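{- Let $\mathbb{K}$ be a commutative $\mathbb{Q}$-algebra, let $a \in \mathbb{K}[x]$, let $n$ be a positive integer, and let $i\in \mathbb{Z}$. For each positive divisor $d\mid n$, let $m_d \in \mathbb{K}[x]$ be such that $m_d \equiv a \pmod{\Phi_d(x)}$. Then $$\mathbf{S}^i_n(a)=\frac{1}{n}\sum_{d\mid n}{G^d_i(m_d)}.$$
   Context: $\Phi_d(x)$ denotes the $d$-th cyclotomic polynomial. For $f\in\mathbb{K}[x]$, $[x^s]f$ denotes the coefficient of $x^s$ in $f$, and $\mathbf{S}^i_n(f)=\sum_{j \equiv i \pmod n,\ j\ge 0}[x^j]f$. For an integer $l$ and positive integer $d$, the Ramanujan sum is the integer $c_d(l)=\sum_{e\mid d,\ e\mid l}\mu(d/e)\,e$ (with $\mu$ the Möbius function), regarded as an element of $\mathbb{K}$. For $m\in\mathbb{K}[x]$, $i\in\mathbb{Z}$ and a positive integer $d$, define $G^d_i(m)=\sum_{s\ge 0}[x^s]m\cdot c_d(i-s)$. -}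

module Defs where

open import Level using (Level)
open import Data.Bool using (Bool; true; false; if_then_else_; _∧_)
open import Data.Nat as ℕ using (ℕ; zero; suc)
open import Data.Nat.Divisibility using (_∣?_)
open import Data.Nat.Primality using (prime?)
open import Data.Integer as ℤ using (ℤ; +_; -[1+_]; ∣_∣)
open import Data.List using (List; []; _∷_; _++_; map; foldr; filterᵇ; upTo; length; replicate; take)
open import Data.Bool.ListAction using (any)
open import Data.Rational as ℚ using (ℚ)
open import Relation.Nullary.Decidable using (⌊_⌋)
open import Algebra.Bundles using (CommutativeRing)

-- Generic dense univariate polynomials as coefficient lists
-- (the list  a₀ ∷ a₁ ∷ … ∷ aₖ ∷ []  represents  a₀ + a₁ x + … + aₖ xᵏ;
--  trailing zeros are allowed, equality is coefficientwise).

module PolyOps {a} {A : Set a} (0# : A) (_+_ _*_ : A → A → A) (-_ : A → A) where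

  coeff : List A → ℕ → A
  coeff []       _       = 0#
  coeff (c ∷ p)  zero    = c
  coeff (c ∷ p)  (suc s) = coeff p s

  padd : List A → List A → List A
  padd []       q        = q
  padd (c ∷ p)  []       = c ∷ p
  padd (c ∷ p)  (e ∷ q)  = (c + e) ∷ padd p q

  pneg : List A → List A
  pneg = map -_

  psub : List A → List A → List A
  psub p q = padd p (pneg q)

  pmul : List A → List A → List A
  pmul []       q = []
  pmul (c ∷ p)  q = padd (map (c *_) q) (0# ∷ pmul p q)

  sumTo : ℕ → (ℕ → A) → A
  sumTo zero    f = 0#
  sumTo (suc k) f = sumTo k f + f k

module PZ = PolyOps (+ 0) ℤ._+_ ℤ._*_ ℤ.-_

_∣ᵇ_ : ℕ → ℕ → Bool
m ∣ᵇ n = ⌊ m ∣? n ⌋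

hasSquareFactor : ℕ → Bool
hasSquareFactor n = any (λ k → (k ℕ.* k) ∣ᵇ n) (map (2 ℕ.+_) (upTo n))

numPrimeDivisors : ℕ → ℕ
numPrimeDivisors n = length (filterᵇ (λ p → ⌊ prime? p ⌋ ∧ (p ∣ᵇ n)) (upTo (suc n)))

μ : ℕ → ℤ
μ n = if hasSquareFactor n then + 0 else (ℤ.-1ℤ ℤ.^ numPrimeDivisors n)

-- Positive divisors of d, written as  suc k  (k < d).
divisorsPred : ℕ → List ℕ
divisorsPred d = filterᵇ (λ k → suc k ∣ᵇ d) (upTo d)

-- Ramanujan sum  c_d(l) = Σ_{e ∣ d, e ∣ l} μ(d/e) e   (d ≥ 1, l ∈ ℤ)
ramanujan : ℕ → ℤ → ℤ
ramanujan d l =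
  foldr ℤ._+_ (+ 0)
    (map (λ k → μ (d ℕ./ suc k) ℤ.* (+ suc k))
         (filterᵇ (λ k → suc k ∣ᵇ ∣ l ∣) (divisorsPred d)))

-- Cyclotomic polynomials over ℤ, via the Möbius product formula
--   Φ_d(x) = ∏_{e ∣ d} (x^e - 1)^{μ(d/e)}       (d ≥ 1)
-- computed in ℤ[[x]] modulo x^{d+1}; since deg Φ_d = φ(d) ≤ d this
-- truncation is exactly Φ_d.  (x^e - 1)^{-1} = -(1 + x^e + x^{2e} + …).

xPowMinusOne : ℕ → List ℤ
xPowMinusOne zero    = + 0 ∷ []
xPowMinusOne (suc k) = ℤ.-1ℤ ∷ (replicate k (+ 0) ++ (+ 1 ∷ []))

invXPowMinusOne : ℕ → ℕ → List ℤ
invXPowMinusOne e D = map (λ j → if suc e ∣ᵇ j then ℤ.-1ℤ else + 0) (upTo (suc D))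

cycloFactor : ℕ → ℕ → List ℤ       -- factor for the divisor e = suc k of d
cycloFactor d k with μ (d ℕ./ suc k)
... | + 1     = xPowMinusOne (suc k)
... | -[1+ 0 ] = invXPowMinusOne k d
... | _       = + 1 ∷ []

cyclotomic : ℕ → List ℤ
cyclotomic d = take (suc d) (foldr PZ.pmul (+ 1 ∷ []) (map (cycloFactor d) (divisorsPred d)))

-- Objects over a commutative ring K equipped with a map φ : ℚ → K
-- (the ℚ-algebra structure map).

module QAlg {c ℓ} (K : CommutativeRing c ℓ) (φ : ℚ → CommutativeRing.Carrier K) where
  open CommutativeRing K
  open PolyOps 0# _+_ _*_ -_ public

  Poly : Set c
  Poly = List Carrier

  ι : ℤ → Carrier
  ι z = φ (z ℚ./ 1)

  Φ : ℕ → Poly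
  Φ d = map ι (cyclotomic d)

  _≡_mod_ : Poly → Poly → Poly → Set (c Level.⊔ ℓ)
  p ≡ q mod r = Data.Product.Σ Poly (λ t → (s : ℕ) → coeff (psub p q) s ≈ coeff (pmul t r) s)
    where import Data.Product

  S : ℤ → ℕ → Poly → Carrier
  S i n f = sumTo (length f) (λ j → if n ∣ᵇ ∣ (+ j) ℤ.- i ∣ then coeff f j else 0#)

  G : ℕ → ℤ → Poly → Carrier
  G d i m = sumTo (length m) (λ s → coeff m s * ι (ramanujan d (i ℤ.- (+ s))))

  sumDivisors : ℕ → (ℕ → Carrier) → Carrier
  sumDivisors n f = foldr _+_ 0# (map (λ k → f (suc k)) (divisorsPred n))

{-# OPTIONS --safe #-}

-- Writing S^i_n(a) = ∑_s [x^s]a · [n ∣ s - i] and using ∑_{d ∣ n} c_d(N) = n [n ∣ N], the identity reduces to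
-- G^d_i(m_d) = G^d_i(a), i.e. to ∑_s [x^s]Φ_d · c_d(l - s) = 0 for all l. The divisor sum follows by induction along
-- the prime factorisation from c_{jp}(N) = [p ∣ N] p c_j(N/p) - [p ∤ j] c_j(N).
--
-- For the annihilation, view Φ_d = ∏_{e ∣ d} (x^e - 1)^{μ(d/e)} in ℤ[[x]]: its logarithmic derivative is
-- x Φ_d′ / Φ_d = -∑_{N ≥ 1} c_d(N) xᴺ, so once Φ_d is a polynomial, comparing coefficients beyond its degree
-- (Newton's identities) kills the pairing for large l, and periodicity of c_d kills it for all l.
-- Polynomiality goes along the prime factorisation as well: uniqueness of series with a given logarithmic derivative
-- gives Φ_{mp} = ±Φ_m(x^p) if p ∣ m and Φ_{mp} Φ_m = ±Φ_m(x^p) if p ∤ m. In the latter case Φ_m(x^p) also annihilates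
-- c_m, and every polynomial annihilating c_m is a multiple of Φ_m: the remainder R modulo Φ_m satisfies
-- R · θΦ_m = Φ_m · (R · θΦ_m/Φ_m) with both factors polynomial, and the Bézout relation Φ_m A + θΦ_m D = ±m coming from
-- Φ_m D = ±(x^m - 1) then forces Φ_m ∣ m R, hence R = 0 by degree.

module Submission where

module RamanujanSums where

  open import Data.Nat as ℕ using (ℕ; zero; suc; _≤_; _<_; z≤n; s≤s; NonZero)
  import Data.Nat.Properties as ℕP
  open import Data.Nat.DivMod using (_/_; m*n/n≡m; m*n/o*n≡m/o)
  open import Data.Nat.Divisibility as ND using (_∣_; _∣?_; divides)
  open import Data.Nat.Primality
    using (Prime; prime?; euclidsLemma; prime⇒irreducible; prime⇒nonZero; prime⇒nonTrivial; ¬prime[1]; productOfPrimes≢0)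
  open import Data.Nat.Primality.Factorisation using (factorise)
  open import Data.Nat.Coprimality as NC using (Coprime; coprime-divisor)
  open import Data.Integer as ℤ using (ℤ; +_; -[1+_]; _+_; _*_; -_; _-_)
  import Data.Integer.Properties as ℤP
  import Data.Integer.Divisibility.Signed as ℤD
  open import Data.Integer.Tactic.RingSolver using (solve-∀)
  open import Data.Bool using (Bool; true; false; if_then_else_; not; _∧_; _∨_)
  open import Data.Bool.Properties using (∨-zeroʳ)
  open import Data.Bool.ListAction using (any)
  open import Data.List using ([]; _∷_; foldr; map; filterᵇ; applyUpTo; upTo; length)
  open import Data.Nat.ListAction using (product)
  open import Data.List.Relation.Unary.All using (All; []; _∷_)
  open import Data.Empty using (⊥-elim)
  open import Data.Sum using (_⊎_; inj₁; inj₂)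
  open import Data.Product using (_×_; _,_; ∃)
  open import Relation.Binary.PropositionalEquality
  open import Relation.Nullary using (¬_; yes; no)
  open import Relation.Nullary.Decidable using (⌊_⌋)
  open import Defs

  ∑ : ℕ → (ℕ → ℤ) → ℤ
  ∑ zero    f = + 0
  ∑ (suc n) f = f 0 + ∑ n (λ k → f (suc k))

  ∑-cong-< : ∀ n {f g : ℕ → ℤ} → (∀ k → k < n → f k ≡ g k) → ∑ n f ≡ ∑ n g
  ∑-cong-< zero    h = refl
  ∑-cong-< (suc n) h = cong₂ _+_ (h 0 (s≤s z≤n)) (∑-cong-< n (λ k k<n → h (suc k) (s≤s k<n)))

  ∑-cong : ∀ n {f g : ℕ → ℤ} → (∀ k → f k ≡ g k) → ∑ n f ≡ ∑ n g
  ∑-cong n h = ∑-cong-< n (λ k _ → h k)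

  ∑-zero : ∀ n {f : ℕ → ℤ} → (∀ k → k < n → f k ≡ + 0) → ∑ n f ≡ + 0
  ∑-zero zero    h = refl
  ∑-zero (suc n) h = cong₂ _+_ (h 0 (s≤s z≤n)) (∑-zero n (λ k k<n → h (suc k) (s≤s k<n)))

  ∑-+ : ∀ n (f g : ℕ → ℤ) → ∑ n (λ k → f k + g k) ≡ ∑ n f + ∑ n g
  ∑-+ zero    f g = refl
  ∑-+ (suc n) f g =
    trans (cong (_+_ (f 0 + g 0)) (∑-+ n (λ k → f (suc k)) (λ k → g (suc k)))) (interchange (f 0) (g 0) _ _)
    where
    interchange : ∀ a b c d → (a + b) + (c + d) ≡ (a + c) + (b + d)
    interchange = solve-∀

  ∑-*ˡ : ∀ n a (f : ℕ → ℤ) → ∑ n (λ k → a * f k) ≡ a * ∑ n f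
  ∑-*ˡ zero    a f = sym (ℤP.*-zeroʳ a)
  ∑-*ˡ (suc n) a f = trans (cong (_+_ (a * f 0)) (∑-*ˡ n a (λ k → f (suc k)))) (sym (ℤP.*-distribˡ-+ a (f 0) _))

  ∑-neg : ∀ n (f : ℕ → ℤ) → ∑ n (λ k → - f k) ≡ - ∑ n f
  ∑-neg zero    f = refl
  ∑-neg (suc n) f = trans (cong (_+_ (- f 0)) (∑-neg n (λ k → f (suc k)))) (sym (ℤP.neg-distrib-+ (f 0) _))

  ∑-split : ∀ a b (f : ℕ → ℤ) → ∑ (a ℕ.+ b) f ≡ ∑ a f + ∑ b (λ k → f (a ℕ.+ k))
  ∑-split zero    b f = sym (ℤP.+-identityˡ _)
  ∑-split (suc a) b f = trans (cong (_+_ (f 0)) (∑-split a b (λ k → f (suc k)))) (sym (ℤP.+-assoc (f 0) _ _))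

  ∑-snoc : ∀ n (f : ℕ → ℤ) → ∑ (suc n) f ≡ ∑ n f + f n
  ∑-snoc n f = begin
    ∑ (suc n) f                    ≡⟨ cong (λ k → ∑ k f) (ℕP.+-comm 1 n) ⟩
    ∑ (n ℕ.+ 1) f                  ≡⟨ ∑-split n 1 f ⟩
    ∑ n f + (f (n ℕ.+ 0) + + 0)    ≡⟨ cong (λ x → ∑ n f + x) (trans (ℤP.+-identityʳ _) (cong f (ℕP.+-identityʳ n))) ⟩
    ∑ n f + f n                    ∎
    where open ≡-Reasoning

  ∑-truncate : ∀ a n (f : ℕ → ℤ) → a ≤ n → (∀ k → a ≤ k → f k ≡ + 0) → ∑ n f ≡ ∑ a f
  ∑-truncate a n f a≤n h = begin
    ∑ n f                                     ≡⟨ cong (λ k → ∑ k f) (sym (ℕP.m+[n∸m]≡n a≤n)) ⟩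
    ∑ (a ℕ.+ (n ℕ.∸ a)) f                     ≡⟨ ∑-split a (n ℕ.∸ a) f ⟩
    ∑ a f + ∑ (n ℕ.∸ a) (λ k → f (a ℕ.+ k))  ≡⟨ cong (_+_ (∑ a f)) (∑-zero (n ℕ.∸ a) (λ k _ → h (a ℕ.+ k) (ℕP.m≤m+n a k))) ⟩
    ∑ a f + + 0                               ≡⟨ ℤP.+-identityʳ _ ⟩
    ∑ a f                                     ∎
    where open ≡-Reasoning

  ∑-multiples : ∀ p .{{_ : NonZero p}} B (f : ℕ → ℤ) → (∀ k → ¬ (p ∣ k) → f k ≡ + 0) →
                ∑ (B ℕ.* p) f ≡ ∑ B (λ j → f (j ℕ.* p))
  ∑-multiples p       zero    f h = refl
  ∑-multiples (suc q) (suc B) f h =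
    trans (∑-split (suc q) (B ℕ.* suc q) f) (cong₂ _+_ first-block (∑-multiples (suc q) B _ h′))
    where
    first-block : ∑ (suc q) f ≡ f 0
    first-block = trans (cong (_+_ (f 0)) (∑-zero q (λ k k<q → h (suc k) (ND.>⇒∤ (s≤s k<q))))) (ℤP.+-identityʳ _)
    h′ : ∀ k → ¬ (suc q ∣ k) → f (suc q ℕ.+ k) ≡ + 0
    h′ k q∤k = h (suc q ℕ.+ k) (λ d → q∤k (ND.∣m+n∣m⇒∣n d ND.∣-refl))

  infixl 5 _when_

  _when_ : ℤ → Bool → ℤ
  x when b = if b then x else + 0

  0-when : ∀ b → + 0 when b ≡ + 0
  0-when true  = refl
  0-when false = refl

  when-+ : ∀ b x y → (x + y) when b ≡ (x when b) + (y when b)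
  when-+ true  x y = refl
  when-+ false x y = refl

  when-neg : ∀ b x → (- x) when b ≡ - (x when b)
  when-neg true  x = refl
  when-neg false x = refl

  when-*ˡ : ∀ b a x → (a * x) when b ≡ a * (x when b)
  when-*ˡ true  a x = refl
  when-*ˡ false a x = sym (ℤP.*-zeroʳ a)

  foldr-+-applyUpTo : ∀ n (g : ℕ → ℤ) (f : ℕ → ℕ) → foldr _+_ (+ 0) (map g (applyUpTo f n)) ≡ ∑ n (λ k → g (f k))
  foldr-+-applyUpTo zero    g f = refl
  foldr-+-applyUpTo (suc n) g f = cong (_+_ (g (f 0))) (foldr-+-applyUpTo n g (λ k → f (suc k)))

  foldr-+-filterᵇ : ∀ {A : Set} (P : A → Bool) (g : A → ℤ) xs →
    foldr _+_ (+ 0) (map g (filterᵇ P xs)) ≡ foldr _+_ (+ 0) (map (λ x → g x when P x) xs)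
  foldr-+-filterᵇ P g []       = refl
  foldr-+-filterᵇ P g (x ∷ xs) with P x
  ... | true  = cong (_+_ (g x)) (foldr-+-filterᵇ P g xs)
  ... | false = trans (foldr-+-filterᵇ P g xs) (sym (ℤP.+-identityˡ _))

  ∣⇒∣ᵇ≡true : ∀ {m n} → m ∣ n → (m ∣ᵇ n) ≡ true
  ∣⇒∣ᵇ≡true {m} {n} m∣n with m ∣? n
  ... | yes _   = refl
  ... | no m∤n  = ⊥-elim (m∤n m∣n)

  ∤⇒∣ᵇ≡false : ∀ {m n} → ¬ (m ∣ n) → (m ∣ᵇ n) ≡ false
  ∤⇒∣ᵇ≡false {m} {n} m∤n with m ∣? n
  ... | yes m∣n = ⊥-elim (m∤n m∣n)
  ... | no _    = refl

  ∣ᵇ≡true⇒∣ : ∀ {m n} → (m ∣ᵇ n) ≡ true → m ∣ n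
  ∣ᵇ≡true⇒∣ {m} {n} eq with m ∣? n
  ... | yes m∣n = m∣n

  ∣ᵇ-cong : ∀ {m n m′ n′} → (m ∣ n → m′ ∣ n′) → (m′ ∣ n′ → m ∣ n) → (m ∣ᵇ n) ≡ (m′ ∣ᵇ n′)
  ∣ᵇ-cong {m} {n} {m′} {n′} to from with m ∣? n | m′ ∣? n′
  ... | yes _   | yes _   = refl
  ... | no _    | no _    = refl
  ... | yes m∣n | no m′∤n′ = ⊥-elim (m′∤n′ (to m∣n))
  ... | no m∤n  | yes m′∣n′ = ⊥-elim (m∤n (from m′∣n′))

  0∤ : ∀ n .{{_ : NonZero n}} → ¬ (0 ∣ n)
  0∤ n 0∣n = ℕ.≢-nonZero⁻¹ n (ND.0∣⇒≡0 0∣n)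

  ∣-nonZero : ∀ {m} n .{{_ : NonZero n}} → m ∣ n → NonZero m
  ∣-nonZero {zero}  n 0∣n = ⊥-elim (0∤ n 0∣n)
  ∣-nonZero {suc m} n _   = _

  prime≥2 : ∀ {p} → Prime p → 2 ≤ p
  prime≥2 pp = ℕ.nonTrivial⇒n>1 _ {{prime⇒nonTrivial pp}}

  prime∤⇒coprime : ∀ {p n} → Prime p → ¬ (p ∣ n) → Coprime p n
  prime∤⇒coprime pp p∤n {d} (d∣p , d∣n) with prime⇒irreducible pp d∣p
  ... | inj₁ d≡1 = d≡1
  ... | inj₂ refl = ⊥-elim (p∤n d∣n)

  ∣*prime⇒∣ : ∀ {p e} m → Prime p → ¬ (p ∣ e) → e ∣ m ℕ.* p → e ∣ m
  ∣*prime⇒∣ {p} {e} m pp p∤e e∣mp = coprime-divisor (NC.sym (prime∤⇒coprime pp p∤e)) (subst (e ∣_) (ℕP.*-comm m p) e∣mp)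

  prime-induction : (P : ℕ → Set) → P 1 →
    (∀ {p} m .{{_ : NonZero m}} → Prime p → P m → P (m ℕ.* p)) → ∀ n .{{_ : NonZero n}} → P n
  prime-induction P base step n with factorise n
  ... | record { factors = ps ; isFactorisation = n≡∏ps ; factorsPrime = ps-prime } =
    subst P (sym n≡∏ps) (go ps ps-prime)
    where
    go : ∀ ps → All Prime ps → P (product ps)
    go []       []        = base
    go (p ∷ ps) (pp ∷ ps-prime) =
      subst P (ℕP.*-comm (product ps) p) (step (product ps) {{productOfPrimes≢0 ps-prime}} pp (go ps ps-prime))

  μ-values : ∀ n → μ n ≡ + 0 ⊎ μ n ≡ + 1 ⊎ μ n ≡ -[1+ 0 ]
  μ-values n with hasSquareFactor n
  ... | true  = inj₁ refl
  ... | false = inj₂ (sign-power (numPrimeDivisors n))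
    where
    sign-power : ∀ k → ℤ.-1ℤ ℤ.^ k ≡ + 1 ⊎ ℤ.-1ℤ ℤ.^ k ≡ -[1+ 0 ]
    sign-power zero    = inj₁ refl
    sign-power (suc k) with sign-power k
    ... | inj₁ eq = inj₂ (cong (ℤ.-1ℤ *_) eq)
    ... | inj₂ eq = inj₁ (cong (ℤ.-1ℤ *_) eq)

  any-shifted-intro : ∀ (P : ℕ → Bool) n (f : ℕ → ℕ) j → j < n → P (2 ℕ.+ f j) ≡ true →
                      any P (map (2 ℕ.+_) (applyUpTo f n)) ≡ true
  any-shifted-intro P (suc n) f zero    _         Pj rewrite Pj = refl
  any-shifted-intro P (suc n) f (suc j) (s≤s j<n) Pj =
    trans (cong (P (2 ℕ.+ f 0) ∨_) (any-shifted-intro P n (λ k → f (suc k)) j j<n Pj)) (∨-zeroʳ _)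

  any-shifted-elim : ∀ (P : ℕ → Bool) n (f : ℕ → ℕ) → any P (map (2 ℕ.+_) (applyUpTo f n)) ≡ true →
                     ∃ λ j → P (2 ℕ.+ f j) ≡ true
  any-shifted-elim P (suc n) f any≡true with P (2 ℕ.+ f 0) in P0
  ... | true  = 0 , P0
  ... | false with any-shifted-elim P n (λ k → f (suc k)) any≡true
  ...   | j , Pj = suc j , Pj

  hasSquareFactor-intro : ∀ n .{{_ : NonZero n}} k → 2 ≤ k → k ℕ.* k ∣ n → hasSquareFactor n ≡ true
  hasSquareFactor-intro n k@(suc (suc j)) (s≤s (s≤s z≤n)) k²∣n =
    any-shifted-intro (λ k → (k ℕ.* k) ∣ᵇ n) n (λ x → x) j j<n (∣⇒∣ᵇ≡true k²∣n)
    where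
    j<n : j < n
    j<n = ℕP.<-≤-trans (ℕP.m<n+m j {2} (s≤s z≤n)) (ℕP.≤-trans (ℕP.m≤m*n k k) (ND.∣⇒≤ k²∣n))

  hasSquareFactor-elim : ∀ n → hasSquareFactor n ≡ true → ∃ λ k → 2 ≤ k × k ℕ.* k ∣ n
  hasSquareFactor-elim n sq with any-shifted-elim (λ k → (k ℕ.* k) ∣ᵇ n) n (λ x → x) sq
  ... | j , j²∣n = 2 ℕ.+ j , s≤s (s≤s z≤n) , ∣ᵇ≡true⇒∣ j²∣n

  μ-square : ∀ n .{{_ : NonZero n}} k → 2 ≤ k → k ℕ.* k ∣ n → μ n ≡ + 0
  μ-square n k k≥2 k²∣n rewrite hasSquareFactor-intro n k k≥2 k²∣n = refl

  indicator : Bool → ℤ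
  indicator b = + 1 when b

  isPrimeDivisor : ℕ → ℕ → Bool
  isPrimeDivisor n q = ⌊ prime? q ⌋ ∧ (q ∣ᵇ n)

  numPrimeDivisors-∑ : ∀ n → + numPrimeDivisors n ≡ ∑ (suc n) (λ q → indicator (isPrimeDivisor n q))
  numPrimeDivisors-∑ n = length-filterᵇ (isPrimeDivisor n) (suc n) (λ x → x)
    where
    length-filterᵇ : ∀ (P : ℕ → Bool) n (f : ℕ → ℕ) →
      + length (filterᵇ P (applyUpTo f n)) ≡ ∑ n (λ k → indicator (P (f k)))
    length-filterᵇ P zero    f = refl
    length-filterᵇ P (suc n) f with P (f 0)
    ... | true  = cong (_+_ (+ 1)) (length-filterᵇ P n (λ k → f (suc k)))
    ... | false = trans (length-filterᵇ P n (λ k → f (suc k))) (sym (ℤP.+-identityˡ _))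

  module _ {p} (pp : Prime p) (j : ℕ) .{{_ : NonZero j}} (p∤j : ¬ (p ∣ j)) where

    private
      instance
        p≢0 : NonZero p
        p≢0 = prime⇒nonZero pp

      _≡ᵇ_ : ℕ → ℕ → Bool
      a ≡ᵇ b = ⌊ a ℕP.≟ b ⌋

      primeDivisor-split : ∀ q → indicator (isPrimeDivisor (p ℕ.* j) q) ≡ indicator (q ≡ᵇ p) + indicator (isPrimeDivisor j q)
      primeDivisor-split q with prime? q | q ℕP.≟ p
      ... | no ¬pq | yes refl = ⊥-elim (¬pq pp)
      ... | no _   | no _     = refl
      ... | yes _  | yes refl rewrite ∣⇒∣ᵇ≡true (ND.m∣m*n {p} j) | ∤⇒∣ᵇ≡false p∤j = refl
      ... | yes pq | no q≢p with q ∣? (p ℕ.* j) | q ∣? j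
      ...   | yes _   | yes _   = refl
      ...   | no _    | no _    = refl
      ...   | no q∤pj | yes q∣j = ⊥-elim (q∤pj (ND.∣-trans q∣j (ND.n∣m*n p)))
      ...   | yes q∣pj | no q∤j with euclidsLemma p j pq q∣pj
      ...     | inj₂ q∣j = ⊥-elim (q∤j q∣j)
      ...     | inj₁ q∣p with prime⇒irreducible pp q∣p
      ...       | inj₁ refl = ⊥-elim (¬prime[1] pq)
      ...       | inj₂ q≡p  = ⊥-elim (q≢p q≡p)

      count-p : ∀ N → p < N → ∑ N (λ q → indicator (q ≡ᵇ p)) ≡ + 1
      count-p N p<N = begin
        ∑ N (λ q → indicator (q ≡ᵇ p))                   ≡⟨ ∑-truncate (suc p) N _ p<N (λ k p<k → off k (λ k≡p → ℕP.<⇒≢ p<k (sym k≡p))) ⟩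
        ∑ (suc p) (λ q → indicator (q ≡ᵇ p))             ≡⟨ ∑-snoc p _ ⟩
        ∑ p (λ q → indicator (q ≡ᵇ p)) + indicator (p ≡ᵇ p) ≡⟨ cong₂ _+_ (∑-zero p (λ k k<p → off k (ℕP.<⇒≢ k<p))) on ⟩
        + 1                                                ∎
        where
        open ≡-Reasoning
        off : ∀ k → k ≢ p → indicator (k ≡ᵇ p) ≡ + 0
        off k k≢p with k ℕP.≟ p
        ... | yes k≡p = ⊥-elim (k≢p k≡p)
        ... | no _    = refl
        on : indicator (p ≡ᵇ p) ≡ + 1
        on with p ℕP.≟ p
        ... | yes _   = refl
        ... | no p≢p  = ⊥-elim (p≢p refl)

      count-divisors-of-j : ∑ (suc (p ℕ.* j)) (λ q → indicator (isPrimeDivisor j q)) ≡ ∑ (suc j) (λ q → indicator (isPrimeDivisor j q))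
      count-divisors-of-j = ∑-truncate (suc j) (suc (p ℕ.* j)) _ (s≤s (ℕP.m≤n*m j p)) beyond-j
        where
        beyond-j : ∀ k → suc j ≤ k → indicator (isPrimeDivisor j k) ≡ + 0
        beyond-j k j<k with prime? k
        ... | no _ = refl
        ... | yes _ rewrite ∤⇒∣ᵇ≡false (ND.>⇒∤ {j} {k} j<k) = refl

    numPrimeDivisors-prime* : numPrimeDivisors (p ℕ.* j) ≡ suc (numPrimeDivisors j)
    numPrimeDivisors-prime* = ℤP.+-injective (begin
      + numPrimeDivisors (p ℕ.* j)                                  ≡⟨ numPrimeDivisors-∑ (p ℕ.* j) ⟩
      ∑ (suc (p ℕ.* j)) (λ q → indicator (isPrimeDivisor (p ℕ.* j) q)) ≡⟨ ∑-cong (suc (p ℕ.* j)) primeDivisor-split ⟩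
      ∑ (suc (p ℕ.* j)) (λ q → indicator (q ≡ᵇ p) + indicator (isPrimeDivisor j q))
        ≡⟨ ∑-+ (suc (p ℕ.* j)) (λ q → indicator (q ≡ᵇ p)) (λ q → indicator (isPrimeDivisor j q)) ⟩
      ∑ (suc (p ℕ.* j)) (λ q → indicator (q ≡ᵇ p)) + ∑ (suc (p ℕ.* j)) (λ q → indicator (isPrimeDivisor j q))
        ≡⟨ cong₂ _+_ (count-p (suc (p ℕ.* j)) (s≤s (ℕP.m≤m*n p j))) count-divisors-of-j ⟩
      + 1 + ∑ (suc j) (λ q → indicator (isPrimeDivisor j q))        ≡⟨ cong (_+_ (+ 1)) (sym (numPrimeDivisors-∑ j)) ⟩
      + suc (numPrimeDivisors j)                                     ∎)
      where open ≡-Reasoning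

    squarefree-prime* : hasSquareFactor j ≡ false → hasSquareFactor (p ℕ.* j) ≡ false
    squarefree-prime* j-squarefree with hasSquareFactor (p ℕ.* j) in sq
    ... | false = refl
    ... | true with hasSquareFactor-elim (p ℕ.* j) sq
    ...   | k , k≥2 , k²∣pj with p ∣? k
    ...     | yes (divides r refl) = ⊥-elim (p∤j (ND.*-cancelˡ-∣ p (ND.∣-trans p²∣k² k²∣pj)))
      where
      p²∣k² : p ℕ.* p ∣ (r ℕ.* p) ℕ.* (r ℕ.* p)
      p²∣k² = ND.*-pres-∣ (ND.n∣m*n r) (ND.n∣m*n r)
    ...     | no p∤k = ⊥-elim (false≢true (trans (sym j-squarefree) (hasSquareFactor-intro j k k≥2 k²∣j)))
      where
      false≢true : false ≢ true
      false≢true ()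
      p∤k² : ¬ (p ∣ k ℕ.* k)
      p∤k² p∣k² with euclidsLemma k k pp p∣k²
      ... | inj₁ p∣k = p∤k p∣k
      ... | inj₂ p∣k = p∤k p∣k
      k²∣j : k ℕ.* k ∣ j
      k²∣j = coprime-divisor (NC.sym (prime∤⇒coprime pp p∤k²)) k²∣pj

    μ-prime*-coprime : μ (p ℕ.* j) ≡ - μ j
    μ-prime*-coprime with hasSquareFactor j in sq
    ... | true with hasSquareFactor-elim j sq
    ...   | k , k≥2 , k²∣j
      rewrite hasSquareFactor-intro (p ℕ.* j) {{ℕP.m*n≢0 p j}} k k≥2 (ND.∣-trans k²∣j (ND.n∣m*n p)) = refl
    μ-prime*-coprime | false rewrite squarefree-prime* sq | numPrimeDivisors-prime* =
      ℤP.-1*i≡-i (ℤ.-1ℤ ℤ.^ numPrimeDivisors j)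

  ∑∣ : ℕ → (ℕ → ℤ) → ℤ
  ∑∣ n g = ∑ (suc n) (λ e → g e when (e ∣ᵇ n))

  ∑∣-cong : ∀ n {g h : ℕ → ℤ} → (∀ e → e ∣ n → g e ≡ h e) → ∑∣ n g ≡ ∑∣ n h
  ∑∣-cong n {g} {h} g≗h = ∑-cong (suc n) on-divisors
    where
    on-divisors : ∀ e → g e when (e ∣ᵇ n) ≡ h e when (e ∣ᵇ n)
    on-divisors e with e ∣? n
    ... | yes e∣n = g≗h e e∣n
    ... | no _    = refl

  ∑∣-+ : ∀ n (g h : ℕ → ℤ) → ∑∣ n (λ e → g e + h e) ≡ ∑∣ n g + ∑∣ n h
  ∑∣-+ n g h = trans (∑-cong (suc n) (λ e → when-+ (e ∣ᵇ n) (g e) (h e)))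
                     (∑-+ (suc n) (λ e → g e when (e ∣ᵇ n)) (λ e → h e when (e ∣ᵇ n)))

  ∑∣-neg : ∀ n (g : ℕ → ℤ) → ∑∣ n (λ e → - g e) ≡ - ∑∣ n g
  ∑∣-neg n g = trans (∑-cong (suc n) (λ e → when-neg (e ∣ᵇ n) (g e))) (∑-neg (suc n) (λ e → g e when (e ∣ᵇ n)))

  ∑∣-*ˡ : ∀ n a (g : ℕ → ℤ) → ∑∣ n (λ e → a * g e) ≡ a * ∑∣ n g
  ∑∣-*ˡ n a g = trans (∑-cong (suc n) (λ e → when-*ˡ (e ∣ᵇ n) a (g e))) (∑-*ˡ (suc n) a (λ e → g e when (e ∣ᵇ n)))

  ∑∣-when : ∀ n b (g : ℕ → ℤ) → ∑∣ n (λ e → g e when b) ≡ ∑∣ n g when b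
  ∑∣-when n true  g = refl
  ∑∣-when n false g = ∑-zero (suc n) (λ e _ → 0-when (e ∣ᵇ n))

  ∑∣-extend : ∀ n .{{_ : NonZero n}} B (g : ℕ → ℤ) → suc n ≤ B → ∑ B (λ e → g e when (e ∣ᵇ n)) ≡ ∑∣ n g
  ∑∣-extend n B g n<B = ∑-truncate (suc n) B (λ e → g e when (e ∣ᵇ n)) n<B beyond-n
    where
    beyond-n : ∀ k → suc n ≤ k → g k when (k ∣ᵇ n) ≡ + 0
    beyond-n k n<k rewrite ∤⇒∣ᵇ≡false (ND.>⇒∤ {n} {k} n<k) = refl

  foldr-divisorsPred : ∀ n .{{_ : NonZero n}} (g : ℕ → ℤ) →
    foldr _+_ (+ 0) (map (λ k → g (suc k)) (divisorsPred n)) ≡ ∑∣ n g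
  foldr-divisorsPred n g = begin
    foldr _+_ (+ 0) (map (λ k → g (suc k)) (divisorsPred n))
      ≡⟨ foldr-+-filterᵇ (λ k → suc k ∣ᵇ n) (λ k → g (suc k)) (upTo n) ⟩
    foldr _+_ (+ 0) (map (λ k → g (suc k) when (suc k ∣ᵇ n)) (upTo n))
      ≡⟨ foldr-+-applyUpTo n _ (λ k → k) ⟩
    ∑ n (λ k → g (suc k) when (suc k ∣ᵇ n))
      ≡⟨ sym (ℤP.+-identityˡ _) ⟩
    + 0 + ∑ n (λ k → g (suc k) when (suc k ∣ᵇ n))
      ≡⟨ cong (λ b → (g 0 when b) + ∑ n (λ k → g (suc k) when (suc k ∣ᵇ n))) (sym (∤⇒∣ᵇ≡false (0∤ n))) ⟩
    ∑∣ n g ∎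
    where open ≡-Reasoning

  ∑∣-prime-split : ∀ {p} → Prime p → ∀ m .{{_ : NonZero m}} (g : ℕ → ℤ) →
    ∑∣ (m ℕ.* p) g ≡ ∑∣ m (λ e → g e when not (p ∣ᵇ e)) + ∑∣ m (λ j → g (j ℕ.* p))
  ∑∣-prime-split {p} pp m g = begin
    ∑∣ (m ℕ.* p) g                                   ≡⟨ sym (∑∣-extend (m ℕ.* p) (suc m ℕ.* p) g m*p<[1+m]*p) ⟩
    ∑ (suc m ℕ.* p) (λ e → g e when (e ∣ᵇ (m ℕ.* p))) ≡⟨ ∑-cong (suc m ℕ.* p) split ⟩
    ∑ (suc m ℕ.* p) (λ e → A e + B e)                ≡⟨ ∑-+ (suc m ℕ.* p) A B ⟩
    ∑ (suc m ℕ.* p) A + ∑ (suc m ℕ.* p) B            ≡⟨ cong₂ _+_ (∑∣-extend m (suc m ℕ.* p) _ (ℕP.m≤m*n (suc m) p))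
                                                                  (∑-multiples p (suc m) B B-off-multiples) ⟩
    ∑∣ m (λ e → g e when not (p ∣ᵇ e)) + ∑ (suc m) (λ j → B (j ℕ.* p))
                                                      ≡⟨ cong (_+_ (∑∣ m (λ e → g e when not (p ∣ᵇ e)))) (∑-cong (suc m) B-on-multiples) ⟩
    ∑∣ m (λ e → g e when not (p ∣ᵇ e)) + ∑∣ m (λ j → g (j ℕ.* p)) ∎
    where
    open ≡-Reasoning
    instance
      p≢0 : NonZero p
      p≢0 = prime⇒nonZero pp
      m*p≢0 : NonZero (m ℕ.* p)
      m*p≢0 = ℕP.m*n≢0 m p
    m*p<[1+m]*p : suc (m ℕ.* p) ≤ suc m ℕ.* p
    m*p<[1+m]*p = ℕP.+-monoˡ-≤ (m ℕ.* p) (ℕ.>-nonZero⁻¹ p)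
    A B : ℕ → ℤ
    A e = (g e when not (p ∣ᵇ e)) when (e ∣ᵇ m)
    B e = (g e when ((e / p) ∣ᵇ m)) when (p ∣ᵇ e)
    B-off-multiples : ∀ e → ¬ (p ∣ e) → B e ≡ + 0
    B-off-multiples e p∤e rewrite ∤⇒∣ᵇ≡false p∤e = refl
    B-on-multiples : ∀ j → B (j ℕ.* p) ≡ g (j ℕ.* p) when (j ∣ᵇ m)
    B-on-multiples j rewrite ∣⇒∣ᵇ≡true (ND.n∣m*n j {p}) | m*n/n≡m j p {{p≢0}} = refl
    split : ∀ e → g e when (e ∣ᵇ (m ℕ.* p)) ≡ A e + B e
    split e with p ∣? e
    ... | no p∤e
      rewrite ∣ᵇ-cong {e} {m ℕ.* p} {e} {m} (∣*prime⇒∣ m pp p∤e) (λ e∣m → ND.∣-trans e∣m (ND.m∣m*n p))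
            = sym (ℤP.+-identityʳ _)
    ... | yes (divides j refl)
      rewrite m*n/n≡m j p {{p≢0}}
            | ∣ᵇ-cong {j ℕ.* p} {m ℕ.* p} {j} {m} (ND.*-cancelʳ-∣ p) (ND.*-monoˡ-∣ p)
            = sym (trans (cong (_+ (g (j ℕ.* p) when (j ∣ᵇ m))) (0-when ((j ℕ.* p) ∣ᵇ m))) (ℤP.+-identityˡ _))

  -- Ramanujan sums

  ramanujanTerm : ℕ → ℕ → ℕ → ℤ
  ramanujanTerm d N zero      = + 0
  ramanujanTerm d N e@(suc _) = (μ (d / e) * + e) when (e ∣ᵇ N)

  ramanujan-∑∣ : ∀ d .{{_ : NonZero d}} N → ramanujan d (+ N) ≡ ∑∣ d (ramanujanTerm d N)
  ramanujan-∑∣ d N =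
    trans (foldr-+-filterᵇ (λ k → suc k ∣ᵇ N) (λ k → μ (d / suc k) * + suc k) (divisorsPred d))
          (foldr-divisorsPred d (ramanujanTerm d N))

  ramanujanTerm-≢0 : ∀ d N e .{{_ : NonZero e}} → ramanujanTerm d N e ≡ (μ (d / e) * + e) when (e ∣ᵇ N)
  ramanujanTerm-≢0 d N (suc _) = refl

  module _ {p} (pp : Prime p) (j : ℕ) .{{_ : NonZero j}} (N : ℕ) where

    private
      instance
        p≢0 : NonZero p
        p≢0 = prime⇒nonZero pp

      quotient-*prime : ∀ {e s} .{{_ : NonZero e}} → j ≡ s ℕ.* e → (j ℕ.* p) / e ≡ p ℕ.* s
      quotient-*prime {e} {s} j≡s*e = begin
        (j ℕ.* p) / e         ≡⟨ cong (λ x → (x ℕ.* p) / e) j≡s*e ⟩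
        (s ℕ.* e ℕ.* p) / e   ≡⟨ cong (_/ e) (trans (ℕP.*-assoc s e p) (trans (cong (s ℕ.*_) (ℕP.*-comm e p)) (sym (ℕP.*-assoc s p e)))) ⟩
        (s ℕ.* p ℕ.* e) / e   ≡⟨ m*n/n≡m (s ℕ.* p) e ⟩
        s ℕ.* p               ≡⟨ ℕP.*-comm s p ⟩
        p ℕ.* s               ∎
        where open ≡-Reasoning

      -- A divisor e of j with p ∤ e contributes μ(p · j/e) = -μ(j/e) to c_{jp}, or 0 when p ∣ j.
      coprime-term : ∀ e → e ∣ j →
        ramanujanTerm (j ℕ.* p) N e when not (p ∣ᵇ e) ≡ - (ramanujanTerm j N e when not (p ∣ᵇ j))
      coprime-term zero    0∣j = ⊥-elim (0∤ j 0∣j)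
      coprime-term e@(suc _) e∣j@(divides s j≡s*e) with p ∣? e
      ... | yes p∣e rewrite ∣⇒∣ᵇ≡true (ND.∣-trans p∣e e∣j) = refl
      ... | no p∤e with p ∣? j
      ...   | yes p∣j = begin
        (μ ((j ℕ.* p) / e) * + e) when (e ∣ᵇ N) ≡⟨ cong (λ x → (μ x * + e) when (e ∣ᵇ N)) (quotient-*prime j≡s*e) ⟩
        (μ (p ℕ.* s) * + e) when (e ∣ᵇ N)       ≡⟨ cong (λ x → (x * + e) when (e ∣ᵇ N)) μ[p*s]≡0 ⟩
        + 0 when (e ∣ᵇ N)                       ≡⟨ 0-when (e ∣ᵇ N) ⟩
        + 0                                     ∎
        where
        open ≡-Reasoning
        instance
          s≢0 : NonZero s
          s≢0 = ND.quotient≢0 e∣j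
        p∣s : p ∣ s
        p∣s with euclidsLemma s e pp (subst (p ∣_) j≡s*e p∣j)
        ... | inj₁ p∣s = p∣s
        ... | inj₂ p∣e = ⊥-elim (p∤e p∣e)
        μ[p*s]≡0 : μ (p ℕ.* s) ≡ + 0
        μ[p*s]≡0 = μ-square (p ℕ.* s) {{ℕP.m*n≢0 p s}} p (prime≥2 pp) (ND.*-monoʳ-∣ p p∣s)
      ...   | no p∤j = begin
        (μ ((j ℕ.* p) / e) * + e) when (e ∣ᵇ N) ≡⟨ cong (λ x → (μ x * + e) when (e ∣ᵇ N)) (quotient-*prime j≡s*e) ⟩
        (μ (p ℕ.* s) * + e) when (e ∣ᵇ N)       ≡⟨ cong (λ x → (x * + e) when (e ∣ᵇ N)) (μ-prime*-coprime pp s p∤s) ⟩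
        (- μ s * + e) when (e ∣ᵇ N)             ≡⟨ cong (_when (e ∣ᵇ N)) (sym (ℤP.neg-distribˡ-* (μ s) (+ e))) ⟩
        (- (μ s * + e)) when (e ∣ᵇ N)           ≡⟨ when-neg (e ∣ᵇ N) (μ s * + e) ⟩
        - ((μ s * + e) when (e ∣ᵇ N))           ≡⟨ cong (λ x → - ((μ x * + e) when (e ∣ᵇ N))) s≡j/e ⟩
        - ((μ (j / e) * + e) when (e ∣ᵇ N))     ∎
        where
        open ≡-Reasoning
        instance
          s≢0 : NonZero s
          s≢0 = ND.quotient≢0 e∣j
        p∤s : ¬ (p ∣ s)
        p∤s p∣s = p∤j (ND.∣-trans p∣s (ND.∣-trans (ND.m∣m*n e) (ND.∣-reflexive (sym j≡s*e))))
        s≡j/e : s ≡ j / e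
        s≡j/e = sym (trans (cong (_/ e) j≡s*e) (m*n/n≡m s e))

      multiple-term : ∀ i → i ∣ j → ramanujanTerm (j ℕ.* p) N (i ℕ.* p) ≡ (+ p * ramanujanTerm j (N / p) i) when (p ∣ᵇ N)
      multiple-term zero    0∣j = ⊥-elim (0∤ j 0∣j)
      multiple-term i@(suc _) i∣j
        rewrite ramanujanTerm-≢0 (j ℕ.* p) N (i ℕ.* p) {{ℕP.m*n≢0 i p}}
              | m*n/o*n≡m/o j p i {{_}} {{ℕP.m*n≢0 i p}}
        with p ∣? N
      ... | no p∤N rewrite ∤⇒∣ᵇ≡false {i ℕ.* p} {N} (λ ip∣N → p∤N (ND.∣-trans (ND.n∣m*n i) ip∣N)) = refl
      ... | yes (divides t refl)
        rewrite m*n/n≡m t p {{p≢0}}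
              | ∣ᵇ-cong {i ℕ.* p} {t ℕ.* p} {i} {t} (ND.*-cancelʳ-∣ p) (ND.*-monoˡ-∣ p) = begin
        (μ (j / i) * + (i ℕ.* p)) when (i ∣ᵇ t) ≡⟨ cong (λ x → (μ (j / i) * x) when (i ∣ᵇ t)) (ℤP.pos-* i p) ⟩
        (μ (j / i) * (+ i * + p)) when (i ∣ᵇ t) ≡⟨ cong (_when (i ∣ᵇ t)) (rearrange (μ (j / i)) (+ i) (+ p)) ⟩
        (+ p * (μ (j / i) * + i)) when (i ∣ᵇ t) ≡⟨ when-*ˡ (i ∣ᵇ t) (+ p) _ ⟩
        + p * ((μ (j / i) * + i) when (i ∣ᵇ t)) ∎
        where
        open ≡-Reasoning
        rearrange : ∀ a b c → a * (b * c) ≡ c * (a * b)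
        rearrange = solve-∀

    ramanujan-prime-step :
      (ramanujan j (+ N) when not (p ∣ᵇ j)) + ramanujan (j ℕ.* p) (+ N) ≡ (+ p * ramanujan j (+ (N / p))) when (p ∣ᵇ N)
    ramanujan-prime-step = begin
      X + ramanujan (j ℕ.* p) (+ N)
        ≡⟨ cong (_+_ X) (ramanujan-∑∣ (j ℕ.* p) {{ℕP.m*n≢0 j p}} N) ⟩
      X + ∑∣ (j ℕ.* p) (ramanujanTerm (j ℕ.* p) N)
        ≡⟨ cong (_+_ X) (∑∣-prime-split pp j (ramanujanTerm (j ℕ.* p) N)) ⟩
      X + (∑∣ j (λ e → ramanujanTerm (j ℕ.* p) N e when not (p ∣ᵇ e)) + ∑∣ j (λ i → ramanujanTerm (j ℕ.* p) N (i ℕ.* p)))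
        ≡⟨ cong (λ x → X + x) (cong₂ _+_ (∑∣-cong j coprime-term) (∑∣-cong j multiple-term)) ⟩
      X + (∑∣ j (λ e → - (ramanujanTerm j N e when not (p ∣ᵇ j))) + ∑∣ j (λ i → (+ p * ramanujanTerm j (N / p) i) when (p ∣ᵇ N)))
        ≡⟨ cong (λ x → X + x) (cong₂ _+_ coprime-part multiple-part) ⟩
      X + (- X + Y)
        ≡⟨ cancel X Y ⟩
      Y ∎
      where
      open ≡-Reasoning
      X = ramanujan j (+ N) when not (p ∣ᵇ j)
      Y = (+ p * ramanujan j (+ (N / p))) when (p ∣ᵇ N)
      cancel : ∀ x y → x + (- x + y) ≡ y
      cancel = solve-∀
      coprime-part : ∑∣ j (λ e → - (ramanujanTerm j N e when not (p ∣ᵇ j))) ≡ - X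
      coprime-part = begin
        ∑∣ j (λ e → - (ramanujanTerm j N e when not (p ∣ᵇ j))) ≡⟨ ∑∣-neg j (λ e → ramanujanTerm j N e when not (p ∣ᵇ j)) ⟩
        - ∑∣ j (λ e → ramanujanTerm j N e when not (p ∣ᵇ j))   ≡⟨ cong -_ (∑∣-when j (not (p ∣ᵇ j)) (ramanujanTerm j N)) ⟩
        - (∑∣ j (ramanujanTerm j N) when not (p ∣ᵇ j))         ≡⟨ cong (λ x → - (x when not (p ∣ᵇ j))) (sym (ramanujan-∑∣ j N)) ⟩
        - X                                                     ∎
      multiple-part : ∑∣ j (λ i → (+ p * ramanujanTerm j (N / p) i) when (p ∣ᵇ N)) ≡ Y
      multiple-part = begin
        ∑∣ j (λ i → (+ p * ramanujanTerm j (N / p) i) when (p ∣ᵇ N)) ≡⟨ ∑∣-when j (p ∣ᵇ N) (λ i → + p * ramanujanTerm j (N / p) i) ⟩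
        ∑∣ j (λ i → + p * ramanujanTerm j (N / p) i) when (p ∣ᵇ N)   ≡⟨ cong (_when (p ∣ᵇ N)) (∑∣-*ˡ j (+ p) (ramanujanTerm j (N / p))) ⟩
        (+ p * ∑∣ j (ramanujanTerm j (N / p))) when (p ∣ᵇ N)         ≡⟨ cong (λ x → (+ p * x) when (p ∣ᵇ N)) (sym (ramanujan-∑∣ j (N / p))) ⟩
        Y                                                            ∎

  ramanujan-1 : ∀ N → ramanujan 1 (+ N) ≡ + 1
  ramanujan-1 N = trans (ramanujan-∑∣ 1 N) (cong (λ b → + 0 + (((μ 1 * + 1) when b) + + 0)) (∣⇒∣ᵇ≡true (ND.1∣ N)))

  private
    scale-indicator : ∀ m p .{{_ : NonZero p}} N →
      (+ p * (+ m when (m ∣ᵇ (N / p)))) when (p ∣ᵇ N) ≡ + (m ℕ.* p) when ((m ℕ.* p) ∣ᵇ N)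
    scale-indicator m p {{p≢0}} N with p ∣? N
    ... | no p∤N rewrite ∤⇒∣ᵇ≡false {m ℕ.* p} {N} (λ mp∣N → p∤N (ND.∣-trans (ND.n∣m*n m) mp∣N)) = refl
    ... | yes (divides u refl)
      rewrite m*n/n≡m u p {{p≢0}}
            | ∣ᵇ-cong {m ℕ.* p} {u ℕ.* p} {m} {u} (ND.*-cancelʳ-∣ p) (ND.*-monoˡ-∣ p)
      with m ∣ᵇ u
    ...   | true  = trans (sym (ℤP.pos-* p m)) (cong +_ (ℕP.*-comm p m))
    ...   | false = ℤP.*-zeroʳ (+ p)

  ∑∣-ramanujan : ∀ n .{{_ : NonZero n}} N → ∑∣ n (λ d → ramanujan d (+ N)) ≡ + n when (n ∣ᵇ N)
  ∑∣-ramanujan = prime-induction P base step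
    where
    P : ℕ → Set
    P n = ∀ N → ∑∣ n (λ d → ramanujan d (+ N)) ≡ + n when (n ∣ᵇ N)

    base : P 1
    base N = begin
      + 0 + (ramanujan 1 (+ N) + + 0) ≡⟨ trans (ℤP.+-identityˡ _) (ℤP.+-identityʳ _) ⟩
      ramanujan 1 (+ N)               ≡⟨ ramanujan-1 N ⟩
      + 1                             ≡⟨ cong (+ 1 when_) (sym (∣⇒∣ᵇ≡true (ND.1∣ N))) ⟩
      + 1 when (1 ∣ᵇ N)               ∎
      where open ≡-Reasoning

    step : ∀ {p} m .{{_ : NonZero m}} → Prime p → P m → P (m ℕ.* p)
    step {p} m pp IH N = begin
      ∑∣ (m ℕ.* p) (λ d → c d N)
        ≡⟨ ∑∣-prime-split pp m (λ d → c d N) ⟩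
      ∑∣ m (λ e → c e N when not (p ∣ᵇ e)) + ∑∣ m (λ j → c (j ℕ.* p) N)
        ≡⟨ sym (∑∣-+ m (λ e → c e N when not (p ∣ᵇ e)) (λ j → c (j ℕ.* p) N)) ⟩
      ∑∣ m (λ j → (c j N when not (p ∣ᵇ j)) + c (j ℕ.* p) N)
        ≡⟨ ∑∣-cong m (λ j j∣m → ramanujan-prime-step pp j {{∣-nonZero m j∣m}} N) ⟩
      ∑∣ m (λ j → (+ p * c j (N / p)) when (p ∣ᵇ N))
        ≡⟨ ∑∣-when m (p ∣ᵇ N) (λ j → + p * c j (N / p)) ⟩
      ∑∣ m (λ j → + p * c j (N / p)) when (p ∣ᵇ N)
        ≡⟨ cong (_when (p ∣ᵇ N)) (trans (∑∣-*ˡ m (+ p) (λ j → c j (N / p))) (cong (+ p *_) (IH (N / p)))) ⟩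
      (+ p * (+ m when (m ∣ᵇ (N / p)))) when (p ∣ᵇ N)
        ≡⟨ scale-indicator m p N ⟩
      + (m ℕ.* p) when ((m ℕ.* p) ∣ᵇ N) ∎
      where
      open ≡-Reasoning
      instance
        p≢0 : NonZero p
        p≢0 = prime⇒nonZero pp
      c : ℕ → ℕ → ℤ
      c d N = ramanujan d (+ N)

  ramanujan-cong : ∀ d .{{_ : NonZero d}} M N → (∀ e → e ∣ d → (e ∣ M → e ∣ N) × (e ∣ N → e ∣ M)) →
                   ramanujan d (+ M) ≡ ramanujan d (+ N)
  ramanujan-cong d M N same = begin
    ramanujan d (+ M)         ≡⟨ ramanujan-∑∣ d M ⟩
    ∑∣ d (ramanujanTerm d M)  ≡⟨ ∑∣-cong d term-cong ⟩
    ∑∣ d (ramanujanTerm d N)  ≡⟨ sym (ramanujan-∑∣ d N) ⟩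
    ramanujan d (+ N)         ∎
    where
    open ≡-Reasoning
    term-cong : ∀ e → e ∣ d → ramanujanTerm d M e ≡ ramanujanTerm d N e
    term-cong zero      _   = refl
    term-cong (suc k) e∣d with same (suc k) e∣d
    ... | to , from = cong ((μ (d / suc k) * + suc k) when_) (∣ᵇ-cong to from)

  ramanujan-periodic : ∀ d .{{_ : NonZero d}} z w → (+ d) ℤD.∣ (z - w) → ramanujan d z ≡ ramanujan d w
  ramanujan-periodic d z w d∣z-w = ramanujan-cong d ℤ.∣ z ∣ ℤ.∣ w ∣ (λ e e∣d → to e e∣d , from e e∣d)
    where
    e∣z-w : ∀ e → e ∣ d → (+ e) ℤD.∣ (z - w)
    e∣z-w e e∣d = ℤD.∣-trans (ℤD.∣ᵤ⇒∣ {+ e} {+ d} e∣d) d∣z-w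
    to : ∀ e → e ∣ d → e ∣ ℤ.∣ z ∣ → e ∣ ℤ.∣ w ∣
    to e e∣d e∣z = ℤD.∣⇒∣ᵤ {+ e} {w} (subst ((+ e) ℤD.∣_) (ℤP.neg-involutive w)
                     (ℤD.∣m⇒∣-m (ℤD.∣m+n∣m⇒∣n (e∣z-w e e∣d) (ℤD.∣ᵤ⇒∣ {+ e} {z} e∣z))))
    from : ∀ e → e ∣ d → e ∣ ℤ.∣ w ∣ → e ∣ ℤ.∣ z ∣
    from e e∣d e∣w = ℤD.∣⇒∣ᵤ {+ e} {z} (ℤD.∣m+n∣n⇒∣m (e∣z-w e e∣d) (ℤD.∣m⇒∣-m (ℤD.∣ᵤ⇒∣ {+ e} {w} e∣w)))

  ramanujan-coprime-scale : ∀ d .{{_ : NonZero d}} q z → Coprime q d → ramanujan d (+ q * z) ≡ ramanujan d z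
  ramanujan-coprime-scale d q z q⊥d = ramanujan-cong d ℤ.∣ + q * z ∣ ℤ.∣ z ∣ (λ e e∣d → to e e∣d , from e)
    where
    ∣qz∣≡q∣z∣ : ℤ.∣ + q * z ∣ ≡ q ℕ.* ℤ.∣ z ∣
    ∣qz∣≡q∣z∣ = ℤP.abs-* (+ q) z
    to : ∀ e → e ∣ d → e ∣ ℤ.∣ + q * z ∣ → e ∣ ℤ.∣ z ∣
    to e e∣d e∣qz = coprime-divisor (λ (a∣e , a∣q) → q⊥d (a∣q , ND.∣-trans a∣e e∣d)) (subst (e ∣_) ∣qz∣≡q∣z∣ e∣qz)
    from : ∀ e → e ∣ ℤ.∣ z ∣ → e ∣ ℤ.∣ + q * z ∣
    from e e∣z = subst (e ∣_) (sym ∣qz∣≡q∣z∣) (ND.∣-trans e∣z (ND.n∣m*n q))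


module Cyclotomic where

  open import Data.Nat as ℕ using (ℕ; zero; suc; _≤_; _<_; z≤n; s≤s; NonZero; _∸_)
  import Data.Nat.Properties as ℕP
  open import Data.Nat.DivMod using (_/_; m*n/n≡m; m≥n⇒m/n>0)
  open import Data.Nat.Divisibility as ND using (_∣_; _∣?_; divides)
  open import Data.Nat.Primality using (Prime; prime⇒nonZero)
  open import Data.Nat.Coprimality as NC using (Coprime)
  open import Data.Nat.GCD using (module Bézout)
  open import Data.Integer as ℤ using (ℤ; +_; -[1+_]; _+_; _*_; -_; _-_)
  import Data.Integer.Properties as ℤP
  import Data.Integer.Divisibility.Signed as ℤD
  open import Data.Integer.Tactic.RingSolver using (solve-∀)
  open import Data.Bool using (true; false; if_then_else_; not)
  open import Data.List using (List; []; _∷_; foldr; map; applyUpTo; take; replicate; _++_; length)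
  open import Data.List.Properties using (length-take)
  open import Data.Empty using (⊥-elim)
  open import Data.Sum using (_⊎_; inj₁; inj₂)
  open import Data.Product using (_×_; _,_; ∃; proj₁; proj₂)
  open import Relation.Binary.PropositionalEquality
  open import Relation.Binary.Bundles using (Setoid)
  import Relation.Binary.Reasoning.Setoid as SetoidReasoning
  open import Relation.Nullary using (¬_; yes; no; Dec)
  open import Defs using (ramanujan; μ; _∣ᵇ_; divisorsPred; cycloFactor; cyclotomic; xPowMinusOne; invXPowMinusOne; module PZ)
  open RamanujanSums

  -- Formal power series over ℤ

  Series : Set
  Series = ℕ → ℤ

  infix 4 _≈_
  _≈_ : Series → Series → Set
  f ≈ g = ∀ N → f N ≡ g N

  ≈-refl : ∀ {f} → f ≈ f
  ≈-refl _ = refl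

  ≈-sym : ∀ {f g} → f ≈ g → g ≈ f
  ≈-sym f≈g N = sym (f≈g N)

  ≈-trans : ∀ {f g h} → f ≈ g → g ≈ h → f ≈ h
  ≈-trans f≈g g≈h N = trans (f≈g N) (g≈h N)

  ≈-setoid : Setoid _ _
  ≈-setoid = record { Carrier = Series ; _≈_ = _≈_
                    ; isEquivalence = record { refl = ≈-refl ; sym = ≈-sym ; trans = ≈-trans } }

  module ≈-Reasoning = SetoidReasoning ≈-setoid

  0ₛ : Series
  0ₛ _ = + 0

  1ₛ : Series
  1ₛ zero    = + 1
  1ₛ (suc _) = + 0

  infixl 6 _⊕_
  infixl 7 _⊛_
  infixr 7 _·_

  _⊕_ : Series → Series → Series
  (f ⊕ g) N = f N + g N

  ⊝ : Series → Series
  ⊝ f N = - f N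

  _·_ : ℤ → Series → Series
  (a · f) N = a * f N

  tailₛ : Series → Series
  tailₛ f N = f (suc N)

  X· : Series → Series
  X· f zero    = + 0
  X· f (suc N) = f N

  _⊛_ : Series → Series → Series
  (f ⊛ g) zero    = f 0 * g 0
  (f ⊛ g) (suc N) = f 0 * g (suc N) + (tailₛ f ⊛ g) N

  θ : Series → Series
  θ f N = + N * f N

  ⊛-coeff : ∀ f g N → (f ⊛ g) N ≡ ∑ (suc N) (λ k → f k * g (N ∸ k))
  ⊛-coeff f g zero    = sym (ℤP.+-identityʳ _)
  ⊛-coeff f g (suc N) = cong (_+_ (f 0 * g (suc N))) (⊛-coeff (tailₛ f) g N)

  ⊛-cong : ∀ {f f′ g g′} → f ≈ f′ → g ≈ g′ → f ⊛ g ≈ f′ ⊛ g′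
  ⊛-cong {f} {f′} {g} {g′} f≈f′ g≈g′ N = begin
    (f ⊛ g) N                            ≡⟨ ⊛-coeff f g N ⟩
    ∑ (suc N) (λ k → f k * g (N ∸ k))    ≡⟨ ∑-cong (suc N) (λ k → cong₂ _*_ (f≈f′ k) (g≈g′ (N ∸ k))) ⟩
    ∑ (suc N) (λ k → f′ k * g′ (N ∸ k))  ≡⟨ sym (⊛-coeff f′ g′ N) ⟩
    (f′ ⊛ g′) N                          ∎
    where open ≡-Reasoning

  ⊛-congˡ : ∀ {f f′} g → f ≈ f′ → f ⊛ g ≈ f′ ⊛ g
  ⊛-congˡ g f≈f′ = ⊛-cong f≈f′ ≈-refl

  ⊛-congʳ : ∀ f {g g′} → g ≈ g′ → f ⊛ g ≈ f ⊛ g′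
  ⊛-congʳ f g≈g′ = ⊛-cong ≈-refl g≈g′

  ⊕-cong : ∀ {f f′ g g′} → f ≈ f′ → g ≈ g′ → f ⊕ g ≈ f′ ⊕ g′
  ⊕-cong f≈f′ g≈g′ N = cong₂ _+_ (f≈f′ N) (g≈g′ N)

  ·-cong : ∀ a {f g} → f ≈ g → a · f ≈ a · g
  ·-cong a f≈g N = cong (a *_) (f≈g N)

  ·-assoc : ∀ a b f → a · (b · f) ≈ (a * b) · f
  ·-assoc a b f N = sym (ℤP.*-assoc a b (f N))

  ⊛-distribʳ-⊕ : ∀ f g h → (f ⊕ g) ⊛ h ≈ f ⊛ h ⊕ g ⊛ h
  ⊛-distribʳ-⊕ f g h N = begin
    ((f ⊕ g) ⊛ h) N                                                   ≡⟨ ⊛-coeff (f ⊕ g) h N ⟩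
    ∑ (suc N) (λ k → (f k + g k) * h (N ∸ k))                         ≡⟨ ∑-cong (suc N) (λ k → ℤP.*-distribʳ-+ (h (N ∸ k)) (f k) (g k)) ⟩
    ∑ (suc N) (λ k → f k * h (N ∸ k) + g k * h (N ∸ k))               ≡⟨ ∑-+ (suc N) (λ k → f k * h (N ∸ k)) (λ k → g k * h (N ∸ k)) ⟩
    ∑ (suc N) (λ k → f k * h (N ∸ k)) + ∑ (suc N) (λ k → g k * h (N ∸ k)) ≡⟨ sym (cong₂ _+_ (⊛-coeff f h N) (⊛-coeff g h N)) ⟩
    (f ⊛ h ⊕ g ⊛ h) N                                                 ∎
    where open ≡-Reasoning

  ⊛-·ˡ : ∀ a f g → (a · f) ⊛ g ≈ a · (f ⊛ g)
  ⊛-·ˡ a f g N = begin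
    ((a · f) ⊛ g) N                          ≡⟨ ⊛-coeff (a · f) g N ⟩
    ∑ (suc N) (λ k → a * f k * g (N ∸ k))    ≡⟨ ∑-cong (suc N) (λ k → ℤP.*-assoc a (f k) (g (N ∸ k))) ⟩
    ∑ (suc N) (λ k → a * (f k * g (N ∸ k)))  ≡⟨ ∑-*ˡ (suc N) a (λ k → f k * g (N ∸ k)) ⟩
    a * ∑ (suc N) (λ k → f k * g (N ∸ k))    ≡⟨ cong (a *_) (sym (⊛-coeff f g N)) ⟩
    (a · (f ⊛ g)) N                          ∎
    where open ≡-Reasoning

  ⊛-⊝ˡ : ∀ f g → ⊝ f ⊛ g ≈ ⊝ (f ⊛ g)
  ⊛-⊝ˡ f g N = begin
    (⊝ f ⊛ g) N                              ≡⟨ ⊛-coeff (⊝ f) g N ⟩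
    ∑ (suc N) (λ k → - f k * g (N ∸ k))      ≡⟨ ∑-cong (suc N) (λ k → sym (ℤP.neg-distribˡ-* (f k) (g (N ∸ k)))) ⟩
    ∑ (suc N) (λ k → - (f k * g (N ∸ k)))    ≡⟨ ∑-neg (suc N) (λ k → f k * g (N ∸ k)) ⟩
    - ∑ (suc N) (λ k → f k * g (N ∸ k))      ≡⟨ cong -_ (sym (⊛-coeff f g N)) ⟩
    ⊝ (f ⊛ g) N                              ∎
    where open ≡-Reasoning

  private
    ⊛-suc-right : ∀ f g N → (f ⊛ g) (suc N) ≡ g 0 * f (suc N) + (f ⊛ tailₛ g) N
    ⊛-suc-right f g zero    = swap (f 0) (g 1) (f 1) (g 0)
      where
      swap : ∀ a b c d → a * b + c * d ≡ d * c + a * b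
      swap = solve-∀
    ⊛-suc-right f g (suc N) = begin
      f 0 * g (suc (suc N)) + (tailₛ f ⊛ g) (suc N)
        ≡⟨ cong (_+_ (f 0 * g (suc (suc N)))) (⊛-suc-right (tailₛ f) g N) ⟩
      f 0 * g (suc (suc N)) + (g 0 * f (suc (suc N)) + (tailₛ f ⊛ tailₛ g) N)
        ≡⟨ left-swap (f 0 * g (suc (suc N))) (g 0 * f (suc (suc N))) ((tailₛ f ⊛ tailₛ g) N) ⟩
      g 0 * f (suc (suc N)) + (f 0 * g (suc (suc N)) + (tailₛ f ⊛ tailₛ g) N) ∎
      where
      open ≡-Reasoning
      left-swap : ∀ a b c → a + (b + c) ≡ b + (a + c)
      left-swap = solve-∀

  ⊛-comm : ∀ f g → f ⊛ g ≈ g ⊛ f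
  ⊛-comm f g zero    = ℤP.*-comm (f 0) (g 0)
  ⊛-comm f g (suc N) = trans (⊛-suc-right f g N) (cong (_+_ (g 0 * f (suc N))) (⊛-comm f (tailₛ g) N))

  ⊛-distribˡ-⊕ : ∀ f g h → f ⊛ (g ⊕ h) ≈ f ⊛ g ⊕ f ⊛ h
  ⊛-distribˡ-⊕ f g h = ≈-trans (⊛-comm f (g ⊕ h)) (≈-trans (⊛-distribʳ-⊕ g h f) (⊕-cong (⊛-comm g f) (⊛-comm h f)))

  ⊛-·ʳ : ∀ a f g → f ⊛ (a · g) ≈ a · (f ⊛ g)
  ⊛-·ʳ a f g = ≈-trans (⊛-comm f (a · g)) (≈-trans (⊛-·ˡ a g f) (·-cong a (⊛-comm g f)))

  ⊛-⊝ʳ : ∀ f g → f ⊛ ⊝ g ≈ ⊝ (f ⊛ g)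
  ⊛-⊝ʳ f g = ≈-trans (⊛-comm f (⊝ g)) (≈-trans (⊛-⊝ˡ g f) (λ N → cong -_ (⊛-comm g f N)))

  ⊛-identityˡ : ∀ f → 1ₛ ⊛ f ≈ f
  ⊛-identityˡ f N = trans (⊛-coeff 1ₛ f N) (trans (cong₂ _+_ (ℤP.*-identityˡ (f N)) (∑-zero N (λ _ _ → refl))) (ℤP.+-identityʳ _))

  ⊛-zeroʳ : ∀ f {g} → g ≈ 0ₛ → f ⊛ g ≈ 0ₛ
  ⊛-zeroʳ f {g} g≈0 N =
    trans (⊛-coeff f g N) (∑-zero (suc N) (λ k _ → trans (cong (f k *_) (g≈0 (N ∸ k))) (ℤP.*-zeroʳ (f k))))

  ⊛-zeroˡ : ∀ {f} g → f ≈ 0ₛ → f ⊛ g ≈ 0ₛ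
  ⊛-zeroˡ {f} g f≈0 = ≈-trans (⊛-comm f g) (⊛-zeroʳ g f≈0)

  ⊛-assoc : ∀ f g h → (f ⊛ g) ⊛ h ≈ f ⊛ (g ⊛ h)
  ⊛-assoc f g h zero    = ℤP.*-assoc (f 0) (g 0) (h 0)
  ⊛-assoc f g h (suc N) = begin
    f 0 * g 0 * h (suc N) + (tailₛ (f ⊛ g) ⊛ h) N
      ≡⟨ cong (_+_ (f 0 * g 0 * h (suc N))) (⊛-congˡ h tail-⊛ N) ⟩
    f 0 * g 0 * h (suc N) + ((f 0 · tailₛ g ⊕ tailₛ f ⊛ g) ⊛ h) N
      ≡⟨ cong (_+_ (f 0 * g 0 * h (suc N))) (trans (⊛-distribʳ-⊕ (f 0 · tailₛ g) (tailₛ f ⊛ g) h N)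
           (cong₂ _+_ (⊛-·ˡ (f 0) (tailₛ g) h N) (⊛-assoc (tailₛ f) g h N))) ⟩
    f 0 * g 0 * h (suc N) + (f 0 * (tailₛ g ⊛ h) N + (tailₛ f ⊛ (g ⊛ h)) N)
      ≡⟨ regroup (f 0) (g 0) (h (suc N)) ((tailₛ g ⊛ h) N) ((tailₛ f ⊛ (g ⊛ h)) N) ⟩
    f 0 * (g 0 * h (suc N) + (tailₛ g ⊛ h) N) + (tailₛ f ⊛ (g ⊛ h)) N ∎
    where
    open ≡-Reasoning
    tail-⊛ : tailₛ (f ⊛ g) ≈ f 0 · tailₛ g ⊕ tailₛ f ⊛ g
    tail-⊛ _ = refl
    regroup : ∀ a b c d e → a * b * c + (a * d + e) ≡ a * (b * c + d) + e
    regroup = solve-∀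

  θ-⊛ : ∀ f g → θ (f ⊛ g) ≈ θ f ⊛ g ⊕ f ⊛ θ g
  θ-⊛ f g N = begin
    + N * (f ⊛ g) N                                        ≡⟨ cong (+ N *_) (⊛-coeff f g N) ⟩
    + N * ∑ (suc N) (λ k → f k * g (N ∸ k))                ≡⟨ sym (∑-*ˡ (suc N) (+ N) (λ k → f k * g (N ∸ k))) ⟩
    ∑ (suc N) (λ k → + N * (f k * g (N ∸ k)))              ≡⟨ ∑-cong-< (suc N) split-weight ⟩
    ∑ (suc N) (λ k → + k * f k * g (N ∸ k) + f k * (+ (N ∸ k) * g (N ∸ k)))
      ≡⟨ ∑-+ (suc N) (λ k → + k * f k * g (N ∸ k)) (λ k → f k * (+ (N ∸ k) * g (N ∸ k))) ⟩
    ∑ (suc N) (λ k → + k * f k * g (N ∸ k)) + ∑ (suc N) (λ k → f k * (+ (N ∸ k) * g (N ∸ k)))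
      ≡⟨ sym (cong₂ _+_ (⊛-coeff (θ f) g N) (⊛-coeff f (θ g) N)) ⟩
    (θ f ⊛ g ⊕ f ⊛ θ g) N                                  ∎
    where
    open ≡-Reasoning
    distribute : ∀ a b x y → (a + b) * (x * y) ≡ a * x * y + x * (b * y)
    distribute = solve-∀
    split-weight : ∀ k → k < suc N → + N * (f k * g (N ∸ k)) ≡ + k * f k * g (N ∸ k) + f k * (+ (N ∸ k) * g (N ∸ k))
    split-weight k (s≤s k≤N) =
      trans (cong (λ x → x * (f k * g (N ∸ k))) (trans (cong +_ (sym (ℕP.m+[n∸m]≡n k≤N))) (ℤP.pos-+ k (N ∸ k))))
            (distribute (+ k) (+ (N ∸ k)) (f k) (g (N ∸ k)))

  X·-⊛ : ∀ f g → X· f ⊛ g ≈ X· (f ⊛ g)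
  X·-⊛ f g zero    = refl
  X·-⊛ f g (suc N) = ℤP.+-identityˡ ((f ⊛ g) N)

  θ-· : ∀ a f → θ (a · f) ≈ a · θ f
  θ-· a f N = left-comm (+ N) a (f N)
    where
    left-comm : ∀ n a x → n * (a * x) ≡ a * (n * x)
    left-comm = solve-∀

  θ-⊝ : ∀ f → θ (⊝ f) ≈ ⊝ (θ f)
  θ-⊝ f N = sym (ℤP.neg-distribʳ-* (+ N) (f N))

  θ-cong : ∀ {f g} → f ≈ g → θ f ≈ θ g
  θ-cong f≈g N = cong (+ N *_) (f≈g N)

  θ-1 : θ 1ₛ ≈ 0ₛ
  θ-1 zero    = refl
  θ-1 (suc N) = ℤP.*-zeroʳ (+ suc N)

  Unit : ℤ → Set
  Unit u = u ≡ + 1 ⊎ u ≡ -[1+ 0 ]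

  Unit-* : ∀ {a b} → Unit a → Unit b → Unit (a * b)
  Unit-* (inj₁ refl) (inj₁ refl) = inj₁ refl
  Unit-* (inj₁ refl) (inj₂ refl) = inj₂ refl
  Unit-* (inj₂ refl) (inj₁ refl) = inj₂ refl
  Unit-* (inj₂ refl) (inj₂ refl) = inj₁ refl

  Unit-square : ∀ {a} → Unit a → a * a ≡ + 1
  Unit-square (inj₁ refl) = refl
  Unit-square (inj₂ refl) = refl

  Unit⇒≢0 : ∀ {a} → Unit a → a ≢ + 0
  Unit⇒≢0 (inj₁ refl) ()
  Unit⇒≢0 (inj₂ refl) ()

  Unit-cancelˡ : ∀ {a} x → Unit a → a * x ≡ + 0 → x ≡ + 0
  Unit-cancelˡ {a} x u ax≡0 = begin
    x             ≡⟨ sym (ℤP.*-identityˡ x) ⟩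
    + 1 * x       ≡⟨ cong (_* x) (sym (Unit-square u)) ⟩
    a * a * x     ≡⟨ ℤP.*-assoc a a x ⟩
    a * (a * x)   ≡⟨ cong (a *_) ax≡0 ⟩
    a * + 0       ≡⟨ ℤP.*-zeroʳ a ⟩
    + 0           ∎
    where open ≡-Reasoning

  Unit-factorˡ : ∀ a b → Unit (a * b) → Unit a
  Unit-factorˡ a b u = ∣∣≡1⇒Unit (ℕP.m*n≡1⇒m≡1 _ _ (trans (sym (ℤP.abs-* a b)) (Unit⇒∣∣≡1 u)))
    where
    Unit⇒∣∣≡1 : ∀ {c} → Unit c → ℤ.∣ c ∣ ≡ 1
    Unit⇒∣∣≡1 (inj₁ refl) = refl
    Unit⇒∣∣≡1 (inj₂ refl) = refl
    ∣∣≡1⇒Unit : ∀ {c} → ℤ.∣ c ∣ ≡ 1 → Unit c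
    ∣∣≡1⇒Unit {+ 1}        _ = inj₁ refl
    ∣∣≡1⇒Unit { -[1+ 0 ] } _ = inj₂ refl

  Unit-solve : ∀ {X S u c} → Unit u → u · X ≈ c · S → X ≈ (u * c) · S
  Unit-solve {X} {S} {u} {c} unit uX≈cS N = begin
    X N              ≡⟨ sym (ℤP.*-identityˡ (X N)) ⟩
    + 1 * X N        ≡⟨ cong (_* X N) (sym (Unit-square unit)) ⟩
    u * u * X N      ≡⟨ ℤP.*-assoc u u (X N) ⟩
    u * (u * X N)    ≡⟨ cong (u *_) (uX≈cS N) ⟩
    u * (c * S N)    ≡⟨ sym (ℤP.*-assoc u c (S N)) ⟩
    u * c * S N      ∎
    where open ≡-Reasoning

  ≈0-by-induction : ∀ (h : Series) → (∀ N → (∀ k → k < N → h k ≡ + 0) → h N ≡ + 0) → h ≈ 0ₛ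
  ≈0-by-induction h step N = below (suc N) N ℕP.≤-refl
    where
    below : ∀ B k → k < B → h k ≡ + 0
    below (suc B) k (s≤s k≤B) = step k (λ j j<k → below B j (ℕP.<-≤-trans j<k k≤B))

  ⊛-first-nonzero : ∀ h F N → (∀ k → k < N → h k ≡ + 0) → (h ⊛ F) N ≡ h N * F 0
  ⊛-first-nonzero h F N h<N≡0 = begin
    (h ⊛ F) N                                   ≡⟨ ⊛-coeff h F N ⟩
    ∑ (suc N) (λ k → h k * F (N ∸ k))           ≡⟨ ∑-snoc N (λ k → h k * F (N ∸ k)) ⟩
    ∑ N (λ k → h k * F (N ∸ k)) + h N * F (N ∸ N)
      ≡⟨ cong₂ _+_ (∑-zero N (λ k k<N → cong (_* F (N ∸ k)) (h<N≡0 k k<N))) (cong (λ i → h N * F i) (ℕP.n∸n≡0 N)) ⟩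
    + 0 + h N * F 0                             ≡⟨ ℤP.+-identityˡ _ ⟩
    h N * F 0                                   ∎
    where open ≡-Reasoning

  ⊛-cancel-unit : ∀ h F → h ⊛ F ≈ 0ₛ → Unit (F 0) → h ≈ 0ₛ
  ⊛-cancel-unit h F hF≈0 unit = ≈0-by-induction h λ N h<N≡0 →
    Unit-cancelˡ (h N) unit (trans (ℤP.*-comm (F 0) (h N)) (trans (sym (⊛-first-nonzero h F N h<N≡0)) (hF≈0 N)))

  -- Logarithmic derivatives

  LogDerivative : Series → Series → Set
  LogDerivative f L = θ f ≈ f ⊛ L

  LogDerivative-cong : ∀ {f f′ L L′} → f ≈ f′ → L ≈ L′ → LogDerivative f L → LogDerivative f′ L′
  LogDerivative-cong f≈f′ L≈L′ θf≈fL = ≈-trans (θ-cong (≈-sym f≈f′)) (≈-trans θf≈fL (⊛-cong f≈f′ L≈L′))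

  LogDerivative-1 : LogDerivative 1ₛ 0ₛ
  LogDerivative-1 = ≈-trans θ-1 (≈-sym (⊛-zeroʳ 1ₛ ≈-refl))

  LogDerivative-⊛ : ∀ {f g L M} → LogDerivative f L → LogDerivative g M → LogDerivative (f ⊛ g) (L ⊕ M)
  LogDerivative-⊛ {f} {g} {L} {M} θf≈fL θg≈gM = begin
    θ (f ⊛ g)                   ≈⟨ θ-⊛ f g ⟩
    θ f ⊛ g ⊕ f ⊛ θ g           ≈⟨ ⊕-cong (⊛-congˡ g θf≈fL) (⊛-congʳ f θg≈gM) ⟩
    (f ⊛ L) ⊛ g ⊕ f ⊛ (g ⊛ M)   ≈⟨ ⊕-cong (≈-trans (⊛-assoc f L g) (≈-trans (⊛-congʳ f (⊛-comm L g)) (≈-sym (⊛-assoc f g L))))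
                                          (≈-sym (⊛-assoc f g M)) ⟩
    (f ⊛ g) ⊛ L ⊕ (f ⊛ g) ⊛ M   ≈⟨ ≈-sym (⊛-distribˡ-⊕ (f ⊛ g) L M) ⟩
    (f ⊛ g) ⊛ (L ⊕ M)           ∎
    where open ≈-Reasoning

  -- If f g = 1 then 0 = θ (f g) = f (θ g + g L), and multiplying by g gives θ g + g L = 0.
  LogDerivative-inverse : ∀ {f g L} → f ⊛ g ≈ 1ₛ → LogDerivative f L → LogDerivative g (⊝ L)
  LogDerivative-inverse {f} {g} {L} fg≈1 θf≈fL N =
    trans (x+y≡0⇒x≡-y (θ g N) ((g ⊛ L) N) (h≈0 N)) (sym (⊛-⊝ʳ g L N))
    where
    x+y≡0⇒x≡-y : ∀ x y → x + y ≡ + 0 → x ≡ - y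
    x+y≡0⇒x≡-y x y x+y≡0 = ℤP.i-j≡0⇒i≡j x (- y) (trans (cong (_+_ x) (ℤP.neg-involutive y)) x+y≡0)
    h : Series
    h = θ g ⊕ g ⊛ L
    fh≈0 : f ⊛ h ≈ 0ₛ
    fh≈0 = begin
      f ⊛ (θ g ⊕ g ⊛ L)          ≈⟨ ⊛-distribˡ-⊕ f (θ g) (g ⊛ L) ⟩
      f ⊛ θ g ⊕ f ⊛ (g ⊛ L)      ≈⟨ (λ N → ℤP.+-comm ((f ⊛ θ g) N) _) ⟩
      f ⊛ (g ⊛ L) ⊕ f ⊛ θ g      ≈⟨ ⊕-cong (≈-trans (≈-sym (⊛-assoc f g L)) (≈-trans (⊛-congˡ L (⊛-comm f g)) (⊛-assoc g f L)))
                                          ≈-refl ⟩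
      g ⊛ (f ⊛ L) ⊕ f ⊛ θ g      ≈⟨ ⊕-cong (≈-trans (⊛-congʳ g (≈-sym θf≈fL)) (⊛-comm g (θ f))) ≈-refl ⟩
      θ f ⊛ g ⊕ f ⊛ θ g          ≈⟨ ≈-sym (θ-⊛ f g) ⟩
      θ (f ⊛ g)                  ≈⟨ θ-cong fg≈1 ⟩
      θ 1ₛ                       ≈⟨ θ-1 ⟩
      0ₛ                         ∎
      where open ≈-Reasoning
    h≈0 : h ≈ 0ₛ
    h≈0 = begin
      h                  ≈⟨ ≈-sym (⊛-identityˡ h) ⟩
      1ₛ ⊛ h             ≈⟨ ⊛-congˡ h (≈-trans (≈-sym fg≈1) (⊛-comm f g)) ⟩
      (g ⊛ f) ⊛ h        ≈⟨ ⊛-assoc g f h ⟩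
      g ⊛ (f ⊛ h)        ≈⟨ ⊛-zeroʳ g fh≈0 ⟩
      0ₛ                 ∎
      where open ≈-Reasoning

  -- θ D = D L with L 0 = 0 and D 0 = 0 forces N D_N = 0 for every N, step by step.
  LogDerivative-zero : ∀ {D L} → LogDerivative D L → L 0 ≡ + 0 → D 0 ≡ + 0 → D ≈ 0ₛ
  LogDerivative-zero {D} {L} θD≈DL L0≡0 D0≡0 = ≈0-by-induction D step
    where
    step : ∀ N → (∀ k → k < N → D k ≡ + 0) → D N ≡ + 0
    step zero    _       = D0≡0
    step (suc N) D<N≡0 = ℤP.*-cancelˡ-≡ (+ suc N) (D (suc N)) (+ 0) (begin
      + suc N * D (suc N)   ≡⟨ θD≈DL (suc N) ⟩
      (D ⊛ L) (suc N)       ≡⟨ ⊛-first-nonzero D L (suc N) D<N≡0 ⟩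
      D (suc N) * L 0       ≡⟨ cong (D (suc N) *_) L0≡0 ⟩
      D (suc N) * + 0       ≡⟨ ℤP.*-zeroʳ (D (suc N)) ⟩
      + 0                   ≡⟨ sym (ℤP.*-zeroʳ (+ suc N)) ⟩
      + suc N * + 0         ∎)
      where open ≡-Reasoning

  LogDerivative-unique : ∀ {f g L} → LogDerivative f L → LogDerivative g L → L 0 ≡ + 0 → g 0 · f ≈ f 0 · g
  LogDerivative-unique {f} {g} {L} θf≈fL θg≈gL L0≡0 N = ℤP.i-j≡0⇒i≡j _ _ (D≈0 N)
    where
    D : Series
    D = g 0 · f ⊕ ⊝ (f 0 · g)
    θD≈DL : LogDerivative D L
    θD≈DL N = begin
      θ D N                                          ≡⟨ ℤP.*-distribˡ-+ (+ N) _ _ ⟩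
      θ (g 0 · f) N + θ (⊝ (f 0 · g)) N              ≡⟨ cong₂ _+_ (θ-· (g 0) f N) (trans (θ-⊝ (f 0 · g) N) (cong -_ (θ-· (f 0) g N))) ⟩
      g 0 * θ f N + - (f 0 * θ g N)                  ≡⟨ cong₂ (λ x y → g 0 * x + - (f 0 * y)) (θf≈fL N) (θg≈gL N) ⟩
      g 0 * (f ⊛ L) N + - (f 0 * (g ⊛ L) N)          ≡⟨ cong₂ _+_ (sym (⊛-·ˡ (g 0) f L N))
                                                              (trans (cong -_ (sym (⊛-·ˡ (f 0) g L N))) (sym (⊛-⊝ˡ (f 0 · g) L N))) ⟩
      ((g 0 · f) ⊛ L) N + (⊝ (f 0 · g) ⊛ L) N        ≡⟨ sym (⊛-distribʳ-⊕ (g 0 · f) (⊝ (f 0 · g)) L N) ⟩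
      (D ⊛ L) N                                      ∎
      where open ≡-Reasoning
    D≈0 : D ≈ 0ₛ
    D≈0 = LogDerivative-zero θD≈DL L0≡0
            (trans (cong (λ x → x + - (f 0 * g 0)) (ℤP.*-comm (g 0) (f 0))) (ℤP.+-inverseʳ (f 0 * g 0)))

  VanishesFrom : Series → ℕ → Set
  VanishesFrom f B = ∀ N → B ≤ N → f N ≡ + 0

  VanishesFrom-mono : ∀ {f B B′} → VanishesFrom f B → B ≤ B′ → VanishesFrom f B′
  VanishesFrom-mono f≥B≡0 B≤B′ N B′≤N = f≥B≡0 N (ℕP.≤-trans B≤B′ B′≤N)

  VanishesFrom-cong : ∀ {f g B} → f ≈ g → VanishesFrom f B → VanishesFrom g B
  VanishesFrom-cong f≈g f≥B≡0 N B≤N = trans (sym (f≈g N)) (f≥B≡0 N B≤N)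

  VanishesFrom-pred : ∀ {f B} → VanishesFrom f (suc B) → f B ≡ + 0 → VanishesFrom f B
  VanishesFrom-pred f>B≡0 fB≡0 N B≤N with ℕP.m≤n⇒m<n∨m≡n B≤N
  ... | inj₁ B<N  = f>B≡0 N B<N
  ... | inj₂ refl = fB≡0

  VanishesFrom-⊕ : ∀ {f g B} → VanishesFrom f B → VanishesFrom g B → VanishesFrom (f ⊕ g) B
  VanishesFrom-⊕ f≥B≡0 g≥B≡0 N B≤N = cong₂ _+_ (f≥B≡0 N B≤N) (g≥B≡0 N B≤N)

  VanishesFrom-· : ∀ {f B} a → VanishesFrom f B → VanishesFrom (a · f) B
  VanishesFrom-· a f≥B≡0 N B≤N = trans (cong (a *_) (f≥B≡0 N B≤N)) (ℤP.*-zeroʳ a)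

  VanishesFrom-⊝ : ∀ {f B} → VanishesFrom f B → VanishesFrom (⊝ f) B
  VanishesFrom-⊝ f≥B≡0 N B≤N = cong -_ (f≥B≡0 N B≤N)

  VanishesFrom-θ : ∀ {f B} → VanishesFrom f B → VanishesFrom (θ f) B
  VanishesFrom-θ f≥B≡0 N B≤N = trans (cong (+ N *_) (f≥B≡0 N B≤N)) (ℤP.*-zeroʳ (+ N))

  VanishesFrom-0 : ∀ B → VanishesFrom 0ₛ B
  VanishesFrom-0 B N _ = refl

  VanishesFrom-1 : VanishesFrom 1ₛ 1
  VanishesFrom-1 (suc N) _ = refl

  VanishesFrom-⊛ : ∀ {f g a b} → VanishesFrom f (suc a) → VanishesFrom g (suc b) → VanishesFrom (f ⊛ g) (suc (a ℕ.+ b))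
  VanishesFrom-⊛ {f} {g} {a} {b} f>a≡0 g>b≡0 N a+b<N = trans (⊛-coeff f g N) (∑-zero (suc N) term≡0)
    where
    term≡0 : ∀ k → k < suc N → f k * g (N ∸ k) ≡ + 0
    term≡0 k _ with k ℕP.≤? a
    ... | no  k≰a = cong (_* g (N ∸ k)) (f>a≡0 k (ℕP.≰⇒> k≰a))
    ... | yes k≤a = trans (cong (f k *_) (g>b≡0 (N ∸ k) b<N∸k)) (ℤP.*-zeroʳ (f k))
      where
      b<N∸k : suc b ≤ N ∸ k
      b<N∸k = ℕP.m+n≤o⇒m≤o∸n (suc b) (ℕP.≤-trans (ℕP.≤-reflexive (ℕP.+-comm (suc b) k))
                (ℕP.≤-trans (ℕP.+-monoˡ-≤ (suc b) k≤a) (ℕP.≤-trans (ℕP.≤-reflexive (ℕP.+-suc a b)) a+b<N)))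

  VanishesFrom-⊛′ : ∀ {f g A B} → VanishesFrom f A → VanishesFrom g B → VanishesFrom (f ⊛ g) (A ℕ.+ B)
  VanishesFrom-⊛′ {f} {g} {zero}  {B}     f≡0 _ = VanishesFrom-cong (≈-sym (⊛-zeroˡ g (λ N → f≡0 N z≤n))) (VanishesFrom-0 B)
  VanishesFrom-⊛′ {f} {g} {suc A} {zero}  _ g≡0 = VanishesFrom-cong (≈-sym (⊛-zeroʳ f (λ N → g≡0 N z≤n))) (VanishesFrom-0 _)
  VanishesFrom-⊛′ {f} {g} {suc A} {suc B} f>A≡0 g>B≡0 =
    VanishesFrom-mono (VanishesFrom-⊛ f>A≡0 g>B≡0) (s≤s (ℕP.+-monoʳ-≤ A (ℕP.n≤1+n B)))

  ⊛-top-coeff : ∀ {F W δ b} → VanishesFrom F (suc δ) → VanishesFrom W (suc b) → (F ⊛ W) (δ ℕ.+ b) ≡ F δ * W b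
  ⊛-top-coeff {F} {W} {δ} {b} F>δ≡0 W>b≡0 = begin
    (F ⊛ W) (δ ℕ.+ b)                                  ≡⟨ ⊛-coeff F W (δ ℕ.+ b) ⟩
    ∑ (suc (δ ℕ.+ b)) T                                ≡⟨ cong (λ n → ∑ n T) (sym (ℕP.+-suc δ b)) ⟩
    ∑ (δ ℕ.+ suc b) T                                  ≡⟨ ∑-split δ (suc b) T ⟩
    ∑ δ T + (T (δ ℕ.+ 0) + ∑ b (λ j → T (δ ℕ.+ suc j))) ≡⟨ cong₂ (λ x y → x + (T (δ ℕ.+ 0) + y)) (∑-zero δ below-δ) (∑-zero b above-δ) ⟩
    + 0 + (T (δ ℕ.+ 0) + + 0)                          ≡⟨ trans (ℤP.+-identityˡ _) (ℤP.+-identityʳ _) ⟩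
    F (δ ℕ.+ 0) * W (δ ℕ.+ b ∸ (δ ℕ.+ 0))              ≡⟨ cong (λ k → F k * W (δ ℕ.+ b ∸ k)) (ℕP.+-identityʳ δ) ⟩
    F δ * W (δ ℕ.+ b ∸ δ)                              ≡⟨ cong (λ k → F δ * W k) (ℕP.m+n∸m≡n δ b) ⟩
    F δ * W b                                          ∎
    where
    open ≡-Reasoning
    T : ℕ → ℤ
    T k = F k * W (δ ℕ.+ b ∸ k)
    below-δ : ∀ k → k < δ → T k ≡ + 0
    below-δ k k<δ = trans (cong (F k *_) (W>b≡0 _ b<δ+b∸k)) (ℤP.*-zeroʳ (F k))
      where
      b<δ+b∸k : suc b ≤ δ ℕ.+ b ∸ k
      b<δ+b∸k = ℕP.m+n≤o⇒m≤o∸n (suc b) (ℕP.≤-trans (ℕP.≤-reflexive (ℕP.+-comm (suc b) k))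
                  (ℕP.≤-trans (ℕP.≤-reflexive (ℕP.+-suc k b)) (ℕP.+-monoˡ-≤ b k<δ)))
    above-δ : ∀ j → j < b → T (δ ℕ.+ suc j) ≡ + 0
    above-δ j _ = cong (_* W (δ ℕ.+ b ∸ (δ ℕ.+ suc j)))
                       (F>δ≡0 (δ ℕ.+ suc j) (ℕP.≤-trans (ℕP.≤-reflexive (ℕP.+-comm 1 δ)) (ℕP.+-monoʳ-≤ δ (s≤s z≤n))))

  unit-leading-⊛-vanishes : ∀ {F W δ} B → VanishesFrom F (suc δ) → Unit (F δ) → VanishesFrom W B →
                            VanishesFrom (F ⊛ W) δ → W ≈ 0ₛ
  unit-leading-⊛-vanishes zero    _ _ W≡0 _ N = W≡0 N z≤n
  unit-leading-⊛-vanishes {F} {W} {δ} (suc b) F>δ≡0 unit W>b≡0 FW≥δ≡0 =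
    unit-leading-⊛-vanishes b F>δ≡0 unit (VanishesFrom-pred W>b≡0 Wb≡0) FW≥δ≡0
    where
    Wb≡0 : W b ≡ + 0
    Wb≡0 = Unit-cancelˡ (W b) unit (trans (sym (⊛-top-coeff F>δ≡0 W>b≡0)) (FW≥δ≡0 (δ ℕ.+ b) (ℕP.m≤m+n δ b)))

  X·-cong : ∀ {f g} → f ≈ g → X· f ≈ X· g
  X·-cong f≈g zero    = refl
  X·-cong f≈g (suc N) = f≈g N

  Xpow : ℕ → Series → Series
  Xpow zero    h = h
  Xpow (suc j) h = X· (Xpow j h)

  Xpow-cong : ∀ j {f g} → f ≈ g → Xpow j f ≈ Xpow j g
  Xpow-cong zero    f≈g = f≈g
  Xpow-cong (suc j) f≈g = X·-cong (Xpow-cong j f≈g)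

  Xpow-+ : ∀ j h N → Xpow j h (j ℕ.+ N) ≡ h N
  Xpow-+ zero    h N = refl
  Xpow-+ (suc j) h N = Xpow-+ j h N

  Xpow-≥ : ∀ j h N → j ≤ N → Xpow j h N ≡ h (N ∸ j)
  Xpow-≥ j h N j≤N = trans (cong (Xpow j h) (sym (ℕP.m+[n∸m]≡n j≤N))) (Xpow-+ j h (N ∸ j))

  Xpow-< : ∀ j h N → N < j → Xpow j h N ≡ + 0
  Xpow-< (suc j) h zero    _         = refl
  Xpow-< (suc j) h (suc N) (s≤s N<j) = Xpow-< j h N N<j

  Xpow-⊛ : ∀ j h F → Xpow j h ⊛ F ≈ Xpow j (h ⊛ F)
  Xpow-⊛ zero    h F = ≈-refl
  Xpow-⊛ (suc j) h F = ≈-trans (X·-⊛ (Xpow j h) F) (X·-cong (Xpow-⊛ j h F))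

  VanishesFrom-Xpow : ∀ {h B} j → VanishesFrom h B → VanishesFrom (Xpow j h) (j ℕ.+ B)
  VanishesFrom-Xpow {h} {B} j h≥B≡0 N j+B≤N =
    trans (Xpow-≥ j h N (ℕP.≤-trans (ℕP.m≤m+n j B) j+B≤N))
          (h≥B≡0 (N ∸ j) (ℕP.m+n≤o⇒m≤o∸n B (ℕP.≤-trans (ℕP.≤-reflexive (ℕP.+-comm B j)) j+B≤N)))

  monomial : ℕ → ℤ → Series
  monomial j c = Xpow j (c · 1ₛ)

  monomial-⊛ : ∀ j c F → monomial j c ⊛ F ≈ Xpow j (c · F)
  monomial-⊛ j c F = ≈-trans (Xpow-⊛ j (c · 1ₛ) F) (Xpow-cong j (≈-trans (⊛-·ˡ c 1ₛ F) (·-cong c (⊛-identityˡ F))))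

  VanishesFrom-monomial : ∀ j c → VanishesFrom (monomial j c) (j ℕ.+ 1)
  VanishesFrom-monomial j c = VanishesFrom-Xpow j (VanishesFrom-· c VanishesFrom-1)

  -- Division by a polynomial with unit leading coefficient

  record DivisionResult (A F : Series) (δ : ℕ) : Set where
    field
      quotient remainder : Series
      quotientBound      : ℕ
      quotient-vanishes  : VanishesFrom quotient quotientBound
      remainder-vanishes : VanishesFrom remainder δ
      division           : A ≈ quotient ⊛ F ⊕ remainder

  private
    -- Subtracting (A_B F_δ) x^(B-δ) F kills the coefficient A_B, because F_δ² = 1.
    lower-degree : ∀ {F δ} → VanishesFrom F (suc δ) → Unit (F δ) → ∀ {A B} → δ ≤ B → VanishesFrom A (suc B) →
                   VanishesFrom (A ⊕ ⊝ (monomial (B ∸ δ) (A B * F δ) ⊛ F)) B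
    lower-degree {F} {δ} F>δ≡0 unit {A} {B} δ≤B A>B≡0 N B≤N with ℕP.m≤n⇒m<n∨m≡n B≤N
    ... | inj₂ refl = begin
      A B + - (M ⊛ F) B                 ≡⟨ cong (λ x → A B + - x) (trans (MF-≥ B ℕP.≤-refl) (cong (λ k → c * F k) (ℕP.m∸[m∸n]≡n δ≤B))) ⟩
      A B + - (A B * F δ * F δ)         ≡⟨ cong (λ x → A B + - x) (trans (ℤP.*-assoc (A B) (F δ) (F δ)) (cong (A B *_) (Unit-square unit))) ⟩
      A B + - (A B * + 1)               ≡⟨ cong (λ x → A B + - x) (ℤP.*-identityʳ (A B)) ⟩
      A B + - A B                       ≡⟨ ℤP.+-inverseʳ (A B) ⟩
      + 0                               ∎
      where open ≡-Reasoning
            c = A B * F δ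
            M = monomial (B ∸ δ) c
            MF-≥ : ∀ N → B ≤ N → (M ⊛ F) N ≡ c * F (N ∸ (B ∸ δ))
            MF-≥ N B≤N = trans (monomial-⊛ (B ∸ δ) c F N) (Xpow-≥ (B ∸ δ) (c · F) N (ℕP.≤-trans (ℕP.m∸n≤m B δ) B≤N))
    ... | inj₁ B<N = begin
      A N + - (M ⊛ F) N                 ≡⟨ cong₂ (λ x y → x + - y) (A>B≡0 N B<N) (trans (monomial-⊛ (B ∸ δ) c F N) (Xpow-≥ (B ∸ δ) (c · F) N j≤N)) ⟩
      + 0 + - (c * F (N ∸ (B ∸ δ)))     ≡⟨ cong (λ x → + 0 + - (c * x)) (F>δ≡0 (N ∸ (B ∸ δ)) δ<N∸j) ⟩
      + 0 + - (c * + 0)                 ≡⟨ cong (λ x → + 0 + - x) (ℤP.*-zeroʳ c) ⟩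
      + 0                               ∎
      where open ≡-Reasoning
            c = A B * F δ
            M = monomial (B ∸ δ) c
            j≤N : B ∸ δ ≤ N
            j≤N = ℕP.≤-trans (ℕP.m∸n≤m B δ) B≤N
            δ<N∸j : suc δ ≤ N ∸ (B ∸ δ)
            δ<N∸j = ℕP.m+n≤o⇒m≤o∸n (suc δ) (ℕP.≤-trans (ℕP.≤-reflexive (cong suc (ℕP.m+[n∸m]≡n δ≤B))) B<N)

  divide : ∀ {F δ} → VanishesFrom F (suc δ) → Unit (F δ) → ∀ B {A} → VanishesFrom A B → DivisionResult A F δ
  divide {F} {δ} F>δ≡0 unit B {A} A≥B≡0 with B ℕP.≤? δ
  ... | yes B≤δ = record
    { quotient = 0ₛ ; remainder = A ; quotientBound = 0
    ; quotient-vanishes = VanishesFrom-0 0 ; remainder-vanishes = VanishesFrom-mono A≥B≡0 B≤δ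
    ; division = λ N → sym (trans (cong (_+ A N) (⊛-zeroˡ F ≈-refl N)) (ℤP.+-identityˡ _)) }
  divide F>δ≡0 unit zero _ | no B≰δ = ⊥-elim (B≰δ z≤n)
  divide {F} {δ} F>δ≡0 unit (suc B) {A} A>B≡0 | no B≰δ = record
    { quotient = Q ⊕ M ; remainder = R ; quotientBound = QB ℕ.+ (B ∸ δ ℕ.+ 1)
    ; quotient-vanishes = VanishesFrom-⊕ (VanishesFrom-mono Q≥QB≡0 (ℕP.m≤m+n _ _))
                                         (VanishesFrom-mono (VanishesFrom-monomial (B ∸ δ) c) (ℕP.m≤n+m _ QB))
    ; remainder-vanishes = R≥δ≡0
    ; division = λ N → begin
        A N                                  ≡⟨ sym (trans (ℤP.+-assoc (A N) _ _) (trans (cong (_+_ (A N)) (ℤP.+-inverseˡ ((M ⊛ F) N))) (ℤP.+-identityʳ _))) ⟩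
        A N + - (M ⊛ F) N + (M ⊛ F) N        ≡⟨ cong (_+ (M ⊛ F) N) (A-MF≈QF+R N) ⟩
        (Q ⊛ F) N + R N + (M ⊛ F) N          ≡⟨ right-comm ((Q ⊛ F) N) (R N) ((M ⊛ F) N) ⟩
        (Q ⊛ F) N + (M ⊛ F) N + R N          ≡⟨ cong (_+ R N) (sym (⊛-distribʳ-⊕ Q M F N)) ⟩
        ((Q ⊕ M) ⊛ F) N + R N                ∎ }
    where
    open ≡-Reasoning
    δ≤B : δ ≤ B
    δ≤B = ℕP.≤-pred (ℕP.≰⇒> B≰δ)
    c = A B * F δ
    M = monomial (B ∸ δ) c
    open DivisionResult (divide F>δ≡0 unit B (lower-degree F>δ≡0 unit δ≤B A>B≡0))
      renaming (quotient to Q; remainder to R; quotientBound to QB; quotient-vanishes to Q≥QB≡0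
               ; remainder-vanishes to R≥δ≡0; division to A-MF≈QF+R)
    right-comm : ∀ a b c → a + b + c ≡ a + c + b
    right-comm = solve-∀

  private
    leading-index : ∀ {G} B → VanishesFrom G B → G ≈ 0ₛ ⊎ ∃ λ g → VanishesFrom G (suc g) × G g ≢ + 0
    leading-index zero    G≡0 = inj₁ (λ N → G≡0 N z≤n)
    leading-index {G} (suc b) G>b≡0 with G b ℤP.≟ + 0
    ... | no  Gb≢0 = inj₂ (b , G>b≡0 , Gb≢0)
    ... | yes Gb≡0 = leading-index b (VanishesFrom-pred G>b≡0 Gb≡0)

  quotient-leading : ∀ {G F S δ σ} B → VanishesFrom G B → VanishesFrom F (suc δ) → Unit (F δ) →
                     VanishesFrom S (suc σ) → Unit (S σ) → G ⊛ F ≈ S →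
                     δ ≤ σ × VanishesFrom G (suc (σ ∸ δ)) × Unit (G (σ ∸ δ))
  quotient-leading {G} {F} {S} {δ} {σ} B G≥B≡0 F>δ≡0 unitF S>σ≡0 unitS GF≈S with leading-index B G≥B≡0
  ... | inj₁ G≈0 = ⊥-elim (Unit⇒≢0 unitS (trans (sym (GF≈S σ)) (⊛-zeroˡ F G≈0 σ)))
  ... | inj₂ (g , G>g≡0 , Gg≢0) =
    δ≤σ , subst (λ k → VanishesFrom G (suc k)) (sym σ∸δ≡g) G>g≡0 , subst (λ k → Unit (G k)) (sym σ∸δ≡g) unitG
    where
    FG≈S : F ⊛ G ≈ S
    FG≈S = ≈-trans (⊛-comm F G) GF≈S
    top : S (δ ℕ.+ g) ≡ F δ * G g
    top = trans (sym (FG≈S (δ ℕ.+ g))) (⊛-top-coeff F>δ≡0 G>g≡0)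
    δ+g≤σ : δ ℕ.+ g ≤ σ
    δ+g≤σ with (δ ℕ.+ g) ℕP.≤? σ
    ... | yes δ+g≤σ = δ+g≤σ
    ... | no  δ+g≰σ = ⊥-elim (Gg≢0 (Unit-cancelˡ (G g) unitF (trans (sym top) (S>σ≡0 (δ ℕ.+ g) (ℕP.≰⇒> δ+g≰σ)))))
    σ≤δ+g : σ ≤ δ ℕ.+ g
    σ≤δ+g with σ ℕP.≤? (δ ℕ.+ g)
    ... | yes σ≤δ+g = σ≤δ+g
    ... | no  σ≰δ+g = ⊥-elim (Unit⇒≢0 unitS (trans (sym (FG≈S σ)) (VanishesFrom-⊛ F>δ≡0 G>g≡0 σ (ℕP.≰⇒> σ≰δ+g))))
    σ≡δ+g : σ ≡ δ ℕ.+ g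
    σ≡δ+g = ℕP.≤-antisym σ≤δ+g δ+g≤σ
    δ≤σ : δ ≤ σ
    δ≤σ = subst (δ ≤_) (sym σ≡δ+g) (ℕP.m≤m+n δ g)
    σ∸δ≡g : σ ∸ δ ≡ g
    σ∸δ≡g = trans (cong (_∸ δ) σ≡δ+g) (ℕP.m+n∸m≡n δ g)
    unitG : Unit (G g)
    unitG = Unit-factorˡ (G g) (F δ) (subst Unit (trans (cong S σ≡δ+g) (trans top (ℤP.*-comm (F δ) (G g)))) unitS)

  Xpow-1ₛ-≢ : ∀ e N → N ≢ e → Xpow e 1ₛ N ≡ + 0
  Xpow-1ₛ-≢ e N N≢e with N ℕP.<? e
  ... | yes N<e = Xpow-< e 1ₛ N N<e
  ... | no  N≮e = trans (Xpow-≥ e 1ₛ N e≤N) (off (N ∸ e) (λ N∸e≡0 → N≢e (ℕP.≤-antisym (ℕP.m∸n≡0⇒m≤n N∸e≡0) e≤N)))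
    where
    e≤N = ℕP.≮⇒≥ N≮e
    off : ∀ k → k ≢ 0 → 1ₛ k ≡ + 0
    off zero    k≢0 = ⊥-elim (k≢0 refl)
    off (suc k) _   = refl

  Xpow-1ₛ-≡ : ∀ e → Xpow e 1ₛ e ≡ + 1
  Xpow-1ₛ-≡ e = trans (cong (Xpow e 1ₛ) (sym (ℕP.+-identityʳ e))) (Xpow-+ e 1ₛ 0)

  -- Dilation f(x) ↦ f(x^p)

  dilate : (p : ℕ) .{{_ : NonZero p}} → Series → Series
  dilate p f N = f (N / p) when (p ∣ᵇ N)

  module _ (p : ℕ) .{{p≢0 : NonZero p}} where

    dilate-off : ∀ f N → ¬ (p ∣ N) → dilate p f N ≡ + 0
    dilate-off f N p∤N rewrite ∤⇒∣ᵇ≡false p∤N = refl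

    dilate-on : ∀ f j → dilate p f (j ℕ.* p) ≡ f j
    dilate-on f j rewrite ∣⇒∣ᵇ≡true (ND.n∣m*n j {p}) | m*n/n≡m j p {{p≢0}} = refl

    dilate-0 : ∀ f → dilate p f 0 ≡ f 0
    dilate-0 f = dilate-on f 0

    dilate-cong : ∀ {f g} → f ≈ g → dilate p f ≈ dilate p g
    dilate-cong f≈g N with p ∣ᵇ N
    ... | true  = f≈g (N / p)
    ... | false = refl

    dilate-⊕ : ∀ f g → dilate p (f ⊕ g) ≈ dilate p f ⊕ dilate p g
    dilate-⊕ f g N = when-+ (p ∣ᵇ N) (f (N / p)) (g (N / p))

    dilate-· : ∀ a f → dilate p (a · f) ≈ a · dilate p f
    dilate-· a f N = when-*ˡ (p ∣ᵇ N) a (f (N / p))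

    dilate-⊝ : ∀ f → dilate p (⊝ f) ≈ ⊝ (dilate p f)
    dilate-⊝ f N = when-neg (p ∣ᵇ N) (f (N / p))

    θ-dilate : ∀ f → θ (dilate p f) ≈ + p · dilate p (θ f)
    θ-dilate f N with p ∣? N
    ... | no  _ = trans (ℤP.*-zeroʳ (+ N)) (sym (ℤP.*-zeroʳ (+ p)))
    ... | yes (divides M refl) rewrite m*n/n≡m M p {{p≢0}} =
      trans (cong (_* f M) (trans (ℤP.pos-* M p) (ℤP.*-comm (+ M) (+ p)))) (ℤP.*-assoc (+ p) (+ M) (f M))

    dilate-⊛ : ∀ f g → dilate p (f ⊛ g) ≈ dilate p f ⊛ dilate p g
    dilate-⊛ f g N with p ∣? N
    ... | no p∤N = sym (trans (⊛-coeff (dilate p f) (dilate p g) N) (∑-zero (suc N) term≡0))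
      where
      term≡0 : ∀ k → k < suc N → dilate p f k * dilate p g (N ∸ k) ≡ + 0
      term≡0 k (s≤s k≤N) with p ∣? k
      ... | no  _   = refl
      ... | yes p∣k = trans (cong (f (k / p) *_) (dilate-off g (N ∸ k) p∤N∸k)) (ℤP.*-zeroʳ (f (k / p)))
        where
        p∤N∸k : ¬ (p ∣ N ∸ k)
        p∤N∸k p∣N∸k = p∤N (subst (p ∣_) (ℕP.m+[n∸m]≡n k≤N) (ND.∣m∣n⇒∣m+n p∣k p∣N∸k))
    ... | yes (divides M refl) = sym (begin
      (dilate p f ⊛ dilate p g) (M ℕ.* p)            ≡⟨ ⊛-coeff (dilate p f) (dilate p g) (M ℕ.* p) ⟩
      ∑ (suc (M ℕ.* p)) T                            ≡⟨ ∑-snoc (M ℕ.* p) T ⟩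
      ∑ (M ℕ.* p) T + T (M ℕ.* p)                    ≡⟨ cong₂ _+_ (trans (∑-multiples p M T T-off-multiples) (∑-cong M T-on-multiples)) (T-on-multiples M) ⟩
      ∑ M (λ j → f j * g (M ∸ j)) + f M * g (M ∸ M)  ≡⟨ sym (∑-snoc M (λ j → f j * g (M ∸ j))) ⟩
      ∑ (suc M) (λ j → f j * g (M ∸ j))              ≡⟨ sym (⊛-coeff f g M) ⟩
      (f ⊛ g) M                                      ≡⟨ cong (f ⊛ g) (sym (m*n/n≡m M p {{p≢0}})) ⟩
      (f ⊛ g) (M ℕ.* p / p)                          ∎)
      where
      open ≡-Reasoning
      T : ℕ → ℤ
      T k = dilate p f k * dilate p g (M ℕ.* p ∸ k)
      T-off-multiples : ∀ k → ¬ (p ∣ k) → T k ≡ + 0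
      T-off-multiples k p∤k rewrite dilate-off f k p∤k = refl
      T-on-multiples : ∀ j → T (j ℕ.* p) ≡ f j * g (M ∸ j)
      T-on-multiples j = cong₂ _*_ (dilate-on f j) (trans (cong (dilate p g) (sym (ℕP.*-distribʳ-∸ p M j))) (dilate-on g (M ∸ j)))

    dilate-Xpow-1ₛ : ∀ m → dilate p (Xpow m 1ₛ) ≈ Xpow (m ℕ.* p) 1ₛ
    dilate-Xpow-1ₛ m N = by-cases (p ∣? N)
      where
      by-cases : Dec (p ∣ N) → dilate p (Xpow m 1ₛ) N ≡ Xpow (m ℕ.* p) 1ₛ N
      by-cases (no p∤N) = trans (dilate-off (Xpow m 1ₛ) N p∤N)
        (sym (Xpow-1ₛ-≢ (m ℕ.* p) N (λ N≡mp → p∤N (subst (p ∣_) (sym N≡mp) (ND.n∣m*n m)))))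
      by-cases (yes (divides q refl)) with q ℕP.≟ m
      ... | yes refl = trans (dilate-on (Xpow q 1ₛ) q) (trans (Xpow-1ₛ-≡ q) (sym (Xpow-1ₛ-≡ (q ℕ.* p))))
      ... | no  q≢m  = trans (dilate-on (Xpow m 1ₛ) q) (trans (Xpow-1ₛ-≢ m q q≢m)
                         (sym (Xpow-1ₛ-≢ (m ℕ.* p) (q ℕ.* p) (λ qp≡mp → q≢m (ℕP.*-cancelʳ-≡ q m p qp≡mp)))))

    VanishesFrom-dilate : ∀ {f a} → VanishesFrom f (suc a) → VanishesFrom (dilate p f) (suc (a ℕ.* p))
    VanishesFrom-dilate {f} {a} f>a≡0 N ap<N = by-cases (p ∣? N)
      where
      by-cases : Dec (p ∣ N) → dilate p f N ≡ + 0
      by-cases (no p∤N) = dilate-off f N p∤N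
      by-cases (yes (divides M refl)) =
        trans (dilate-on f M) (f>a≡0 M (ℕP.*-cancelʳ-< p a M ap<N))

  -- Pairing polynomials against Ramanujan sums

  -- −∑_{N ≥ 1} c_d(N) xᴺ, which turns out to be θ Φ_d / Φ_d
  cyclotomicLogDeriv : ℕ → Series
  cyclotomicLogDeriv d zero    = + 0
  cyclotomicLogDeriv d (suc N) = - ramanujan d (+ suc N)

  -- for F of degree < B this is G^d_l(F)
  ramanujanPairing : ℕ → Series → ℕ → ℤ → ℤ
  ramanujanPairing d F B l = ∑ B (λ k → F k * ramanujan d (l - + k))

  Annihilates : ℕ → Series → ℕ → Set
  Annihilates d F B = ∀ l → ramanujanPairing d F B l ≡ + 0

  module _ (d : ℕ) where

    ramanujanPairing-extend : ∀ {F} B B′ l → VanishesFrom F B → B ≤ B′ → ramanujanPairing d F B′ l ≡ ramanujanPairing d F B l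
    ramanujanPairing-extend {F} B B′ l F≥B≡0 B≤B′ =
      ∑-truncate B B′ (λ k → F k * ramanujan d (l - + k)) B≤B′ (λ k B≤k → cong (_* ramanujan d (l - + k)) (F≥B≡0 k B≤k))

    ramanujanPairing-cong : ∀ {F G} B l → F ≈ G → ramanujanPairing d F B l ≡ ramanujanPairing d G B l
    ramanujanPairing-cong B l F≈G = ∑-cong B (λ k → cong (_* ramanujan d (l - + k)) (F≈G k))

    ramanujanPairing-⊕ : ∀ F G B l → ramanujanPairing d (F ⊕ G) B l ≡ ramanujanPairing d F B l + ramanujanPairing d G B l
    ramanujanPairing-⊕ F G B l = trans (∑-cong B (λ k → ℤP.*-distribʳ-+ (ramanujan d (l - + k)) (F k) (G k)))
                                       (∑-+ B (λ k → F k * ramanujan d (l - + k)) (λ k → G k * ramanujan d (l - + k)))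

    ramanujanPairing-⊝ : ∀ F B l → ramanujanPairing d (⊝ F) B l ≡ - ramanujanPairing d F B l
    ramanujanPairing-⊝ F B l = trans (∑-cong B (λ k → sym (ℤP.neg-distribˡ-* (F k) (ramanujan d (l - + k)))))
                                     (∑-neg B (λ k → F k * ramanujan d (l - + k)))

    ramanujanPairing-· : ∀ a F B l → ramanujanPairing d (a · F) B l ≡ a * ramanujanPairing d F B l
    ramanujanPairing-· a F B l = trans (∑-cong B (λ k → ℤP.*-assoc a (F k) (ramanujan d (l - + k))))
                                       (∑-*ˡ B a (λ k → F k * ramanujan d (l - + k)))

    ⊛-cyclotomicLogDeriv-beyond : ∀ F B → VanishesFrom F B → ∀ N → B ≤ N →
                                  (F ⊛ cyclotomicLogDeriv d) N ≡ - ramanujanPairing d F B (+ N)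
    ⊛-cyclotomicLogDeriv-beyond F B F≥B≡0 N B≤N = begin
      (F ⊛ cyclotomicLogDeriv d) N                          ≡⟨ ⊛-coeff F (cyclotomicLogDeriv d) N ⟩
      ∑ (suc N) (λ k → F k * cyclotomicLogDeriv d (N ∸ k))
        ≡⟨ ∑-truncate B (suc N) _ (ℕP.m≤n⇒m≤1+n B≤N) (λ k B≤k → cong (_* cyclotomicLogDeriv d (N ∸ k)) (F≥B≡0 k B≤k)) ⟩
      ∑ B (λ k → F k * cyclotomicLogDeriv d (N ∸ k))        ≡⟨ ∑-cong-< B term ⟩
      ∑ B (λ k → - (F k * ramanujan d (+ N - + k)))         ≡⟨ ∑-neg B (λ k → F k * ramanujan d (+ N - + k)) ⟩
      - ramanujanPairing d F B (+ N)                        ∎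
      where
      open ≡-Reasoning
      term : ∀ k → k < B → F k * cyclotomicLogDeriv d (N ∸ k) ≡ - (F k * ramanujan d (+ N - + k))
      term k k<B with N ∸ k in N∸k≡
      ... | zero  = ⊥-elim (ℕP.<-irrefl refl (ℕP.<-≤-trans k<B (ℕP.≤-trans B≤N (ℕP.m∸n≡0⇒m≤n N∸k≡))))
      ... | suc M = trans (sym (ℤP.neg-distribʳ-* (F k) (ramanujan d (+ suc M))))
                          (cong (λ i → - (F k * ramanujan d (+ i))) (sym ∣N-k∣≡))
        where
        ∣N-k∣≡ : ℤ.∣ + N - + k ∣ ≡ suc M
        ∣N-k∣≡ = trans (cong ℤ.∣_∣ (trans (ℤP.[+m]-[+n]≡m⊖n N k) (ℤP.⊖-≥ (ℕP.<⇒≤ (ℕP.<-≤-trans k<B B≤N))))) N∸k≡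

    Annihilates⇒⊛-VanishesFrom : ∀ R B → VanishesFrom R B → Annihilates d R B → VanishesFrom (R ⊛ cyclotomicLogDeriv d) B
    Annihilates⇒⊛-VanishesFrom R B R≥B≡0 ann N B≤N = trans (⊛-cyclotomicLogDeriv-beyond R B R≥B≡0 N B≤N) (cong -_ (ann (+ N)))

    Annihilates-⊛ : ∀ {F} BF → VanishesFrom F BF → Annihilates d F BF →
                    ∀ BQ Q → VanishesFrom Q BQ → Annihilates d (Q ⊛ F) (BQ ℕ.+ BF)
    Annihilates-⊛ {F} BF F≥BF≡0 annF zero    Q Q≡0 l =
      trans (ramanujanPairing-cong BF l (⊛-zeroˡ F (λ N → Q≡0 N z≤n))) (∑-zero BF (λ _ _ → refl))
    Annihilates-⊛ {F} BF F≥BF≡0 annF (suc b) Q Q>b≡0 l = begin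
      ramanujanPairing d (Q ⊛ F) (suc b ℕ.+ BF) l
        ≡⟨ ramanujanPairing-cong (suc b ℕ.+ BF) l split ⟩
      ramanujanPairing d (Q 0 · F ⊕ X· (tailₛ Q ⊛ F)) (suc b ℕ.+ BF) l
        ≡⟨ ramanujanPairing-⊕ (Q 0 · F) (X· (tailₛ Q ⊛ F)) (suc b ℕ.+ BF) l ⟩
      ramanujanPairing d (Q 0 · F) (suc b ℕ.+ BF) l + ramanujanPairing d (X· (tailₛ Q ⊛ F)) (suc b ℕ.+ BF) l
        ≡⟨ cong₂ _+_ constant-part tail-part ⟩
      + 0 ∎
      where
      open ≡-Reasoning
      split : Q ⊛ F ≈ Q 0 · F ⊕ X· (tailₛ Q ⊛ F)
      split zero    = sym (ℤP.+-identityʳ _)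
      split (suc N) = refl
      constant-part : ramanujanPairing d (Q 0 · F) (suc b ℕ.+ BF) l ≡ + 0
      constant-part = begin
        ramanujanPairing d (Q 0 · F) (suc b ℕ.+ BF) l   ≡⟨ ramanujanPairing-· (Q 0) F (suc b ℕ.+ BF) l ⟩
        Q 0 * ramanujanPairing d F (suc b ℕ.+ BF) l     ≡⟨ cong (Q 0 *_) (ramanujanPairing-extend BF (suc b ℕ.+ BF) l F≥BF≡0 (ℕP.m≤n+m BF (suc b))) ⟩
        Q 0 * ramanujanPairing d F BF l                 ≡⟨ cong (Q 0 *_) (annF l) ⟩
        Q 0 * + 0                                       ≡⟨ ℤP.*-zeroʳ (Q 0) ⟩
        + 0                                             ∎
      shift : ∀ k → l - + suc k ≡ (l - + 1) - + k
      shift k = trans (cong (λ x → l - x) (ℤP.pos-+ 1 k)) (reassoc l (+ k))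
        where
        reassoc : ∀ l k → l - (+ 1 + k) ≡ (l - + 1) - k
        reassoc = solve-∀
      tail-part : ramanujanPairing d (X· (tailₛ Q ⊛ F)) (suc b ℕ.+ BF) l ≡ + 0
      tail-part = trans (ℤP.+-identityˡ _)
        (trans (∑-cong (b ℕ.+ BF) (λ k → cong (λ i → (tailₛ Q ⊛ F) k * ramanujan d i) (shift k)))
               (Annihilates-⊛ BF F≥BF≡0 annF b (tailₛ Q) (λ N b≤N → Q>b≡0 (suc N) (s≤s b≤N)) (l - + 1)))

  module _ (d : ℕ) .{{_ : NonZero d}} where

    ramanujanPairing-periodic : ∀ F B l t → ramanujanPairing d F B (l + + (t ℕ.* d)) ≡ ramanujanPairing d F B l
    ramanujanPairing-periodic F B l t = ∑-cong B (λ k → cong (F k *_) (ramanujan-periodic d (l + + (t ℕ.* d) - + k) (l - + k) (d∣diff k)))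
      where
      cancel : ∀ l T k → T ≡ (l + T - k) - (l - k)
      cancel = solve-∀
      d∣diff : ∀ k → (+ d) ℤD.∣ ((l + + (t ℕ.* d) - + k) - (l - + k))
      d∣diff k = subst ((+ d) ℤD.∣_) (cancel l (+ (t ℕ.* d)) (+ k)) (ℤD.∣ᵤ⇒∣ {+ d} {+ (t ℕ.* d)} (ND.n∣m*n t))

    -- Newton's identities: beyond the degree of F, the coefficient of θ F = F L is minus the pairing;
    -- periodicity of c_d moves every l beyond the degree.
    LogDerivative⇒Annihilates : ∀ F B → LogDerivative F (cyclotomicLogDeriv d) → VanishesFrom F B → Annihilates d F B
    LogDerivative⇒Annihilates F B θF≈FL F≥B≡0 = annihilates
      where
      beyond : ∀ N → B ≤ N → ramanujanPairing d F B (+ N) ≡ + 0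
      beyond N B≤N = ℤP.neg-injective (begin
        - ramanujanPairing d F B (+ N)        ≡⟨ sym (⊛-cyclotomicLogDeriv-beyond d F B F≥B≡0 N B≤N) ⟩
        (F ⊛ cyclotomicLogDeriv d) N          ≡⟨ sym (θF≈FL N) ⟩
        + N * F N                             ≡⟨ cong (+ N *_) (F≥B≡0 N B≤N) ⟩
        + N * + 0                             ≡⟨ ℤP.*-zeroʳ (+ N) ⟩
        - + 0                                 ∎)
        where open ≡-Reasoning
      annihilates : ∀ l → ramanujanPairing d F B l ≡ + 0
      annihilates (+ n) = begin
        ramanujanPairing d F B (+ n)                     ≡⟨ sym (ramanujanPairing-periodic F B (+ n) B) ⟩
        ramanujanPairing d F B (+ n + + (B ℕ.* d))        ≡⟨ cong (ramanujanPairing d F B) (sym (ℤP.pos-+ n (B ℕ.* d))) ⟩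
        ramanujanPairing d F B (+ (n ℕ.+ B ℕ.* d))        ≡⟨ beyond (n ℕ.+ B ℕ.* d) (ℕP.≤-trans (ℕP.m≤m*n B d) (ℕP.m≤n+m (B ℕ.* d) n)) ⟩
        + 0                                              ∎
        where open ≡-Reasoning
      annihilates -[1+ n ] = begin
        ramanujanPairing d F B -[1+ n ]                     ≡⟨ sym (ramanujanPairing-periodic F B -[1+ n ] t) ⟩
        ramanujanPairing d F B (-[1+ n ] + + (t ℕ.* d))     ≡⟨ cong (ramanujanPairing d F B) (ℤP.⊖-≥ n<td) ⟩
        ramanujanPairing d F B (+ (t ℕ.* d ∸ suc n))        ≡⟨ beyond (t ℕ.* d ∸ suc n) B≤td∸n ⟩
        + 0                                                 ∎
        where
        open ≡-Reasoning
        t = suc n ℕ.+ B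
        t≤td : t ≤ t ℕ.* d
        t≤td = ℕP.m≤m*n t d
        n<td : suc n ≤ t ℕ.* d
        n<td = ℕP.≤-trans (ℕP.m≤m+n (suc n) B) t≤td
        B≤td∸n : B ≤ t ℕ.* d ∸ suc n
        B≤td∸n = ℕP.m+n≤o⇒m≤o∸n B (ℕP.≤-trans (ℕP.≤-reflexive (ℕP.+-comm B (suc n))) t≤td)

    coprime-inverse : ∀ {p} → Coprime p d → ∀ l → ∃ λ l′ → (+ d) ℤD.∣ (l - + p * l′)
    coprime-inverse {p} p⊥d l with NC.coprime-Bézout p⊥d
    ... | Bézout.+- x y 1+yd≡xp = + x * l , ℤD.divides (- (+ y * l)) (begin
      l - + p * (+ x * l)              ≡⟨ reassoc l (+ p) (+ x) ⟩
      l - (+ x * + p) * l              ≡⟨ cong (λ z → l - z * l) xp≡1+yd ⟩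
      l - (+ 1 + + y * + d) * l        ≡⟨ expand l (+ y) (+ d) ⟩
      - (+ y * l) * + d                ∎)
      where
      open ≡-Reasoning
      reassoc : ∀ l p x → l - p * (x * l) ≡ l - (x * p) * l
      reassoc = solve-∀
      expand : ∀ l y d → l - (+ 1 + y * d) * l ≡ - (y * l) * d
      expand = solve-∀
      xp≡1+yd : + x * + p ≡ + 1 + + y * + d
      xp≡1+yd = trans (sym (ℤP.pos-* x p)) (trans (cong +_ (sym 1+yd≡xp)) (trans (ℤP.pos-+ 1 (y ℕ.* d)) (cong (_+_ (+ 1)) (ℤP.pos-* y d))))
    ... | Bézout.-+ x y 1+xp≡yd = - (+ x) * l , ℤD.divides (+ y * l) (begin
      l - + p * (- (+ x) * l)          ≡⟨ reassoc l (+ p) (+ x) ⟩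
      (+ 1 + + x * + p) * l            ≡⟨ cong (_* l) 1+xp≡yd′ ⟩
      + y * + d * l                    ≡⟨ right-comm (+ y) (+ d) l ⟩
      + y * l * + d                    ∎)
      where
      open ≡-Reasoning
      reassoc : ∀ l p x → l - p * (- x * l) ≡ (+ 1 + x * p) * l
      reassoc = solve-∀
      right-comm : ∀ y d l → y * d * l ≡ y * l * d
      right-comm = solve-∀
      1+xp≡yd′ : + 1 + + x * + p ≡ + y * + d
      1+xp≡yd′ = trans (cong (_+_ (+ 1)) (sym (ℤP.pos-* x p))) (trans (sym (ℤP.pos-+ 1 (x ℕ.* p))) (trans (cong +_ 1+xp≡yd) (ℤP.pos-* y d)))

    -- For p ∤ d, c_d(l - jp) = c_d(p (l′ - j)) = c_d(l′ - j) where p l′ ≡ l (mod d).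
    Annihilates-dilate : ∀ {p} (pp : Prime p) → ¬ (p ∣ d) → ∀ F B → VanishesFrom F B → Annihilates d F B →
                         Annihilates d (dilate p {{prime⇒nonZero pp}} F) (B ℕ.* p)
    Annihilates-dilate {p} pp p∤d F B F≥B≡0 annF l = begin
      ramanujanPairing d (dilate p F) (B ℕ.* p) l
        ≡⟨ ∑-multiples p B (λ k → dilate p F k * ramanujan d (l - + k)) off-multiples ⟩
      ∑ B (λ j → dilate p F (j ℕ.* p) * ramanujan d (l - + (j ℕ.* p)))
        ≡⟨ ∑-cong B (λ j → cong₂ _*_ (dilate-on p F j) (reindex j)) ⟩
      ramanujanPairing d F B l′
        ≡⟨ annF l′ ⟩
      + 0 ∎
      where
      open ≡-Reasoning
      instance
        p≢0 : NonZero p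
        p≢0 = prime⇒nonZero pp
      p⊥d : Coprime p d
      p⊥d = prime∤⇒coprime pp p∤d
      l′ : ℤ
      l′ = proj₁ (coprime-inverse p⊥d l)
      off-multiples : ∀ k → ¬ (p ∣ k) → dilate p F k * ramanujan d (l - + k) ≡ + 0
      off-multiples k p∤k = cong (_* ramanujan d (l - + k)) (dilate-off p F k p∤k)
      reindex : ∀ j → ramanujan d (l - + (j ℕ.* p)) ≡ ramanujan d (l′ - + j)
      reindex j = begin
        ramanujan d (l - + (j ℕ.* p))        ≡⟨ ramanujan-periodic d (l - + (j ℕ.* p)) (+ p * (l′ - + j)) d∣diff ⟩
        ramanujan d (+ p * (l′ - + j))       ≡⟨ ramanujan-coprime-scale d p (l′ - + j) p⊥d ⟩
        ramanujan d (l′ - + j)               ∎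
        where
        rearrange : ∀ l a p j → (l - j * p) - p * (a - j) ≡ l - p * a
        rearrange = solve-∀
        d∣diff : (+ d) ℤD.∣ ((l - + (j ℕ.* p)) - + p * (l′ - + j))
        d∣diff = subst ((+ d) ℤD.∣_) (sym (trans (cong (λ z → (l - z) - + p * (l′ - + j)) (ℤP.pos-* j p)) (rearrange l l′ (+ p) (+ j))))
                   (proj₂ (coprime-inverse p⊥d l))

  xPowMinusOneₛ : ℕ → Series
  xPowMinusOneₛ e = Xpow e 1ₛ ⊕ ⊝ 1ₛ

  -- (x^e - 1)⁻¹ = -(1 + x^e + x^{2e} + …)
  invXPowMinusOneₛ : ℕ → Series
  invXPowMinusOneₛ e N = -[1+ 0 ] when (e ∣ᵇ N)

  -- θ(x^e - 1) / (x^e - 1) = e x^e (x^e - 1)⁻¹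
  logDerivXPowMinusOne : ℕ → Series
  logDerivXPowMinusOne e = + e · Xpow e (invXPowMinusOneₛ e)

  xPowMinusOneₛ-⊛ : ∀ e h → xPowMinusOneₛ e ⊛ h ≈ Xpow e h ⊕ ⊝ h
  xPowMinusOneₛ-⊛ e h = ≈-trans (⊛-distribʳ-⊕ (Xpow e 1ₛ) (⊝ 1ₛ) h)
    (⊕-cong (≈-trans (Xpow-⊛ e 1ₛ h) (Xpow-cong e (⊛-identityˡ h))) (≈-trans (⊛-⊝ˡ 1ₛ h) (λ N → cong -_ (⊛-identityˡ h N))))

  θ-xPowMinusOneₛ : ∀ e → θ (xPowMinusOneₛ e) ≈ + e · Xpow e 1ₛ
  θ-xPowMinusOneₛ e N with N ℕP.≟ e
  ... | yes refl = on-diagonal N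
    where
    on-diagonal : ∀ N → + N * (Xpow N 1ₛ N + - 1ₛ N) ≡ + N * Xpow N 1ₛ N
    on-diagonal zero    = refl
    on-diagonal (suc N) = cong (+ suc N *_) (ℤP.+-identityʳ _)
  ... | no N≢e = trans (cong (λ x → + N * (x + - 1ₛ N)) (Xpow-1ₛ-≢ e N N≢e))
                       (trans (off-diagonal N) (sym (trans (cong (+ e *_) (Xpow-1ₛ-≢ e N N≢e)) (ℤP.*-zeroʳ (+ e)))))
    where
    off-diagonal : ∀ N → + N * (+ 0 + - 1ₛ N) ≡ + 0
    off-diagonal zero    = refl
    off-diagonal (suc N) = ℤP.*-zeroʳ (+ suc N)

  module _ (e : ℕ) .{{_ : NonZero e}} where

    private
      ∣ᵇ-shift : ∀ N → e ≤ N → (e ∣ᵇ (N ∸ e)) ≡ (e ∣ᵇ N)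
      ∣ᵇ-shift N e≤N = ∣ᵇ-cong (λ e∣N∸e → subst (e ∣_) (ℕP.m∸n+n≡m e≤N) (ND.∣m∣n⇒∣m+n e∣N∸e ND.∣-refl))
                               (λ e∣N → ND.∣m+n∣m⇒∣n (subst (e ∣_) (sym (ℕP.m+[n∸m]≡n e≤N)) e∣N) ND.∣-refl)

      e∤small : ∀ n → suc n < e → ¬ (e ∣ suc n)
      e∤small n n<e e∣n = ℕP.<⇒≱ n<e (ND.∣⇒≤ e∣n)

    xPowMinusOneₛ-inverse : xPowMinusOneₛ e ⊛ invXPowMinusOneₛ e ≈ 1ₛ
    xPowMinusOneₛ-inverse N = trans (xPowMinusOneₛ-⊛ e (invXPowMinusOneₛ e) N) (coeff N)
      where
      coeff : ∀ N → Xpow e (invXPowMinusOneₛ e) N + - invXPowMinusOneₛ e N ≡ 1ₛ N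
      coeff N with N ℕP.<? e
      coeff zero    | yes 0<e rewrite Xpow-< e (invXPowMinusOneₛ e) 0 0<e | ∣⇒∣ᵇ≡true (e ND.∣0) = refl
      coeff (suc n) | yes n<e rewrite Xpow-< e (invXPowMinusOneₛ e) (suc n) n<e | ∤⇒∣ᵇ≡false (e∤small n n<e) = refl
      coeff N       | no  N≮e = begin
        Xpow e (invXPowMinusOneₛ e) N + - invXPowMinusOneₛ e N   ≡⟨ cong (_+ - invXPowMinusOneₛ e N) (Xpow-≥ e _ N (ℕP.≮⇒≥ N≮e)) ⟩
        invXPowMinusOneₛ e (N ∸ e) + - invXPowMinusOneₛ e N      ≡⟨ cong (λ b → (-[1+ 0 ] when b) + - invXPowMinusOneₛ e N) (∣ᵇ-shift N (ℕP.≮⇒≥ N≮e)) ⟩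
        invXPowMinusOneₛ e N + - invXPowMinusOneₛ e N            ≡⟨ ℤP.+-inverseʳ (invXPowMinusOneₛ e N) ⟩
        + 0                                                       ≡⟨ sym (positive N (ℕP.≤-trans (ℕ.>-nonZero⁻¹ e) (ℕP.≮⇒≥ N≮e))) ⟩
        1ₛ N                                                      ∎
        where
        open ≡-Reasoning
        positive : ∀ N → 1 ≤ N → 1ₛ N ≡ + 0
        positive (suc N) _ = refl

    LogDerivative-xPowMinusOneₛ : LogDerivative (xPowMinusOneₛ e) (logDerivXPowMinusOne e)
    LogDerivative-xPowMinusOneₛ = begin
      θ (xPowMinusOneₛ e)                                        ≈⟨ θ-xPowMinusOneₛ e ⟩
      + e · Xpow e 1ₛ                                            ≈⟨ ·-cong (+ e) (Xpow-cong e (≈-sym xPowMinusOneₛ-inverse)) ⟩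
      + e · Xpow e (xPowMinusOneₛ e ⊛ invXPowMinusOneₛ e)         ≈⟨ ·-cong (+ e) (Xpow-cong e (⊛-comm _ _)) ⟩
      + e · Xpow e (invXPowMinusOneₛ e ⊛ xPowMinusOneₛ e)         ≈⟨ ·-cong (+ e) (≈-sym (Xpow-⊛ e _ _)) ⟩
      + e · (Xpow e (invXPowMinusOneₛ e) ⊛ xPowMinusOneₛ e)       ≈⟨ ≈-sym (⊛-·ˡ (+ e) _ _) ⟩
      logDerivXPowMinusOne e ⊛ xPowMinusOneₛ e                   ≈⟨ ⊛-comm _ _ ⟩
      xPowMinusOneₛ e ⊛ logDerivXPowMinusOne e                   ∎
      where open ≈-Reasoning

    LogDerivative-invXPowMinusOneₛ : LogDerivative (invXPowMinusOneₛ e) (⊝ (logDerivXPowMinusOne e))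
    LogDerivative-invXPowMinusOneₛ = LogDerivative-inverse xPowMinusOneₛ-inverse LogDerivative-xPowMinusOneₛ

    logDerivXPowMinusOne-0 : logDerivXPowMinusOne e 0 ≡ + 0
    logDerivXPowMinusOne-0 = trans (cong (+ e *_) (Xpow-< e _ 0 (ℕ.>-nonZero⁻¹ e))) (ℤP.*-zeroʳ (+ e))

    logDerivXPowMinusOne-suc : ∀ N → logDerivXPowMinusOne e (suc N) ≡ (- + e) when (e ∣ᵇ suc N)
    logDerivXPowMinusOne-suc N with suc N ℕP.<? e
    ... | yes N<e rewrite Xpow-< e (invXPowMinusOneₛ e) (suc N) N<e | ∤⇒∣ᵇ≡false (e∤small N N<e) = ℤP.*-zeroʳ (+ e)
    ... | no  N≮e = begin
      + e * Xpow e (invXPowMinusOneₛ e) (suc N)   ≡⟨ cong (+ e *_) (Xpow-≥ e _ (suc N) (ℕP.≮⇒≥ N≮e)) ⟩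
      + e * (-[1+ 0 ] when (e ∣ᵇ (suc N ∸ e)))    ≡⟨ cong (λ b → + e * (-[1+ 0 ] when b)) (∣ᵇ-shift (suc N) (ℕP.≮⇒≥ N≮e)) ⟩
      + e * (-[1+ 0 ] when (e ∣ᵇ suc N))          ≡⟨ sym (when-*ˡ (e ∣ᵇ suc N) (+ e) -[1+ 0 ]) ⟩
      (+ e * -[1+ 0 ]) when (e ∣ᵇ suc N)          ≡⟨ cong (_when (e ∣ᵇ suc N)) (ℤP.*-comm (+ e) -[1+ 0 ]) ⟩
      (-[1+ 0 ] * + e) when (e ∣ᵇ suc N)          ≡⟨ cong (_when (e ∣ᵇ suc N)) (ℤP.-1*i≡-i (+ e)) ⟩
      (- + e) when (e ∣ᵇ suc N)                   ∎
      where open ≡-Reasoning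

  cycloFactorₛ : ℕ → ℕ → Series
  cycloFactorₛ d k with μ (d / suc k)
  ... | + 1      = xPowMinusOneₛ (suc k)
  ... | -[1+ 0 ] = invXPowMinusOneₛ (suc k)
  ... | _        = 1ₛ

  cyclotomicₛ : ℕ → Series
  cyclotomicₛ d = foldr _⊛_ 1ₛ (map (cycloFactorₛ d) (divisorsPred d))

  logDerivFactor : ℕ → ℕ → Series
  logDerivFactor d k = μ (d / suc k) · logDerivXPowMinusOne (suc k)

  LogDerivative-cycloFactorₛ : ∀ d k → LogDerivative (cycloFactorₛ d k) (logDerivFactor d k)
  LogDerivative-cycloFactorₛ d k with μ (d / suc k) | μ-values (d / suc k)
  ... | + 1      | _ = LogDerivative-cong ≈-refl (λ N → sym (ℤP.*-identityˡ _)) (LogDerivative-xPowMinusOneₛ (suc k))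
  ... | -[1+ 0 ] | _ = LogDerivative-cong ≈-refl (λ N → sym (ℤP.-1*i≡-i _)) (LogDerivative-invXPowMinusOneₛ (suc k))
  ... | + 0      | _ = LogDerivative-1
  ... | + suc (suc _) | inj₂ (inj₁ ())
  ... | + suc (suc _) | inj₂ (inj₂ ())
  ... | -[1+ suc _ ]  | inj₂ (inj₁ ())
  ... | -[1+ suc _ ]  | inj₂ (inj₂ ())

  LogDerivative-cyclotomicₛ : ∀ d .{{_ : NonZero d}} → LogDerivative (cyclotomicₛ d) (cyclotomicLogDeriv d)
  LogDerivative-cyclotomicₛ d = LogDerivative-cong ≈-refl ∑-logDerivFactor (LogDerivative-product (divisorsPred d))
    where
    LogDerivative-product : ∀ ks → LogDerivative (foldr _⊛_ 1ₛ (map (cycloFactorₛ d) ks)) (foldr _⊕_ 0ₛ (map (logDerivFactor d) ks))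
    LogDerivative-product []       = LogDerivative-1
    LogDerivative-product (k ∷ ks) = LogDerivative-⊛ (LogDerivative-cycloFactorₛ d k) (LogDerivative-product ks)

    foldr-⊕-coeff : ∀ (F : ℕ → Series) ks N → foldr _⊕_ 0ₛ (map F ks) N ≡ foldr _+_ (+ 0) (map (λ k → F k N) ks)
    foldr-⊕-coeff F []       N = refl
    foldr-⊕-coeff F (k ∷ ks) N = cong (_+_ (F k N)) (foldr-⊕-coeff F ks N)

    -- logDerivFactor d k N, indexed by the divisor e = suc k instead of k
    term : ℕ → ℕ → ℤ
    term N zero    = + 0
    term N (suc k) = logDerivFactor d k N

    ∑-logDerivFactor : foldr _⊕_ 0ₛ (map (logDerivFactor d) (divisorsPred d)) ≈ cyclotomicLogDeriv d
    ∑-logDerivFactor N = begin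
      foldr _⊕_ 0ₛ (map (logDerivFactor d) (divisorsPred d)) N    ≡⟨ foldr-⊕-coeff (logDerivFactor d) (divisorsPred d) N ⟩
      foldr _+_ (+ 0) (map (λ k → term N (suc k)) (divisorsPred d)) ≡⟨ foldr-divisorsPred d (term N) ⟩
      ∑∣ d (term N)                                                  ≡⟨ at N ⟩
      cyclotomicLogDeriv d N                                         ∎
      where
      open ≡-Reasoning
      at : ∀ N → ∑∣ d (term N) ≡ cyclotomicLogDeriv d N
      at zero    = trans (∑∣-cong d on-divisors) (∑-zero (suc d) (λ e _ → 0-when (e ∣ᵇ d)))
        where
        on-divisors : ∀ e → e ∣ d → term 0 e ≡ + 0
        on-divisors zero    _ = refl
        on-divisors (suc k) _ = trans (cong (μ (d / suc k) *_) (logDerivXPowMinusOne-0 (suc k))) (ℤP.*-zeroʳ (μ (d / suc k)))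
      at (suc N) = begin
        ∑∣ d (term (suc N))                          ≡⟨ ∑∣-cong d on-divisors ⟩
        ∑∣ d (λ e → - ramanujanTerm d (suc N) e)     ≡⟨ ∑∣-neg d (ramanujanTerm d (suc N)) ⟩
        - ∑∣ d (ramanujanTerm d (suc N))             ≡⟨ cong -_ (sym (ramanujan-∑∣ d (suc N))) ⟩
        - ramanujan d (+ suc N)                      ∎
        where
        on-divisors : ∀ e → e ∣ d → term (suc N) e ≡ - ramanujanTerm d (suc N) e
        on-divisors zero    _ = refl
        on-divisors (suc k) _ = begin
          μ (d / suc k) * logDerivXPowMinusOne (suc k) (suc N)    ≡⟨ cong (μ (d / suc k) *_) (logDerivXPowMinusOne-suc (suc k) N) ⟩
          μ (d / suc k) * ((- + suc k) when (suc k ∣ᵇ suc N))      ≡⟨ sym (when-*ˡ (suc k ∣ᵇ suc N) (μ (d / suc k)) (- + suc k)) ⟩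
          (μ (d / suc k) * - + suc k) when (suc k ∣ᵇ suc N)        ≡⟨ cong (_when (suc k ∣ᵇ suc N)) (sym (ℤP.neg-distribʳ-* (μ (d / suc k)) (+ suc k))) ⟩
          (- (μ (d / suc k) * + suc k)) when (suc k ∣ᵇ suc N)      ≡⟨ when-neg (suc k ∣ᵇ suc N) _ ⟩
          - ramanujanTerm d (suc N) (suc k)                        ∎

  Unit-cyclotomicₛ-0 : ∀ d → Unit (cyclotomicₛ d 0)
  Unit-cyclotomicₛ-0 d = product (divisorsPred d)
    where
    factor : ∀ k → Unit (cycloFactorₛ d k 0)
    factor k with μ (d / suc k)
    ... | + 1           = inj₂ refl
    ... | -[1+ 0 ]      rewrite ∣⇒∣ᵇ≡true (suc k ND.∣0) = inj₂ refl
    ... | + 0           = inj₁ refl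
    ... | + suc (suc _) = inj₁ refl
    ... | -[1+ suc _ ]  = inj₁ refl
    product : ∀ ks → Unit (foldr _⊛_ 1ₛ (map (cycloFactorₛ d) ks) 0)
    product []       = inj₁ refl
    product (k ∷ ks) = Unit-* (factor k) (product ks)

  -- Polynomiality of the cyclotomic series, by induction on the prime factorisation

  record IsCyclotomicPolynomial (d : ℕ) : Set where
    field
      degree            : ℕ
      degree≤d          : degree ≤ d
      vanishes          : VanishesFrom (cyclotomicₛ d) (suc degree)
      leading-unit      : Unit (cyclotomicₛ d degree)
      cofactor          : Series
      cofactorBound     : ℕ
      cofactor-vanishes : VanishesFrom cofactor cofactorBound
      sign              : ℤ
      sign-unit         : Unit sign
      cofactor-product  : cyclotomicₛ d ⊛ cofactor ≈ sign · xPowMinusOneₛ d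

  IsCyclotomicPolynomial-1 : IsCyclotomicPolynomial 1
  IsCyclotomicPolynomial-1 = record
    { degree = 1 ; degree≤d = ℕP.≤-refl
    ; vanishes = VanishesFrom-cong (≈-sym Φ₁≈x-1) x-1≥2≡0 ; leading-unit = inj₁ (Φ₁≈x-1 1)
    ; cofactor = 1ₛ ; cofactorBound = 1 ; cofactor-vanishes = VanishesFrom-1
    ; sign = + 1 ; sign-unit = inj₁ refl
    ; cofactor-product = ≈-trans (⊛-comm (cyclotomicₛ 1) 1ₛ) (≈-trans (⊛-identityˡ _) (≈-trans Φ₁≈x-1 (λ N → sym (ℤP.*-identityˡ _)))) }
    where
    Φ₁≈x-1 : cyclotomicₛ 1 ≈ xPowMinusOneₛ 1
    Φ₁≈x-1 = ≈-trans (⊛-comm (xPowMinusOneₛ 1) 1ₛ) (⊛-identityˡ (xPowMinusOneₛ 1))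
    x-1≥2≡0 : VanishesFrom (xPowMinusOneₛ 1) 2
    x-1≥2≡0 (suc (suc n)) _         = refl
    x-1≥2≡0 (suc zero)    (s≤s ())

  cyclotomicLogDeriv-suc : ∀ d N → 1 ≤ N → cyclotomicLogDeriv d N ≡ - ramanujan d (+ N)
  cyclotomicLogDeriv-suc d (suc N) _ = refl

  module _ {p} (pp : Prime p) (m : ℕ) .{{_ : NonZero m}} where

    private
      instance
        p≢0 : NonZero p
        p≢0 = prime⇒nonZero pp

    dilate-cyclotomicLogDeriv-suc : ∀ n → dilate p (cyclotomicLogDeriv m) (suc n) ≡ (- ramanujan m (+ (suc n / p))) when (p ∣ᵇ suc n)
    dilate-cyclotomicLogDeriv-suc n with p ∣? suc n
    ... | no  _     = refl
    ... | yes p∣1+n = cyclotomicLogDeriv-suc m (suc n / p) (m≥n⇒m/n>0 (ND.∣⇒≤ p∣1+n))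

    cyclotomicLogDeriv-prime : ∀ {b} → (p ∣ᵇ m) ≡ b → ∀ N →
      (cyclotomicLogDeriv m N when not b) + cyclotomicLogDeriv (m ℕ.* p) N ≡ (+ p · dilate p (cyclotomicLogDeriv m)) N
    cyclotomicLogDeriv-prime refl zero    = trans (cong (_+ + 0) (0-when (not (p ∣ᵇ m))))
                                             (sym (trans (cong (+ p *_) (dilate-0 p (cyclotomicLogDeriv m))) (ℤP.*-zeroʳ (+ p))))
    cyclotomicLogDeriv-prime refl (suc n) = begin
      ((- c m N) when not (p ∣ᵇ m)) + - c (m ℕ.* p) N      ≡⟨ cong (_+ - c (m ℕ.* p) N) (when-neg (not (p ∣ᵇ m)) (c m N)) ⟩
      - (c m N when not (p ∣ᵇ m)) + - c (m ℕ.* p) N        ≡⟨ sym (ℤP.neg-distrib-+ (c m N when not (p ∣ᵇ m)) (c (m ℕ.* p) N)) ⟩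
      - ((c m N when not (p ∣ᵇ m)) + c (m ℕ.* p) N)        ≡⟨ cong -_ (ramanujan-prime-step pp m N) ⟩
      - ((+ p * c m (N / p)) when (p ∣ᵇ N))                ≡⟨ sym (when-neg (p ∣ᵇ N) (+ p * c m (N / p))) ⟩
      (- (+ p * c m (N / p))) when (p ∣ᵇ N)                ≡⟨ cong (_when (p ∣ᵇ N)) (ℤP.neg-distribʳ-* (+ p) (c m (N / p))) ⟩
      (+ p * - c m (N / p)) when (p ∣ᵇ N)                  ≡⟨ when-*ˡ (p ∣ᵇ N) (+ p) (- c m (N / p)) ⟩
      + p * ((- c m (N / p)) when (p ∣ᵇ N))                ≡⟨ cong (+ p *_) (sym (dilate-cyclotomicLogDeriv-suc n)) ⟩
      + p * dilate p (cyclotomicLogDeriv m) N              ∎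
      where
      open ≡-Reasoning
      N = suc n
      c : ℕ → ℕ → ℤ
      c d N = ramanujan d (+ N)

    LogDerivative-dilate-cyclotomicₛ : LogDerivative (dilate p (cyclotomicₛ m)) (+ p · dilate p (cyclotomicLogDeriv m))
    LogDerivative-dilate-cyclotomicₛ = begin
      θ (dilate p F)                                       ≈⟨ θ-dilate p F ⟩
      + p · dilate p (θ F)                                 ≈⟨ ·-cong (+ p) (dilate-cong p (LogDerivative-cyclotomicₛ m)) ⟩
      + p · dilate p (F ⊛ cyclotomicLogDeriv m)            ≈⟨ ·-cong (+ p) (dilate-⊛ p F (cyclotomicLogDeriv m)) ⟩
      + p · (dilate p F ⊛ dilate p (cyclotomicLogDeriv m)) ≈⟨ ≈-sym (⊛-·ʳ (+ p) (dilate p F) _) ⟩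
      dilate p F ⊛ (+ p · dilate p (cyclotomicLogDeriv m)) ∎
      where
      open ≈-Reasoning
      F = cyclotomicₛ m

    private
      S = dilate p (cyclotomicₛ m)

      Unit-S-0 : Unit (S 0)
      Unit-S-0 = subst Unit (sym (dilate-0 p (cyclotomicₛ m))) (Unit-cyclotomicₛ-0 m)

      dilate-logDeriv-0 : (+ p · dilate p (cyclotomicLogDeriv m)) 0 ≡ + 0
      dilate-logDeriv-0 = trans (cong (+ p *_) (dilate-0 p (cyclotomicLogDeriv m))) (ℤP.*-zeroʳ (+ p))

    cyclotomicₛ-prime-dividing : p ∣ m → ∃ λ ε → Unit ε × cyclotomicₛ (m ℕ.* p) ≈ ε · dilate p (cyclotomicₛ m)
    cyclotomicₛ-prime-dividing p∣m =
      S 0 * cyclotomicₛ (m ℕ.* p) 0 , Unit-* Unit-S-0 (Unit-cyclotomicₛ-0 (m ℕ.* p)) ,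
      Unit-solve Unit-S-0 (LogDerivative-unique (LogDerivative-cyclotomicₛ (m ℕ.* p) {{ℕP.m*n≢0 m p}}) LogDerivative-S (refl))
      where
      same-logDeriv : cyclotomicLogDeriv (m ℕ.* p) ≈ + p · dilate p (cyclotomicLogDeriv m)
      same-logDeriv N = trans (sym (ℤP.+-identityˡ _)) (cyclotomicLogDeriv-prime (∣⇒∣ᵇ≡true p∣m) N)
      LogDerivative-S : LogDerivative S (cyclotomicLogDeriv (m ℕ.* p))
      LogDerivative-S = LogDerivative-cong ≈-refl (≈-sym same-logDeriv) LogDerivative-dilate-cyclotomicₛ

    cyclotomicₛ-prime-coprime : ¬ (p ∣ m) → ∃ λ ε → Unit ε × cyclotomicₛ (m ℕ.* p) ⊛ cyclotomicₛ m ≈ ε · dilate p (cyclotomicₛ m)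
    cyclotomicₛ-prime-coprime p∤m =
      S 0 * G 0 , Unit-* Unit-S-0 (Unit-* (Unit-cyclotomicₛ-0 (m ℕ.* p)) (Unit-cyclotomicₛ-0 m)) ,
      Unit-solve Unit-S-0 (LogDerivative-unique LogDerivative-G LogDerivative-dilate-cyclotomicₛ dilate-logDeriv-0)
      where
      G = cyclotomicₛ (m ℕ.* p) ⊛ cyclotomicₛ m
      sum-logDeriv : cyclotomicLogDeriv (m ℕ.* p) ⊕ cyclotomicLogDeriv m ≈ + p · dilate p (cyclotomicLogDeriv m)
      sum-logDeriv N = trans (ℤP.+-comm (cyclotomicLogDeriv (m ℕ.* p) N) (cyclotomicLogDeriv m N))
        (cyclotomicLogDeriv-prime (∤⇒∣ᵇ≡false p∤m) N)
      LogDerivative-G : LogDerivative G (+ p · dilate p (cyclotomicLogDeriv m))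
      LogDerivative-G = LogDerivative-cong ≈-refl sum-logDeriv
        (LogDerivative-⊛ (LogDerivative-cyclotomicₛ (m ℕ.* p) {{ℕP.m*n≢0 m p}}) (LogDerivative-cyclotomicₛ m))

    dilate-xPowMinusOneₛ : dilate p (xPowMinusOneₛ m) ≈ xPowMinusOneₛ (m ℕ.* p)
    dilate-xPowMinusOneₛ = ≈-trans (dilate-⊕ p (Xpow m 1ₛ) (⊝ 1ₛ))
      (⊕-cong (dilate-Xpow-1ₛ p m) (≈-trans (dilate-⊝ p 1ₛ) (λ N → cong -_ (dilate-Xpow-1ₛ p 0 N))))

  module _ {m} .{{_ : NonZero m}} (Φₘ : IsCyclotomicPolynomial m) where

    open IsCyclotomicPolynomial Φₘ

    private
      F = cyclotomicₛ m
      L = cyclotomicLogDeriv m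

      annihilates-Φₘ : Annihilates m F (suc degree)
      annihilates-Φₘ = LogDerivative⇒Annihilates m F (suc degree) (LogDerivative-cyclotomicₛ m) vanishes

      -- F D = ε (x^m - 1) gives F A + θF D = ε m with A = θD - m D, since θ(x^m - 1) = m x^m.
      bezout : F ⊛ (θ cofactor ⊕ ⊝ (+ m · cofactor)) ⊕ θ F ⊛ cofactor ≈ (sign * + m) · 1ₛ
      bezout N = begin
        (F ⊛ A) N + (θ F ⊛ D) N
          ≡⟨ cong (_+ (θ F ⊛ D) N) (trans (⊛-distribˡ-⊕ F (θ D) (⊝ (+ m · D)) N)
               (cong (_+_ ((F ⊛ θ D) N)) (trans (⊛-⊝ʳ F (+ m · D) N) (cong -_ (⊛-·ʳ (+ m) F D N))))) ⟩
        (F ⊛ θ D) N + - (+ m * (F ⊛ D) N) + (θ F ⊛ D) N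
          ≡⟨ regroup ((F ⊛ θ D) N) (+ m * (F ⊛ D) N) ((θ F ⊛ D) N) ⟩
        ((θ F ⊛ D) N + (F ⊛ θ D) N) - + m * (F ⊛ D) N
          ≡⟨ cong₂ (λ a b → a - + m * b) (sym (θ-⊛ F D N)) (cofactor-product N) ⟩
        θ (F ⊛ D) N - + m * (sign * xPowMinusOneₛ m N)
          ≡⟨ cong (λ a → a - + m * (sign * xPowMinusOneₛ m N))
               (trans (θ-cong cofactor-product N) (trans (θ-· sign (xPowMinusOneₛ m) N) (cong (sign *_) (θ-xPowMinusOneₛ m N)))) ⟩
        sign * (+ m * Xpow m 1ₛ N) - + m * (sign * (Xpow m 1ₛ N + - 1ₛ N))
          ≡⟨ cancel sign (+ m) (Xpow m 1ₛ N) (1ₛ N) ⟩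
        sign * + m * 1ₛ N ∎
        where
        open ≡-Reasoning
        D = cofactor
        A = θ D ⊕ ⊝ (+ m · D)
        regroup : ∀ a b c → a + - b + c ≡ (c + a) - b
        regroup = solve-∀
        cancel : ∀ e m x o → e * (m * x) - m * (e * (x + - o)) ≡ e * m * o
        cancel = solve-∀

    annihilator-below-degree≈0 : ∀ R → VanishesFrom R degree → Annihilates m R degree → R ≈ 0ₛ
    annihilator-below-degree≈0 R R≥δ≡0 annR N =
      ℤP.*-cancelˡ-≡ (+ m) (R N) (+ 0)
        (trans (Unit-cancelˡ (+ m * R N) sign-unit (trans (sym (ℤP.*-assoc sign (+ m) (R N))) (trans (κR≈FW N) (⊛-zeroʳ F W≈0 N))))
               (sym (ℤP.*-zeroʳ (+ m))))
      where
      D = cofactor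
      A = θ D ⊕ ⊝ (+ m · D)
      T = R ⊛ L
      W = A ⊛ R ⊕ D ⊛ T
      κ = sign * + m
      κR≈FW : κ · R ≈ F ⊛ W
      κR≈FW = begin
        κ · R                                   ≈⟨ ·-cong κ (≈-sym (⊛-identityˡ R)) ⟩
        κ · (1ₛ ⊛ R)                            ≈⟨ ≈-sym (⊛-·ˡ κ 1ₛ R) ⟩
        (κ · 1ₛ) ⊛ R                            ≈⟨ ⊛-congˡ R (≈-sym bezout) ⟩
        (F ⊛ A ⊕ θ F ⊛ D) ⊛ R                   ≈⟨ ⊛-distribʳ-⊕ (F ⊛ A) (θ F ⊛ D) R ⟩
        (F ⊛ A) ⊛ R ⊕ (θ F ⊛ D) ⊛ R             ≈⟨ ⊕-cong (⊛-assoc F A R) θFDR≈FDT ⟩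
        F ⊛ (A ⊛ R) ⊕ F ⊛ (D ⊛ T)               ≈⟨ ≈-sym (⊛-distribˡ-⊕ F (A ⊛ R) (D ⊛ T)) ⟩
        F ⊛ W                                   ∎
        where
        open ≈-Reasoning
        θFDR≈FDT : (θ F ⊛ D) ⊛ R ≈ F ⊛ (D ⊛ T)
        θFDR≈FDT = begin
          (θ F ⊛ D) ⊛ R           ≈⟨ ⊛-congˡ R (⊛-congˡ D (LogDerivative-cyclotomicₛ m)) ⟩
          ((F ⊛ L) ⊛ D) ⊛ R       ≈⟨ ⊛-assoc (F ⊛ L) D R ⟩
          (F ⊛ L) ⊛ (D ⊛ R)       ≈⟨ ⊛-assoc F L (D ⊛ R) ⟩
          F ⊛ (L ⊛ (D ⊛ R))       ≈⟨ ⊛-congʳ F (≈-trans (⊛-comm L (D ⊛ R)) (⊛-assoc D R L)) ⟩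
          F ⊛ (D ⊛ T)             ∎
      A-vanishes : VanishesFrom A cofactorBound
      A-vanishes = VanishesFrom-⊕ (VanishesFrom-θ cofactor-vanishes) (VanishesFrom-⊝ (VanishesFrom-· (+ m) cofactor-vanishes))
      W-vanishes : VanishesFrom W (cofactorBound ℕ.+ degree)
      W-vanishes = VanishesFrom-⊕ (VanishesFrom-⊛′ A-vanishes R≥δ≡0)
                                  (VanishesFrom-⊛′ cofactor-vanishes (Annihilates⇒⊛-VanishesFrom m R degree R≥δ≡0 annR))
      W≈0 : W ≈ 0ₛ
      W≈0 = unit-leading-⊛-vanishes (cofactorBound ℕ.+ degree) vanishes leading-unit W-vanishes
              (VanishesFrom-cong κR≈FW (VanishesFrom-· κ R≥δ≡0))

    annihilator-multiple : ∀ S B → VanishesFrom S B → Annihilates m S B →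
                           ∃ λ Q → ∃ λ QB → VanishesFrom Q QB × S ≈ Q ⊛ cyclotomicₛ m
    annihilator-multiple S B S≥B≡0 annS = Q , QB , Q≥QB≡0 , S≈QF
      where
      open DivisionResult (divide vanishes leading-unit B S≥B≡0)
        renaming (quotient to Q; remainder to R; quotientBound to QB; quotient-vanishes to Q≥QB≡0
                 ; remainder-vanishes to R≥δ≡0; division to S≈QF+R)
      B′ = B ℕ.+ (QB ℕ.+ suc degree)
      R≈S-QF : R ≈ S ⊕ ⊝ (Q ⊛ F)
      R≈S-QF N = sym (trans (cong (_+ - (Q ⊛ F) N) (S≈QF+R N)) (cancel ((Q ⊛ F) N) (R N)))
        where
        cancel : ∀ a b → a + b - a ≡ b
        cancel = solve-∀
      annR : Annihilates m R degree
      annR l = begin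
        ramanujanPairing m R degree l                                  ≡⟨ sym (ramanujanPairing-extend m degree B′ l R≥δ≡0 δ≤B′) ⟩
        ramanujanPairing m R B′ l                                      ≡⟨ ramanujanPairing-cong m B′ l R≈S-QF ⟩
        ramanujanPairing m (S ⊕ ⊝ (Q ⊛ F)) B′ l                        ≡⟨ ramanujanPairing-⊕ m S (⊝ (Q ⊛ F)) B′ l ⟩
        ramanujanPairing m S B′ l + ramanujanPairing m (⊝ (Q ⊛ F)) B′ l ≡⟨ cong (_+_ (ramanujanPairing m S B′ l)) (ramanujanPairing-⊝ m (Q ⊛ F) B′ l) ⟩
        ramanujanPairing m S B′ l + - ramanujanPairing m (Q ⊛ F) B′ l  ≡⟨ cong₂ (λ a b → a + - b) S-part QF-part ⟩
        + 0                                                            ∎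
        where
        open ≡-Reasoning
        δ≤B′ : degree ≤ B′
        δ≤B′ = ℕP.≤-trans (ℕP.n≤1+n degree) (ℕP.≤-trans (ℕP.m≤n+m (suc degree) QB) (ℕP.m≤n+m (QB ℕ.+ suc degree) B))
        S-part : ramanujanPairing m S B′ l ≡ + 0
        S-part = trans (ramanujanPairing-extend m B B′ l S≥B≡0 (ℕP.m≤m+n B _)) (annS l)
        QF-part : ramanujanPairing m (Q ⊛ F) B′ l ≡ + 0
        QF-part = trans (ramanujanPairing-extend m (QB ℕ.+ suc degree) B′ l (VanishesFrom-⊛′ Q≥QB≡0 vanishes) (ℕP.m≤n+m _ B))
                        (Annihilates-⊛ m (suc degree) vanishes annihilates-Φₘ QB Q Q≥QB≡0 l)
      S≈QF : S ≈ Q ⊛ F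
      S≈QF N = trans (S≈QF+R N) (trans (cong (_+_ ((Q ⊛ F) N)) (annihilator-below-degree≈0 R R≥δ≡0 annR N)) (ℤP.+-identityʳ _))

  module _ {p} (pp : Prime p) {m} .{{_ : NonZero m}} (Φₘ : IsCyclotomicPolynomial m) where

    open IsCyclotomicPolynomial Φₘ

    private
      instance
        p≢0 : NonZero p
        p≢0 = prime⇒nonZero pp

      F = cyclotomicₛ m
      S = dilate p F

      S-vanishes : VanishesFrom S (suc (degree ℕ.* p))
      S-vanishes = VanishesFrom-dilate p vanishes

      S-leading-unit : ∀ {ε} → Unit ε → Unit ((ε · S) (degree ℕ.* p))
      S-leading-unit {ε} unit-ε = subst Unit (sym (cong (ε *_) (dilate-on p F degree))) (Unit-* unit-ε leading-unit)

      dilated-cofactor-vanishes : VanishesFrom (dilate p cofactor) (suc (cofactorBound ℕ.* p))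
      dilated-cofactor-vanishes = VanishesFrom-dilate p (VanishesFrom-mono cofactor-vanishes (ℕP.n≤1+n cofactorBound))

      annihilates-S : ¬ (p ∣ m) → Annihilates m S (suc degree ℕ.* p)
      annihilates-S p∤m = Annihilates-dilate m pp p∤m F (suc degree) vanishes
        (LogDerivative⇒Annihilates m F (suc degree) (LogDerivative-cyclotomicₛ m) vanishes)

      S-cofactor : ∀ ε → (ε · S) ⊛ dilate p cofactor ≈ (ε * sign) · xPowMinusOneₛ (m ℕ.* p)
      S-cofactor ε = begin
        (ε · S) ⊛ dilate p cofactor          ≈⟨ ⊛-·ˡ ε S (dilate p cofactor) ⟩
        ε · (S ⊛ dilate p cofactor)          ≈⟨ ·-cong ε (≈-sym (dilate-⊛ p F cofactor)) ⟩
        ε · dilate p (F ⊛ cofactor)          ≈⟨ ·-cong ε (dilate-cong p cofactor-product) ⟩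
        ε · dilate p (sign · xPowMinusOneₛ m) ≈⟨ ·-cong ε (dilate-· p sign (xPowMinusOneₛ m)) ⟩
        ε · (sign · dilate p (xPowMinusOneₛ m)) ≈⟨ ·-cong ε (·-cong sign (dilate-xPowMinusOneₛ pp m)) ⟩
        ε · (sign · xPowMinusOneₛ (m ℕ.* p))  ≈⟨ ·-assoc ε sign (xPowMinusOneₛ (m ℕ.* p)) ⟩
        (ε * sign) · xPowMinusOneₛ (m ℕ.* p)  ∎
        where open ≈-Reasoning

    IsCyclotomicPolynomial-prime-dividing : p ∣ m → IsCyclotomicPolynomial (m ℕ.* p)
    IsCyclotomicPolynomial-prime-dividing p∣m = from (cyclotomicₛ-prime-dividing pp m p∣m)
      where
      from : (∃ λ ε → Unit ε × cyclotomicₛ (m ℕ.* p) ≈ ε · S) → IsCyclotomicPolynomial (m ℕ.* p)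
      from (ε , unit-ε , Φₘₚ≈εS) = record
        { degree = degree ℕ.* p ; degree≤d = ℕP.*-monoˡ-≤ p degree≤d
        ; vanishes = VanishesFrom-cong (≈-sym Φₘₚ≈εS) (VanishesFrom-· ε S-vanishes)
        ; leading-unit = subst Unit (sym (Φₘₚ≈εS (degree ℕ.* p))) (S-leading-unit unit-ε)
        ; cofactor = dilate p cofactor ; cofactorBound = suc (cofactorBound ℕ.* p) ; cofactor-vanishes = dilated-cofactor-vanishes
        ; sign = ε * sign ; sign-unit = Unit-* unit-ε sign-unit
        ; cofactor-product = ≈-trans (⊛-congˡ (dilate p cofactor) Φₘₚ≈εS) (S-cofactor ε) }

    -- Here Φ_m divides Φ_m(x^p) because the latter annihilates c_m as well; the quotient is ±Φ_{mp}.
    IsCyclotomicPolynomial-prime-coprime : ¬ (p ∣ m) → IsCyclotomicPolynomial (m ℕ.* p)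
    IsCyclotomicPolynomial-prime-coprime p∤m =
      from (cyclotomicₛ-prime-coprime pp m p∤m)
           (annihilator-multiple Φₘ S (suc degree ℕ.* p)
              (VanishesFrom-mono S-vanishes (ℕP.+-monoˡ-≤ (degree ℕ.* p) (ℕ.>-nonZero⁻¹ p))) (annihilates-S p∤m))
      where
      Φₘₚ = cyclotomicₛ (m ℕ.* p)
      from : (∃ λ ε → Unit ε × Φₘₚ ⊛ F ≈ ε · S) → (∃ λ Q → ∃ λ QB → VanishesFrom Q QB × S ≈ Q ⊛ F) →
             IsCyclotomicPolynomial (m ℕ.* p)
      from (ε , unit-ε , ΦₘₚΦₘ≈εS) (Q , QB , Q≥QB≡0 , S≈QF) = record
        { degree = degree ℕ.* p ∸ degree ; degree≤d = ℕP.≤-trans (ℕP.m∸n≤m (degree ℕ.* p) degree) (ℕP.*-monoˡ-≤ p degree≤d)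
        ; vanishes = proj₁ (proj₂ leading) ; leading-unit = proj₂ (proj₂ leading)
        ; cofactor = dilate p cofactor ⊛ F ; cofactorBound = suc (cofactorBound ℕ.* p) ℕ.+ suc degree
        ; cofactor-vanishes = VanishesFrom-⊛′ dilated-cofactor-vanishes vanishes
        ; sign = ε * sign ; sign-unit = Unit-* unit-ε sign-unit
        ; cofactor-product = product }
        where
        Φₘₚ≈εQ : Φₘₚ ≈ ε · Q
        Φₘₚ≈εQ N = ℤP.i-j≡0⇒i≡j (Φₘₚ N) ((ε · Q) N) (⊛-cancel-unit (Φₘₚ ⊕ ⊝ (ε · Q)) F difference≈0 (Unit-cyclotomicₛ-0 m) N)
          where
          difference≈0 : (Φₘₚ ⊕ ⊝ (ε · Q)) ⊛ F ≈ 0ₛ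
          difference≈0 N = begin
            ((Φₘₚ ⊕ ⊝ (ε · Q)) ⊛ F) N               ≡⟨ ⊛-distribʳ-⊕ Φₘₚ (⊝ (ε · Q)) F N ⟩
            (Φₘₚ ⊛ F) N + (⊝ (ε · Q) ⊛ F) N         ≡⟨ cong₂ _+_ (trans (ΦₘₚΦₘ≈εS N) (cong (ε *_) (S≈QF N)))
                                                                (trans (⊛-⊝ˡ (ε · Q) F N) (cong -_ (⊛-·ˡ ε Q F N))) ⟩
            ε * (Q ⊛ F) N + - (ε * (Q ⊛ F) N)       ≡⟨ ℤP.+-inverseʳ (ε * (Q ⊛ F) N) ⟩
            + 0                                     ∎
            where open ≡-Reasoning
        product : Φₘₚ ⊛ (dilate p cofactor ⊛ F) ≈ (ε * sign) · xPowMinusOneₛ (m ℕ.* p)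
        product = begin
          Φₘₚ ⊛ (dilate p cofactor ⊛ F)  ≈⟨ ⊛-congʳ Φₘₚ (⊛-comm (dilate p cofactor) F) ⟩
          Φₘₚ ⊛ (F ⊛ dilate p cofactor)  ≈⟨ ≈-sym (⊛-assoc Φₘₚ F (dilate p cofactor)) ⟩
          (Φₘₚ ⊛ F) ⊛ dilate p cofactor  ≈⟨ ⊛-congˡ (dilate p cofactor) ΦₘₚΦₘ≈εS ⟩
          (ε · S) ⊛ dilate p cofactor    ≈⟨ S-cofactor ε ⟩
          (ε * sign) · xPowMinusOneₛ (m ℕ.* p) ∎
          where open ≈-Reasoning
        leading = quotient-leading QB (VanishesFrom-cong (≈-sym Φₘₚ≈εQ) (VanishesFrom-· ε Q≥QB≡0))
                    vanishes leading-unit (VanishesFrom-· ε S-vanishes) (S-leading-unit unit-ε) ΦₘₚΦₘ≈εS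

  isCyclotomicPolynomial : ∀ d .{{_ : NonZero d}} → IsCyclotomicPolynomial d
  isCyclotomicPolynomial = prime-induction IsCyclotomicPolynomial IsCyclotomicPolynomial-1 step
    where
    step : ∀ {p} m .{{_ : NonZero m}} → Prime p → IsCyclotomicPolynomial m → IsCyclotomicPolynomial (m ℕ.* p)
    step {p} m pp Φₘ with p ∣? m
    ... | yes p∣m = IsCyclotomicPolynomial-prime-dividing pp Φₘ p∣m
    ... | no  p∤m = IsCyclotomicPolynomial-prime-coprime pp Φₘ p∤m

  cyclotomicₛ-vanishes : ∀ d .{{_ : NonZero d}} → VanishesFrom (cyclotomicₛ d) (suc d)
  cyclotomicₛ-vanishes d = VanishesFrom-mono vanishes (s≤s degree≤d)
    where open IsCyclotomicPolynomial (isCyclotomicPolynomial d)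

  cyclotomicₛ-annihilates : ∀ d .{{_ : NonZero d}} → Annihilates d (cyclotomicₛ d) (suc d)
  cyclotomicₛ-annihilates d = LogDerivative⇒Annihilates d (cyclotomicₛ d) (suc d) (LogDerivative-cyclotomicₛ d) (cyclotomicₛ-vanishes d)

  open PZ using (coeff; padd; pmul)

  coeff-padd : ∀ p q N → coeff (padd p q) N ≡ coeff p N + coeff q N
  coeff-padd []      q       N       = sym (ℤP.+-identityˡ _)
  coeff-padd (c ∷ p) []      N       = sym (ℤP.+-identityʳ _)
  coeff-padd (c ∷ p) (e ∷ q) zero    = refl
  coeff-padd (c ∷ p) (e ∷ q) (suc N) = coeff-padd p q N

  coeff-map-* : ∀ c q N → coeff (map (c *_) q) N ≡ c * coeff q N
  coeff-map-* c []      N       = sym (ℤP.*-zeroʳ c)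
  coeff-map-* c (x ∷ q) zero    = refl
  coeff-map-* c (x ∷ q) (suc N) = coeff-map-* c q N

  coeff-pmul : ∀ p q → coeff (pmul p q) ≈ coeff p ⊛ coeff q
  coeff-pmul []      q N       = sym (⊛-zeroˡ (coeff q) (λ _ → refl) N)
  coeff-pmul (c ∷ p) q zero    = trans (coeff-padd (map (c *_) q) (+ 0 ∷ pmul p q) 0)
                                       (trans (cong (_+ + 0) (coeff-map-* c q 0)) (ℤP.+-identityʳ _))
  coeff-pmul (c ∷ p) q (suc N) = trans (coeff-padd (map (c *_) q) (+ 0 ∷ pmul p q) (suc N))
                                       (cong₂ _+_ (coeff-map-* c q (suc N)) (coeff-pmul p q N))

  coeff-1 : coeff (+ 1 ∷ []) ≈ 1ₛ
  coeff-1 zero    = refl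
  coeff-1 (suc N) = refl

  coeff-product : ∀ {A : Set} (g : A → List ℤ) xs → coeff (foldr pmul (+ 1 ∷ []) (map g xs)) ≈ foldr _⊛_ 1ₛ (map (λ x → coeff (g x)) xs)
  coeff-product g []       = coeff-1
  coeff-product g (x ∷ xs) = ≈-trans (coeff-pmul (g x) _) (⊛-congʳ (coeff (g x)) (coeff-product g xs))

  infix 4 _≈[≤_]_

  _≈[≤_]_ : Series → ℕ → Series → Set
  f ≈[≤ D ] g = ∀ k → k ≤ D → f k ≡ g k

  ⊛-local : ∀ {f f′ g g′} D → f ≈[≤ D ] f′ → g ≈[≤ D ] g′ → f ⊛ g ≈[≤ D ] f′ ⊛ g′
  ⊛-local {f} {f′} {g} {g′} D f≈f′ g≈g′ N N≤D = begin
    (f ⊛ g) N                             ≡⟨ ⊛-coeff f g N ⟩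
    ∑ (suc N) (λ k → f k * g (N ∸ k))     ≡⟨ ∑-cong-< (suc N) (λ k k≤N → cong₂ _*_ (f≈f′ k (ℕP.≤-trans (ℕP.≤-pred k≤N) N≤D))
                                                                         (g≈g′ (N ∸ k) (ℕP.≤-trans (ℕP.m∸n≤m N k) N≤D))) ⟩
    ∑ (suc N) (λ k → f′ k * g′ (N ∸ k))   ≡⟨ sym (⊛-coeff f′ g′ N) ⟩
    (f′ ⊛ g′) N                           ∎
    where open ≡-Reasoning

  product-local : ∀ {A : Set} (g h : A → Series) D → (∀ x → g x ≈[≤ D ] h x) → ∀ xs →
                  foldr _⊛_ 1ₛ (map g xs) ≈[≤ D ] foldr _⊛_ 1ₛ (map h xs)
  product-local g h D g≈h []       N _ = refl
  product-local g h D g≈h (x ∷ xs)     = ⊛-local D (g≈h x) (product-local g h D g≈h xs)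

  coeff-xPowMinusOne : ∀ k → coeff (xPowMinusOne (suc k)) ≈ xPowMinusOneₛ (suc k)
  coeff-xPowMinusOne k zero    = refl
  coeff-xPowMinusOne k (suc n) = trans (monomial-coeff k n) (sym (ℤP.+-identityʳ _))
    where
    monomial-coeff : ∀ k n → coeff (replicate k (+ 0) ++ (+ 1 ∷ [])) n ≡ Xpow k 1ₛ n
    monomial-coeff zero    n       = coeff-1 n
    monomial-coeff (suc k) zero    = refl
    monomial-coeff (suc k) (suc n) = monomial-coeff k n

  coeff-invXPowMinusOne : ∀ k D → coeff (invXPowMinusOne k D) ≈[≤ D ] invXPowMinusOneₛ (suc k)
  coeff-invXPowMinusOne k D N N≤D = coeff-applyUpTo (suc D) (λ x → x) N (s≤s N≤D)
    where
    coeff-applyUpTo : ∀ n (f : ℕ → ℕ) N → N < n →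
      coeff (map (λ j → if suc k ∣ᵇ j then -[1+ 0 ] else + 0) (applyUpTo f n)) N ≡ invXPowMinusOneₛ (suc k) (f N)
    coeff-applyUpTo (suc n) f zero    _         = refl
    coeff-applyUpTo (suc n) f (suc N) (s≤s N<n) = coeff-applyUpTo n (λ x → f (suc x)) N N<n

  coeff-cycloFactor : ∀ d k → coeff (cycloFactor d k) ≈[≤ d ] cycloFactorₛ d k
  coeff-cycloFactor d k N N≤d with μ (d / suc k)
  ... | + 1           = coeff-xPowMinusOne k N
  ... | -[1+ 0 ]      = coeff-invXPowMinusOne k d N N≤d
  ... | + 0           = coeff-1 N
  ... | + suc (suc _) = coeff-1 N
  ... | -[1+ suc _ ]  = coeff-1 N

  coeff-take-< : ∀ n (L : List ℤ) N → N < n → coeff (take n L) N ≡ coeff L N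
  coeff-take-< (suc n) []      N       _         = refl
  coeff-take-< (suc n) (x ∷ L) zero    _         = refl
  coeff-take-< (suc n) (x ∷ L) (suc N) (s≤s N<n) = coeff-take-< n L N N<n

  coeff-take-≥ : ∀ n (L : List ℤ) N → n ≤ N → coeff (take n L) N ≡ + 0
  coeff-take-≥ zero    L       N       _         = refl
  coeff-take-≥ (suc n) []      N       _         = refl
  coeff-take-≥ (suc n) (x ∷ L) (suc N) (s≤s n≤N) = coeff-take-≥ n L N n≤N

  cyclotomic≈cyclotomicₛ : ∀ d .{{_ : NonZero d}} → coeff (cyclotomic d) ≈ cyclotomicₛ d
  cyclotomic≈cyclotomicₛ d N = by-cases (N ℕP.<? suc d)
    where
    open ≡-Reasoning
    L = foldr pmul (+ 1 ∷ []) (map (cycloFactor d) (divisorsPred d))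
    by-cases : Dec (N < suc d) → coeff (take (suc d) L) N ≡ cyclotomicₛ d N
    by-cases (yes N≤d) = begin
      coeff (take (suc d) L) N                                                ≡⟨ coeff-take-< (suc d) L N N≤d ⟩
      coeff L N                                                               ≡⟨ coeff-product (cycloFactor d) (divisorsPred d) N ⟩
      foldr _⊛_ 1ₛ (map (λ k → coeff (cycloFactor d k)) (divisorsPred d)) N
        ≡⟨ product-local _ _ d (coeff-cycloFactor d) (divisorsPred d) N (ℕP.≤-pred N≤d) ⟩
      cyclotomicₛ d N                                                         ∎
    by-cases (no N≰d) = trans (coeff-take-≥ (suc d) L N (ℕP.≮⇒≥ N≰d)) (sym (cyclotomicₛ-vanishes d N (ℕP.≮⇒≥ N≰d)))

  length-cyclotomic : ∀ d → length (cyclotomic d) ≤ suc d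
  length-cyclotomic d = ℕP.≤-trans (ℕP.≤-reflexive (length-take (suc d) L)) (ℕP.m⊓n≤m (suc d) (length L))
    where
    L = foldr pmul (+ 1 ∷ []) (map (cycloFactor d) (divisorsPred d))

  cyclotomic-annihilates : ∀ d .{{_ : NonZero d}} → Annihilates d (coeff (cyclotomic d)) (suc d)
  cyclotomic-annihilates d l =
    trans (ramanujanPairing-cong d (suc d) l (cyclotomic≈cyclotomicₛ d)) (cyclotomicₛ-annihilates d l)


open import Defs
open import Data.Nat as ℕ using (ℕ; zero; suc; NonZero; _≤_; s≤s; z≤n)
open import Data.Nat.Divisibility using (_∣_)
import Data.Nat.Coprimality as ℕC
open import Data.Integer as ℤ using (ℤ; +_; -[1+_])
import Data.Integer.Properties as ℤP
open import Data.Rational as ℚ using (ℚ; _/_; mkℚ)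
import Data.Rational.Properties as ℚP
open import Data.Rational.Properties using (+-*-rawRing)
open import Algebra.Bundles using (CommutativeRing)
open import Algebra.Morphism.Structures using (module RingMorphisms)
import Algebra.Properties.Ring as RingProperties
open import Data.Bool using (true; false; if_then_else_)
open import Data.List using (List; []; _∷_; foldr; map; filterᵇ; upTo; length)
open import Data.Product using (_,_)
import Relation.Binary.PropositionalEquality as ≡
open RamanujanSums using (∑; ∑-truncate; ∑∣-ramanujan; foldr-divisorsPred; _when_; ∣ᵇ≡true⇒∣)
open Cyclotomic using (cyclotomic-annihilates; length-cyclotomic)

-- Integers as rationals with denominator 1: numerator arithmetic is then literally that of ℚ.
private
  coprime-to-1 : ∀ z → ℕC.Coprime ℤ.∣ z ∣ 1
  coprime-to-1 z = ℕC.sym (ℕC.1-coprimeTo ℤ.∣ z ∣)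

  /1≡mkℚ : ∀ z → z / 1 ≡.≡ mkℚ z 0 (coprime-to-1 z)
  /1≡mkℚ (+ n)    = ℚP.normalize-coprime (coprime-to-1 (+ n))
  /1≡mkℚ -[1+ n ] = ≡.cong ℚ.-_ (ℚP.normalize-coprime (coprime-to-1 (+ suc n)))

  /1-+ : ∀ a b → (a ℤ.+ b) / 1 ≡.≡ (a / 1) ℚ.+ (b / 1)
  /1-+ a b = ≡.trans (≡.cong (_/ 1) (≡.cong₂ ℤ._+_ (≡.sym (ℤP.*-identityʳ a)) (≡.sym (ℤP.*-identityʳ b))))
                     (≡.sym (≡.cong₂ ℚ._+_ (/1≡mkℚ a) (/1≡mkℚ b)))

  /1-* : ∀ a b → (a ℤ.* b) / 1 ≡.≡ (a / 1) ℚ.* (b / 1)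
  /1-* a b = ≡.sym (≡.cong₂ ℚ._*_ (/1≡mkℚ a) (/1≡mkℚ b))

  1/n*n≡1 : ∀ n .{{_ : NonZero n}} → (+ 1 / n) ℚ.* (+ n / 1) ≡.≡ ℚ.1ℚ
  1/n*n≡1 (suc k) = ≡.trans (≡.cong₂ ℚ._*_ (ℚP.normalize-coprime (ℕC.1-coprimeTo (suc k))) (/1≡mkℚ (+ suc k)))
                            (ℚP.*-inverseˡ (mkℚ (+ suc k) 0 (coprime-to-1 (+ suc k))))

module QAlgebra {c ℓ} (K : CommutativeRing c ℓ) (φ : ℚ → CommutativeRing.Carrier K)
                (hom : RingMorphisms.IsRingHomomorphism +-*-rawRing (CommutativeRing.rawRing K) φ) where

  open CommutativeRing K
  open QAlg K φ
  open RingProperties ring using (-‿distribˡ-*)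
  open import Algebra.Properties.AbelianGroup +-abelianGroup using (⁻¹-∙-comm; ε⁻¹≈ε; x∙y⁻¹≈ε⇒x≈y)
  open import Relation.Binary.Reasoning.Setoid setoid
  private
    module φ = RingMorphisms.IsRingHomomorphism hom

  ≡⇒≈ : ∀ {x y} → x ≡.≡ y → x ≈ y
  ≡⇒≈ ≡.refl = refl

  ι-+ : ∀ a b → ι (a ℤ.+ b) ≈ ι a + ι b
  ι-+ a b = trans (≡⇒≈ (≡.cong φ (/1-+ a b))) (φ.+-homo (a / 1) (b / 1))

  ι-* : ∀ a b → ι (a ℤ.* b) ≈ ι a * ι b
  ι-* a b = trans (≡⇒≈ (≡.cong φ (/1-* a b))) (φ.*-homo (a / 1) (b / 1))

  ι-0 : ι (+ 0) ≈ 0#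
  ι-0 = φ.0#-homo

  φ[1/n]*ι[n]≈1 : ∀ n .{{_ : NonZero n}} → φ (+ 1 / n) * ι (+ n) ≈ 1#
  φ[1/n]*ι[n]≈1 n = trans (sym (φ.*-homo (+ 1 / n) (+ n / 1))) (trans (≡⇒≈ (≡.cong φ (1/n*n≡1 n))) φ.1#-homo)

  interchange : ∀ a b x y → (a + b) + (x + y) ≈ (a + x) + (b + y)
  interchange a b x y = begin
    (a + b) + (x + y)   ≈⟨ +-assoc a b (x + y) ⟩
    a + (b + (x + y))   ≈⟨ +-congˡ (sym (+-assoc b x y)) ⟩
    a + ((b + x) + y)   ≈⟨ +-congˡ (+-congʳ (+-comm b x)) ⟩
    a + ((x + b) + y)   ≈⟨ +-congˡ (+-assoc x b y) ⟩
    a + (x + (b + y))   ≈⟨ sym (+-assoc a x (b + y)) ⟩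
    (a + x) + (b + y)   ∎

  weightedSum : (ℕ → Carrier) → Poly → Carrier
  weightedSum w []      = 0#
  weightedSum w (x ∷ p) = x * w 0 + weightedSum (λ s → w (suc s)) p

  sumTo-suc : ∀ n (f : ℕ → Carrier) → sumTo (suc n) f ≈ f 0 + sumTo n (λ k → f (suc k))
  sumTo-suc zero    f = trans (+-identityˡ (f 0)) (sym (+-identityʳ (f 0)))
  sumTo-suc (suc n) f = trans (+-congʳ (sumTo-suc n f)) (+-assoc (f 0) _ _)

  sumTo-cong : ∀ n {f g : ℕ → Carrier} → (∀ k → f k ≈ g k) → sumTo n f ≈ sumTo n g
  sumTo-cong zero    f≈g = refl
  sumTo-cong (suc n) f≈g = +-cong (sumTo-cong n f≈g) (f≈g n)

  sumTo≈weightedSum : ∀ (w : ℕ → Carrier) p → sumTo (length p) (λ s → coeff p s * w s) ≈ weightedSum w p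
  sumTo≈weightedSum w []      = refl
  sumTo≈weightedSum w (x ∷ p) = trans (sumTo-suc (length p) (λ s → coeff (x ∷ p) s * w s)) (+-congˡ (sumTo≈weightedSum (λ s → w (suc s)) p))

  weightedSum-congʷ : ∀ p {w w′ : ℕ → Carrier} → (∀ s → w s ≈ w′ s) → weightedSum w p ≈ weightedSum w′ p
  weightedSum-congʷ []      w≈w′ = refl
  weightedSum-congʷ (x ∷ p) w≈w′ = +-cong (*-congˡ (w≈w′ 0)) (weightedSum-congʷ p (λ s → w≈w′ (suc s)))

  weightedSum-zero : ∀ p (w : ℕ → Carrier) → (∀ s → coeff p s ≈ 0#) → weightedSum w p ≈ 0#
  weightedSum-zero []      w p≈0 = refl
  weightedSum-zero (x ∷ p) w p≈0 = trans (+-cong (trans (*-congʳ (p≈0 0)) (zeroˡ (w 0))) (weightedSum-zero p _ (λ s → p≈0 (suc s)))) (+-identityˡ 0#)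

  weightedSum-congᶜ : ∀ p q (w : ℕ → Carrier) → (∀ s → coeff p s ≈ coeff q s) → weightedSum w p ≈ weightedSum w q
  weightedSum-congᶜ []      q       w p≈q = sym (weightedSum-zero q w (λ s → sym (p≈q s)))
  weightedSum-congᶜ (x ∷ p) []      w p≈q = weightedSum-zero (x ∷ p) w p≈q
  weightedSum-congᶜ (x ∷ p) (y ∷ q) w p≈q = +-cong (*-congʳ (p≈q 0)) (weightedSum-congᶜ p q _ (λ s → p≈q (suc s)))

  weightedSum-padd : ∀ p q (w : ℕ → Carrier) → weightedSum w (padd p q) ≈ weightedSum w p + weightedSum w q
  weightedSum-padd []      q       w = sym (+-identityˡ _)
  weightedSum-padd (x ∷ p) []      w = sym (+-identityʳ _)
  weightedSum-padd (x ∷ p) (y ∷ q) w = trans (+-cong (distribʳ (w 0) x y) (weightedSum-padd p q _)) (interchange _ _ _ _)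

  weightedSum-pneg : ∀ p (w : ℕ → Carrier) → weightedSum w (pneg p) ≈ - weightedSum w p
  weightedSum-pneg []      w = sym ε⁻¹≈ε
  weightedSum-pneg (x ∷ p) w = trans (+-cong (sym (-‿distribˡ-* x (w 0))) (weightedSum-pneg p _)) (⁻¹-∙-comm _ _)

  weightedSum-scale : ∀ a q (w : ℕ → Carrier) → weightedSum w (map (a *_) q) ≈ a * weightedSum w q
  weightedSum-scale a []      w = sym (zeroʳ a)
  weightedSum-scale a (x ∷ q) w = trans (+-cong (*-assoc a x (w 0)) (weightedSum-scale a q _)) (sym (distribˡ a _ _))

  weightedSum-*ʷ : ∀ p a (w : ℕ → Carrier) → a * weightedSum w p ≈ weightedSum (λ s → a * w s) p
  weightedSum-*ʷ []      a w = zeroʳ a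
  weightedSum-*ʷ (x ∷ p) a w = trans (distribˡ a _ _)
    (+-cong (trans (sym (*-assoc a x (w 0))) (trans (*-congʳ (*-comm a x)) (*-assoc x a (w 0)))) (weightedSum-*ʷ p a _))

  foldr-weightedSum : ∀ (w : ℕ → ℕ → Carrier) p ks →
    foldr _+_ 0# (map (λ k → weightedSum (w k) p) ks) ≈ weightedSum (λ s → foldr _+_ 0# (map (λ k → w k s) ks)) p
  foldr-weightedSum w p []       = sym (weightedSum-zero′ p)
    where
    weightedSum-zero′ : ∀ p → weightedSum (λ _ → 0#) p ≈ 0#
    weightedSum-zero′ []      = refl
    weightedSum-zero′ (x ∷ p) = trans (+-cong (zeroʳ x) (weightedSum-zero′ p)) (+-identityˡ 0#)
  foldr-weightedSum w p (k ∷ ks) = trans (+-congˡ (foldr-weightedSum w p ks)) (weightedSum-+ʷ p (w k) _)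
    where
    weightedSum-+ʷ : ∀ p (w₁ w₂ : ℕ → Carrier) → weightedSum w₁ p + weightedSum w₂ p ≈ weightedSum (λ s → w₁ s + w₂ s) p
    weightedSum-+ʷ []      w₁ w₂ = +-identityˡ 0#
    weightedSum-+ʷ (x ∷ p) w₁ w₂ = trans (interchange _ _ _ _) (+-cong (sym (distribˡ x (w₁ 0) (w₂ 0))) (weightedSum-+ʷ p _ _))

  weightedSum-ι : ∀ (v : ℕ → ℤ) L → weightedSum (λ s → ι (v s)) (map ι L) ≈ ι (∑ (length L) (λ k → PZ.coeff L k ℤ.* v k))
  weightedSum-ι v []      = sym ι-0
  weightedSum-ι v (x ∷ L) = trans (+-cong (sym (ι-* x (v 0))) (weightedSum-ι (λ s → v (suc s)) L))
                                 (sym (ι-+ (x ℤ.* v 0) (∑ (length L) (λ k → PZ.coeff L k ℤ.* v (suc k)))))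

  foldr-ι : ∀ (r : ℕ → ℤ) ks → foldr _+_ 0# (map (λ k → ι (r k)) ks) ≈ ι (foldr ℤ._+_ (+ 0) (map r ks))
  foldr-ι r []       = sym ι-0
  foldr-ι r (k ∷ ks) = trans (+-congˡ (foldr-ι r ks)) (sym (ι-+ (r k) (foldr ℤ._+_ (+ 0) (map r ks))))

  sumDivisors-cong : ∀ n (f g : ℕ → Carrier) → (∀ d → 1 ≤ d → d ∣ n → f d ≈ g d) → sumDivisors n f ≈ sumDivisors n g
  sumDivisors-cong n f g f≈g = filtered (upTo n)
    where
    filtered : ∀ ks → foldr _+_ 0# (map (λ k → f (suc k)) (filterᵇ (λ k → suc k ∣ᵇ n) ks))
                    ≈ foldr _+_ 0# (map (λ k → g (suc k)) (filterᵇ (λ k → suc k ∣ᵇ n) ks))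
    filtered []       = refl
    filtered (k ∷ ks) with suc k ∣ᵇ n in k∣n
    ... | true  = +-cong (f≈g (suc k) (s≤s z≤n) (∣ᵇ≡true⇒∣ k∣n)) (filtered ks)
    ... | false = filtered ks

  ramanujanWeight : ℕ → ℤ → ℕ → Carrier
  ramanujanWeight d i s = ι (ramanujan d (i ℤ.- + s))

  weightedSum-Φ : ∀ d .{{_ : NonZero d}} i → weightedSum (ramanujanWeight d i) (Φ d) ≈ 0#
  weightedSum-Φ d i = begin
    weightedSum (ramanujanWeight d i) (map ι L)                    ≈⟨ weightedSum-ι (λ s → ramanujan d (i ℤ.- + s)) L ⟩
    ι (∑ (length L) (λ k → PZ.coeff L k ℤ.* ramanujan d (i ℤ.- + k))) ≈⟨ ≡⇒≈ (≡.cong ι extend) ⟩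
    ι (∑ (suc d) (λ k → PZ.coeff L k ℤ.* ramanujan d (i ℤ.- + k))) ≈⟨ ≡⇒≈ (≡.cong ι (cyclotomic-annihilates d i)) ⟩
    ι (+ 0)                                                         ≈⟨ ι-0 ⟩
    0#                                                              ∎
    where
    L = cyclotomic d
    coeff-beyond-length : ∀ (L : List ℤ) k → length L ≤ k → PZ.coeff L k ≡.≡ + 0
    coeff-beyond-length []      k       _         = ≡.refl
    coeff-beyond-length (x ∷ L) (suc k) (s≤s L≤k) = coeff-beyond-length L k L≤k
    extend : ∑ (length L) (λ k → PZ.coeff L k ℤ.* ramanujan d (i ℤ.- + k)) ≡.≡ ∑ (suc d) (λ k → PZ.coeff L k ℤ.* ramanujan d (i ℤ.- + k))
    extend = ≡.sym (∑-truncate (length L) (suc d) _ (length-cyclotomic d)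
                       (λ k L≤k → ≡.cong (ℤ._* ramanujan d (i ℤ.- + k)) (coeff-beyond-length L k L≤k)))

  weightedSum-multiple-of-Φ : ∀ d .{{_ : NonZero d}} t i → weightedSum (ramanujanWeight d i) (pmul t (Φ d)) ≈ 0#
  weightedSum-multiple-of-Φ d []      i = refl
  weightedSum-multiple-of-Φ d (x ∷ t) i = begin
    weightedSum (ramanujanWeight d i) (padd (map (x *_) (Φ d)) (0# ∷ pmul t (Φ d)))
      ≈⟨ weightedSum-padd (map (x *_) (Φ d)) (0# ∷ pmul t (Φ d)) (ramanujanWeight d i) ⟩
    weightedSum (ramanujanWeight d i) (map (x *_) (Φ d)) + (0# * ramanujanWeight d i 0 + weightedSum (λ s → ramanujanWeight d i (suc s)) (pmul t (Φ d)))
      ≈⟨ +-cong (trans (weightedSum-scale x (Φ d) (ramanujanWeight d i)) (trans (*-congˡ (weightedSum-Φ d i)) (zeroʳ x)))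
                (+-cong (zeroˡ _) (trans (weightedSum-congʷ (pmul t (Φ d)) shift) (weightedSum-multiple-of-Φ d t (i ℤ.- + 1)))) ⟩
    0# + (0# + 0#)
      ≈⟨ trans (+-identityˡ _) (+-identityˡ 0#) ⟩
    0# ∎
    where
    shift : ∀ s → ramanujanWeight d i (suc s) ≈ ramanujanWeight d (i ℤ.- + 1) s
    shift s = ≡⇒≈ (≡.cong (λ z → ι (ramanujan d z)) (reassoc i s))
      where
      reassoc : ∀ i s → i ℤ.- + suc s ≡.≡ (i ℤ.- + 1) ℤ.- + s
      reassoc i s = ≡.trans (≡.cong (λ x → i ℤ.+ ℤ.- x) (ℤP.pos-+ 1 s))
                      (≡.trans (≡.cong (ℤ._+_ i) (ℤP.neg-distrib-+ (+ 1) (+ s))) (≡.sym (ℤP.+-assoc i (ℤ.- + 1) (ℤ.- + s))))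

  G-mod-Φ : ∀ d .{{_ : NonZero d}} i (p q : Poly) → p ≡ q mod Φ d → G d i p ≈ G d i q
  G-mod-Φ d i p q (t , p-q≈tΦ) = begin
    G d i p                     ≈⟨ sumTo≈weightedSum w p ⟩
    weightedSum w p             ≈⟨ x∙y⁻¹≈ε⇒x≈y _ _ difference≈0 ⟩
    weightedSum w q             ≈⟨ sym (sumTo≈weightedSum w q) ⟩
    G d i q                     ∎
    where
    w = ramanujanWeight d i
    difference≈0 : weightedSum w p + - weightedSum w q ≈ 0#
    difference≈0 = begin
      weightedSum w p + - weightedSum w q        ≈⟨ +-congˡ (sym (weightedSum-pneg q w)) ⟩
      weightedSum w p + weightedSum w (pneg q)   ≈⟨ sym (weightedSum-padd p (pneg q) w) ⟩
      weightedSum w (psub p q)                   ≈⟨ weightedSum-congᶜ (psub p q) (pmul t (Φ d)) w p-q≈tΦ ⟩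
      weightedSum w (pmul t (Φ d))               ≈⟨ weightedSum-multiple-of-Φ d t i ⟩
      0#                                         ∎

  averaged-ramanujan : ∀ n .{{_ : NonZero n}} i s →
    φ (+ 1 / n) * sumDivisors n (λ d → ramanujanWeight d i s) ≈ (if n ∣ᵇ ℤ.∣ (+ s) ℤ.- i ∣ then 1# else 0#)
  averaged-ramanujan n i s = begin
    φ (+ 1 / n) * sumDivisors n (λ d → ramanujanWeight d i s)
      ≈⟨ *-congˡ (foldr-ι (λ k → ramanujan (suc k) (i ℤ.- + s)) (divisorsPred n)) ⟩
    φ (+ 1 / n) * ι (foldr ℤ._+_ (+ 0) (map (λ k → ramanujan (suc k) (i ℤ.- + s)) (divisorsPred n)))
      ≈⟨ *-congˡ (≡⇒≈ (≡.cong ι (≡.trans (foldr-divisorsPred n (λ d → ramanujan d (+ N))) (∑∣-ramanujan n N)))) ⟩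
    φ (+ 1 / n) * ι (+ n when (n ∣ᵇ N))
      ≈⟨ indicator (n ∣ᵇ N) ⟩
    (if n ∣ᵇ N then 1# else 0#)
      ≈⟨ ≡⇒≈ (≡.cong (λ k → if n ∣ᵇ k then 1# else 0#) (ℤP.∣i-j∣≡∣j-i∣ i (+ s))) ⟩
    (if n ∣ᵇ ℤ.∣ (+ s) ℤ.- i ∣ then 1# else 0#) ∎
    where
    N = ℤ.∣ i ℤ.- + s ∣
    indicator : ∀ b → φ (+ 1 / n) * ι (+ n when b) ≈ (if b then 1# else 0#)
    indicator true  = φ[1/n]*ι[n]≈1 n
    indicator false = trans (*-congˡ ι-0) (zeroʳ _)

  if-1# : ∀ b x → (if b then x else 0#) ≈ x * (if b then 1# else 0#)
  if-1# true  x = sym (*-identityʳ x)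
  if-1# false x = sym (zeroʳ x)

theorem3p4 : ∀ {c ℓ} (K : CommutativeRing c ℓ) (φ : ℚ → CommutativeRing.Carrier K) →
    RingMorphisms.IsRingHomomorphism +-*-rawRing (CommutativeRing.rawRing K) φ →
    let open CommutativeRing K
        open QAlg K φ
    in (a : Poly) (n : ℕ) .{{_ : NonZero n}} (i : ℤ) (m : ℕ → Poly) →
       (∀ d → 1 ≤ d → d ∣ n → m d ≡ a mod Φ d) →
       S i n a ≈ φ ((+ 1) / n) * sumDivisors n (λ d → G d i (m d))
theorem3p4 K φ hom a n i m m≡a = begin
  S i n a                                                          ≈⟨ sumTo-cong (length a) (λ j → if-1# (n ∣ᵇ ℤ.∣ + j ℤ.- i ∣) (coeff a j)) ⟩
  sumTo (length a) (λ j → coeff a j * congruent j)                   ≈⟨ sumTo≈weightedSum congruent a ⟩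
  weightedSum congruent a                                           ≈⟨ weightedSum-congʷ a (λ s → sym (averaged-ramanujan n i s)) ⟩
  weightedSum (λ s → φ (+ 1 / n) * sumDivisors n (λ d → ramanujanWeight d i s)) a
                                                                   ≈⟨ sym (weightedSum-*ʷ a (φ (+ 1 / n)) _) ⟩
  φ (+ 1 / n) * weightedSum (λ s → sumDivisors n (λ d → ramanujanWeight d i s)) a
                                                                   ≈⟨ *-congˡ (sym (foldr-weightedSum (λ k → ramanujanWeight (suc k) i) a (divisorsPred n))) ⟩
  φ (+ 1 / n) * sumDivisors n (λ d → weightedSum (ramanujanWeight d i) a)
                                                                   ≈⟨ *-congˡ (sumDivisors-cong n _ _ G[a]≈G[m]) ⟩
  φ (+ 1 / n) * sumDivisors n (λ d → G d i (m d))                  ∎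
  where
  open CommutativeRing K
  open QAlg K φ
  open QAlgebra K φ hom
  open import Relation.Binary.Reasoning.Setoid setoid
  congruent : ℕ → Carrier
  congruent j = if n ∣ᵇ ℤ.∣ + j ℤ.- i ∣ then 1# else 0#
  G[a]≈G[m] : ∀ d → 1 ≤ d → d ∣ n → weightedSum (ramanujanWeight d i) a ≈ G d i (m d)
  G[a]≈G[m] d 1≤d d∣n = sym (trans (G-mod-Φ d {{ℕ.>-nonZero 1≤d}} i (m d) a (m≡a d 1≤d d∣n)) (sumTo≈weightedSum _ a))
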